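{- $\textsc{Ramsey}$ is many-one reducible to $\textsc{Weak long choice}$.
   Context: Strings are binary, $[a]=\{0,\dots,a-1\}$. A TFNP problem is given by a polynomial-time $R(x,y)$ and polynomial $p$ with $\forall x\exists y\in[2^{p(|x|)}]R(x,y)$; task: given $x$ find such $y$. $Q\le R$ if there are polynomial-time $f,g$ with $R(f(u),y)\to Q(u,g(u,y))$ for all $u,y$. $\textsc{Ramsey}$: given a circuit defining an undirected graph on $[2^n]$, find a clique or an independent set of size at least $n/2$. For $0/1$-valued functions $P_0,\dots,P_{m-1}$, where $P_i(x_0,\dots,x_i,z)$ takes $i+2$ arguments, and bits $b_0,\dots,b_{\ell-1}$ with $\ell\le m$, a sequence of $k$ distinct strings $a_0,\dots,a_{k-1}$ is a $\vec b$-sequence for $\vec P$ if $P_i(a_0,\dots,a_i,a_j)=b_i$ whenever $i<j$, $i<\ell$, $j<k$. $\textsc{Weak long choice}$: given circuits for $0/1$-valued functions $P_0,\dots,P_{n-2}$, where $P_i$ takes $i+2$ arguments in $[2^{n+1}]$, find bits $b_0,\dots,b_{n-2}$ and $a_0,\dots,a_n\in[2^{n+1}]$ such that $\vec a$ is a $\vec b$-sequence for $\vec P$. -}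

module Defs where

open import Data.Bool using (Bool; true; false)
open import Data.Nat using (ℕ; zero; suc; _+_; _*_; _∸_; _≤_; _<_)
open import Data.Fin using (Fin; toℕ)
import Data.Fin as Fin
open import Data.List using (List; []; _∷_; _++_; length; take; concat)
import Data.List as List
open import Data.Vec using (Vec; []; _∷_)
import Data.Vec as Vec
open import Data.Maybe using (Maybe; just; nothing)
open import Data.Product using (Σ; Σ-syntax; _×_; _,_)
open import Data.Sum using (_⊎_)
open import Data.Unit using (⊤)
open import Data.List.Relation.Unary.All using (All)
open import Data.List.Relation.Unary.AllPairs using (AllPairs)
open import Relation.Binary.PropositionalEquality using (_≡_; _≢_)

W : Set
W = List Bool

-- Polynomial-time functions: Bellantoni–Cook safe-recursion algebra BC
-- over binary words (head of a list = the last / least significant bit).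
-- BC n s : functions with n normal and s safe arguments.
-- By the Bellantoni–Cook theorem, the BC functions with only normal
-- arguments are exactly the polynomial-time computable functions (FP).

data BC : ℕ → ℕ → Set where
  zer   : BC 0 0
  projN : ∀ {n s} → Fin n → BC n s
  projS : ∀ {n s} → Fin s → BC n s
  suc0  : BC 0 1
  suc1  : BC 0 1
  pred  : BC 0 1
  cond  : BC 0 3
  srec  : ∀ {n s} → BC n s → BC (suc n) (suc s) → BC (suc n) (suc s) → BC (suc n) s
          -- f(ε,x;a) = g(x;a), f(yi,x;a) = h_i(y,x; f(y,x;a), a)
  scomp : ∀ {n s k l} → BC k l → Vec (BC n 0) k → Vec (BC n s) l → BC n s
          -- f(x;a) = h(r(x;) ; t(x;a))

mutual
  ⟦_⟧ : ∀ {n s} → BC n s → Vec W n → Vec W s → W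
  ⟦ zer ⟧ xs as = []
  ⟦ projN i ⟧ xs as = Vec.lookup xs i
  ⟦ projS i ⟧ xs as = Vec.lookup as i
  ⟦ suc0 ⟧ xs (a ∷ []) = false ∷ a
  ⟦ suc1 ⟧ xs (a ∷ []) = true ∷ a
  ⟦ pred ⟧ xs ([] ∷ []) = []
  ⟦ pred ⟧ xs ((_ ∷ a) ∷ []) = a
  ⟦ cond ⟧ xs ((true ∷ _) ∷ b ∷ c ∷ []) = c
  ⟦ cond ⟧ xs (_ ∷ b ∷ c ∷ []) = b
  ⟦ srec g h0 h1 ⟧ (y ∷ xs) as = recEval g h0 h1 y xs as
  ⟦ scomp h rs ts ⟧ xs as = ⟦ h ⟧ (evalsN rs xs) (evals ts xs as)

  recEval : ∀ {n s} → BC n s → BC (suc n) (suc s) → BC (suc n) (suc s) →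
            W → Vec W n → Vec W s → W
  recEval g h0 h1 [] xs as = ⟦ g ⟧ xs as
  recEval g h0 h1 (false ∷ y) xs as = ⟦ h0 ⟧ (y ∷ xs) (recEval g h0 h1 y xs as ∷ as)
  recEval g h0 h1 (true ∷ y) xs as = ⟦ h1 ⟧ (y ∷ xs) (recEval g h0 h1 y xs as ∷ as)

  evalsN : ∀ {n k} → Vec (BC n 0) k → Vec W n → Vec W k
  evalsN [] xs = []
  evalsN (r ∷ rs) xs = ⟦ r ⟧ xs [] ∷ evalsN rs xs

  evals : ∀ {n s l} → Vec (BC n s) l → Vec W n → Vec W s → Vec W l
  evals [] xs as = []
  evals (t ∷ ts) xs as = ⟦ t ⟧ xs as ∷ evals ts xs as

PolyTime₁ : (W → W) → Set
PolyTime₁ f = Σ[ e ∈ BC 1 0 ] (∀ x → ⟦ e ⟧ (x ∷ []) [] ≡ f x)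

PolyTime₂ : (W → W → W) → Set
PolyTime₂ g = Σ[ e ∈ BC 2 0 ] (∀ x y → ⟦ e ⟧ (x ∷ y ∷ []) [] ≡ g x y)

-- Search problems are given by their relation R(x,y) on strings.
-- Many-one reduction Q ≤ R: polytime f, g with R(f u, y) → Q(u, g u y).

_≤ₘ_ : (W → W → Set) → (W → W → Set) → Set
Q ≤ₘ R = Σ[ f ∈ (W → W) ] Σ[ g ∈ (W → W → W) ]
           (PolyTime₁ f × PolyTime₂ g × (∀ u y → R (f u) y → Q u (g u y)))

-- Encoding of lists of strings: bit b ↦ b 1, end of a string ↦ 0 0.

decL : W → Maybe (List W)
decL [] = just []
decL (b ∷ true ∷ rest) with decL rest
... | just (w ∷ ws) = just ((b ∷ w) ∷ ws)
... | _ = nothing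
decL (false ∷ false ∷ rest) with decL rest
... | just ws = just ([] ∷ ws)
... | nothing = nothing
decL (true ∷ false ∷ rest) = nothing
decL (_ ∷ []) = nothing

-- binary (little-endian) value of a string
bin : W → ℕ
bin [] = 0
bin (false ∷ w) = 2 * bin w
bin (true ∷ w) = suc (2 * bin w)

-- Boolean circuits over {AND, OR, NOT}.  Wires 0..m-1 are the m input
-- bits, gate number k produces wire m+k; the output is the last wire.
-- (A reference to a not-yet-defined wire reads as 0.)

data Gate : Set where
  AND OR : ℕ → ℕ → Gate
  NOT    : ℕ → Gate

Circuit : Set
Circuit = List Gate

lookupD : List Bool → ℕ → Bool
lookupD [] _ = false
lookupD (b ∷ bs) zero = b
lookupD (b ∷ bs) (suc k) = lookupD bs k

lastD : List Bool → Bool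
lastD [] = false
lastD (b ∷ []) = b
lastD (_ ∷ b ∷ bs) = lastD (b ∷ bs)

gateVal : List Bool → Gate → Bool
gateVal ws (AND i j) = Data.Bool._∧_ (lookupD ws i) (lookupD ws j)
gateVal ws (OR i j)  = Data.Bool._∨_ (lookupD ws i) (lookupD ws j)
gateVal ws (NOT i)   = Data.Bool.not (lookupD ws i)

wires : List Bool → Circuit → List Bool
wires ws [] = ws
wires ws (g ∷ gs) = wires (ws ++ (gateVal ws g ∷ [])) gs

evalC : Circuit → W → Bool
evalC C input = lastD (wires input C)

-- a circuit is encoded as an encoded list of strings t₀ i₀ j₀ t₁ i₁ j₁ …,
-- tag ε = NOT i, tag 0 = AND i j, tag 1 = OR i j, indices in binary.
parseGates : List W → Maybe Circuit
parseGates [] = just []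
parseGates (t ∷ i ∷ j ∷ rest) with parseGates rest
... | nothing = nothing
... | just gs with t
...   | [] = just (NOT (bin i) ∷ gs)
...   | false ∷ [] = just (AND (bin i) (bin j) ∷ gs)
...   | true ∷ [] = just (OR (bin i) (bin j) ∷ gs)
...   | _ = nothing
parseGates _ = nothing

parseCircuit : W → Maybe Circuit
parseCircuit w with decL w
... | nothing = nothing
... | just ss = parseGates ss

parseCircuits : List W → Maybe (List Circuit)
parseCircuits [] = just []
parseCircuits (w ∷ ws) with parseCircuit w | parseCircuits ws
... | just C | just Cs = just (C ∷ Cs)
... | _ | _ = nothing

-- Strict lexicographic order on strings (first bit most significant);
-- on strings of equal length n this is the usual order on [2^n].

data _<ₗ_ : W → W → Set where
  here  : ∀ {u v} → (false ∷ u) <ₗ (true ∷ v)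
  there : ∀ {b u v} → u <ₗ v → (b ∷ u) <ₗ (b ∷ v)

-- Instance: encoding of the list [1ⁿ-string (any string of
-- length n), circuit C] ; C on 2n input bits defines the undirected
-- graph on [2^n] (n-bit strings) where, for u < v, {u,v} is an edge iff
-- C(u v) = 1.  Solution: an encoded list a₀ < a₁ < … < a_{k-1} of n-bit
-- strings with 2k ≥ n forming a clique or an independent set.
-- Malformed instances: every y is a solution.

decodeRamsey : W → Maybe (ℕ × Circuit)
decodeRamsey x with decL x
... | just (nstr ∷ cstr ∷ []) with parseCircuit cstr
...   | just C = just (length nstr , C)
...   | nothing = nothing
decodeRamsey x | _ = nothing

RamseySolFor : ℕ → Circuit → W → Set
RamseySolFor n C y =
  Σ[ as ∈ List W ] (decL y ≡ just as
    × All (λ a → length a ≡ n) as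
    × AllPairs _<ₗ_ as
    × n ≤ 2 * length as
    × Σ[ b ∈ Bool ] AllPairs (λ u v → evalC C (u ++ v) ≡ b) as)

Ramsey : W → W → Set
Ramsey x y with decodeRamsey x
... | nothing = ⊤
... | just (n , C) = RamseySolFor n C y

-- Instance: encoding of the list
-- [string of length n, P₀, …, P_{n-2}] (circuits), P_i read on the
-- (i+2)(n+1) input bits a₀ … a_i z, each argument an (n+1)-bit string.
-- Solution: encoded list [b₀…b_{n-2}, a₀, …, a_n] of distinct (n+1)-bit
-- strings with P_i(a₀,…,a_i,a_j) = b_i whenever i < j ≤ n, i ≤ n-2.
-- Malformed instances (incl. wrong number of circuits): every y is a solution.

decodeWLC : W → Maybe (ℕ × List Circuit)
decodeWLC x with decL x
... | nothing = nothing
... | just [] = nothing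
... | just (nstr ∷ cs) with parseCircuits cs
...   | nothing = nothing
...   | just Ps = just (length nstr , Ps)

WLCSolFor : ℕ → List Circuit → W → Set
WLCSolFor n Ps y =
  Σ[ bs ∈ W ] Σ[ as ∈ List W ] (decL y ≡ just (bs ∷ as)
    × length bs ≡ n ∸ 1
    × length as ≡ suc n
    × All (λ a → length a ≡ suc n) as
    × AllPairs _≢_ as
    × (∀ (i : Fin (length Ps)) (j : Fin (length as)) → toℕ i < toℕ j →
         evalC (List.lookup Ps i)
               (concat (take (suc (toℕ i)) as) ++ List.lookup as j)
           ≡ lookupD bs (toℕ i)))

WeakLongChoice : W → W → Set
WeakLongChoice x y with decodeWLC x
... | nothing = ⊤
... | just (n , Ps) = suc (length Ps) ≡ n → WLCSolFor n Ps y

-- For a Ramsey instance (n, C) the reduction asks Weak long choice, with size parameter n - 1,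
-- for n distinct strings a₀, …, a_{n-1} of length n and bits b₀, …, b_{n-3}, where
-- Pᵢ(a₀, …, aᵢ, z) is the colour C gives to the edge {aᵢ, z} (a prelude circuit first puts the
-- two strings in increasing order). In a solution every edge from aᵢ, i ≤ n - 3, to a later aⱼ
-- has colour bᵢ, so for the majority value b of the bᵢ the strings aᵢ with bᵢ = b together with
-- a_{n-1} form a homogeneous set of at least n/2 vertices. The recovery map outputs this set
-- in increasing order by emitting, for r = 0, …, n - 1, its element with exactly r elements
-- below it. For n ≤ 1 a single vertex is a solution.
module Submission where

open import Defs
open import Data.Bool using (Bool; true; false; not; _∧_; _∨_; if_then_else_)
open import Data.Bool.Properties using (not-involutive)
open import Data.Nat using (ℕ; zero; suc; _+_; _*_; _∸_; _≤_; _<_; z≤n; s≤s; _≡ᵇ_; _⊓_; _^_; ⌊_/2⌋)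
open import Data.Nat.Properties
open import Data.Nat.Solver using (module +-*-Solver)
open +-*-Solver using (solve; _:+_; _:*_; _:=_; con)
open import Data.List using (List; []; _∷_; _++_; length; replicate; drop; take; concat; map)
import Data.List as List
open import Data.List.Properties using (length-++; ++-assoc; ++-identityʳ; map-++; length-drop; length-replicate; take-all)
open import Data.List.Relation.Unary.All using (All; []; _∷_)
import Data.List.Relation.Unary.All as All
import Data.List.Relation.Unary.All.Properties as Allₚ
open import Data.List.Relation.Unary.Any using (here; there)
open import Data.List.Relation.Unary.AllPairs using (AllPairs; []; _∷_)
import Data.List.Relation.Unary.AllPairs as AP
import Data.List.Relation.Unary.AllPairs.Properties as AllPairsₚ
open import Data.List.Membership.Propositional using (_∈_)
open import Data.List.Membership.Propositional.Properties using (∈-++⁻)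
open import Data.Vec using (Vec; []; _∷_; tabulate; lookup)
open import Data.Vec.Properties using (tabulate∘lookup)
open import Data.Fin using (Fin; zero; suc; toℕ; fromℕ<)
import Data.Fin as Fin
open import Data.Fin.Properties using (toℕ-fromℕ<)
open import Data.Maybe using (just; nothing)
open import Data.Product using (Σ; Σ-syntax; _,_; _×_; proj₁; proj₂)
open import Data.Sum using (_⊎_; inj₁; inj₂; [_,_]′)
open import Data.Empty using (⊥-elim)
open import Data.Unit using (tt)
open import Function using (_∘_)
open import Relation.Nullary using (¬_)
open import Relation.Binary.PropositionalEquality

unary : ℕ → W
unary k = replicate k true

flag : Bool → W
flag false = []
flag true = true ∷ []

branch : W → W → W → W
branch (true ∷ _) b c = c
branch _ b c = b

behead : W → W
behead [] = []
behead (_ ∷ w) = w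

behead-drop : ∀ k (a : W) → behead (drop k a) ≡ drop (suc k) a
behead-drop zero [] = refl
behead-drop zero (x ∷ a) = refl
behead-drop (suc k) [] = refl
behead-drop (suc k) (x ∷ a) = behead-drop k a

drop-unary : ∀ j K → drop j (unary K) ≡ unary (K ∸ j)
drop-unary zero K = refl
drop-unary (suc j) zero = refl
drop-unary (suc j) (suc K) = drop-unary j K

bit : Bool → ℕ
bit false = 0
bit true = 1

headBit : W → Bool
headBit (true ∷ _) = true
headBit _ = false

headBit-flag : ∀ b → headBit (flag b) ≡ b
headBit-flag false = refl
headBit-flag true = refl

headBit-drop : ∀ q s → headBit (drop q s) ≡ lookupD s q
headBit-drop zero [] = refl
headBit-drop zero (false ∷ s) = refl
headBit-drop zero (true ∷ s) = refl
headBit-drop (suc q) [] = refl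
headBit-drop (suc q) (x ∷ s) = headBit-drop q s

lookupD-++ˡ : ∀ (A B : W) k → k < length A → lookupD (A ++ B) k ≡ lookupD A k
lookupD-++ˡ (a ∷ A) B zero p = refl
lookupD-++ˡ (a ∷ A) B (suc k) (s≤s p) = lookupD-++ˡ A B k p

lookupD-++ʳ : ∀ (A B : W) k → lookupD (A ++ B) (length A + k) ≡ lookupD B k
lookupD-++ʳ [] B k = refl
lookupD-++ʳ (a ∷ A) B k = lookupD-++ʳ A B k

lookupD-length : ∀ A → lookupD A (length A) ≡ false
lookupD-length [] = refl
lookupD-length (a ∷ A) = lookupD-length A

drop-lookupD : ∀ t (u : W) → t < length u → drop t u ≡ lookupD u t ∷ drop (suc t) u
drop-lookupD zero (a ∷ u) p = refl
drop-lookupD (suc t) (a ∷ u) (s≤s p) = drop-lookupD t u p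

drop-length : ∀ (u : W) → drop (length u) u ≡ []
drop-length [] = refl
drop-length (a ∷ u) = drop-length u

unary-++ : ∀ a b → unary a ++ unary b ≡ unary (a + b)
unary-++ zero b = refl
unary-++ (suc a) b = cong (true ∷_) (unary-++ a b)

keep : {A : Set} → (A → Bool) → List A → List A
keep p [] = []
keep p (x ∷ xs) = if p x then x ∷ keep p xs else keep p xs

All-keep : ∀ {A : Set} {P : A → Set} p (xs : List A) → All P xs → All P (keep p xs)
All-keep p [] [] = []
All-keep p (x ∷ xs) (q ∷ qs) with p x
... | true = q ∷ All-keep p xs qs
... | false = All-keep p xs qs

AllPairs-keep : ∀ {A : Set} {R : A → A → Set} p (xs : List A) → AllPairs R xs → AllPairs R (keep p xs)
AllPairs-keep p [] [] = []
AllPairs-keep p (x ∷ xs) (q ∷ qs) with p x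
... | true = All-keep p xs q ∷ AllPairs-keep p xs qs
... | false = AllPairs-keep p xs qs

∈-keep : ∀ {A : Set} p (xs : List A) {x} → x ∈ keep p xs → (x ∈ xs) × (p x ≡ true)
∈-keep p (y ∷ xs) {x} m with p y in e
... | true with m
...   | here refl = here refl , e
...   | there m' = there (proj₁ (∈-keep p xs m')) , proj₂ (∈-keep p xs m')
∈-keep p (y ∷ xs) {x} m | false = there (proj₁ (∈-keep p xs m)) , proj₂ (∈-keep p xs m)

AllPairs-either : ∀ {A : Set} {R : A → A → Set} (xs : List A) → AllPairs R xs → ∀ {x y} → x ∈ xs → y ∈ xs → ¬ (x ≡ y) → R x y ⊎ R y x
AllPairs-either (z ∷ xs) (q ∷ qs) (here refl) (here refl) ne = ⊥-elim (ne refl)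
AllPairs-either (z ∷ xs) (q ∷ qs) (here refl) (there my) ne = inj₁ (All.lookup q my)
AllPairs-either (z ∷ xs) (q ∷ qs) (there mx) (here refl) ne = inj₂ (All.lookup q mx)
AllPairs-either (z ∷ xs) (q ∷ qs) (there mx) (there my) ne = AllPairs-either xs qs mx my ne

AllPairs-map-All : ∀ {A : Set} {P Q : A → A → Set} {S : A → Set} xs → All S xs → AllPairs P xs →
                   (∀ {x y} → S x → S y → P x y → Q x y) → AllPairs Q xs
AllPairs-map-All [] [] [] f = []
AllPairs-map-All (x ∷ xs) (a ∷ as) (p ∷ ps) f = go xs as p ∷ AllPairs-map-All xs as ps f
  where
    go : ∀ ys → All _ ys → All _ ys → All _ ys
    go [] [] [] = []
    go (y ∷ ys) (b ∷ bs) (q ∷ qs) = f a b q ∷ go ys bs qs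

length-keep : ∀ {A : Set} p (x : A) xs → length (keep p (x ∷ xs)) ≡ bit (p x) + length (keep p xs)
length-keep p x xs with p x
... | true = refl
... | false = refl

nth : List W → ℕ → W
nth [] k = []
nth (x ∷ xs) zero = x
nth (x ∷ xs) (suc k) = nth xs k

All-drop : ∀ {P : W → Set} xs k → (∀ j → k ≤ j → j < length xs → P (nth xs j)) → All P (drop k xs)
All-drop [] zero f = []
All-drop [] (suc k) f = []
All-drop (x ∷ xs) zero f = f 0 z≤n (s≤s z≤n) ∷ All-drop xs 0 (λ j _ q → f (suc j) z≤n (s≤s q))
All-drop (x ∷ xs) (suc k) f = All-drop xs k (λ j p q → f (suc j) (s≤s p) (s≤s q))

drop-∷ : ∀ (xs : List W) k {s rest} → drop k xs ≡ s ∷ rest → (nth xs k ≡ s) × (drop (suc k) xs ≡ rest)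
drop-∷ (x ∷ xs) zero refl = refl , refl
drop-∷ (x ∷ xs) (suc k) e = drop-∷ xs k e

lookup-nth : ∀ (xs : List W) (fj : Fin (length xs)) → List.lookup xs fj ≡ nth xs (toℕ fj)
lookup-nth (x ∷ xs) Fin.zero = refl
lookup-nth (x ∷ xs) (Fin.suc fj) = lookup-nth xs fj

concat-take-suc : ∀ (xs : List W) i → i < length xs → concat (take (suc i) xs) ≡ concat (take i xs) ++ nth xs i
concat-take-suc (x ∷ xs) zero p = ++-identityʳ x
concat-take-suc (x ∷ xs) (suc i) (s≤s p) = trans (cong (x ++_) (concat-take-suc xs i p)) (sym (++-assoc x _ _))

length-concat-take : ∀ n (xs : List W) i → All (λ (a : W) → length a ≡ n) xs → i ≤ length xs → length (concat (take i xs)) ≡ i * n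
length-concat-take n xs zero al p = refl
length-concat-take n (x ∷ xs) (suc i) (a ∷ al) (s≤s p) = trans (length-++ x) (cong₂ _+_ a (length-concat-take n xs i al p))

All-nth : ∀ {P : W → Set} (xs : List W) i → All P xs → i < length xs → P (nth xs i)
All-nth (x ∷ xs) zero (p ∷ ps) q = p
All-nth (x ∷ xs) (suc i) (p ∷ ps) (s≤s q) = All-nth xs i ps q

length-behead : ∀ (w : W) → length (behead w) ≡ length w ∸ 1
length-behead [] = refl
length-behead (x ∷ w) = refl

nonempty : ∀ (w : W) k → length w ≡ suc k → Σ[ a ∈ Bool ] Σ[ w' ∈ W ] (w ≡ a ∷ w')
nonempty (a ∷ w) k e = a , w , refl

countdown : (W → W) → ℕ → W
countdown f zero = []
countdown f (suc k) = f (unary k) ++ countdown f k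

concatRange : {A : Set} → (ℕ → List A) → ℕ → ℕ → List A
concatRange f a zero = []
concatRange f a (suc k) = f a ++ concatRange f (suc a) k

countdown-concatRange : ∀ (f : W → W) (Fs : ℕ → W) K → (∀ j → suc j ≤ K → f (unary j) ≡ Fs (K ∸ suc j)) →
          ∀ L → L ≤ K → countdown f L ≡ concatRange Fs (K ∸ L) L
countdown-concatRange f Fs K hyp zero le = refl
countdown-concatRange f Fs K hyp (suc L) le =
  trans (cong₂ _++_ (hyp L le) (countdown-concatRange f Fs K hyp L (≤-trans (n≤1+n L) le)))
        (cong (λ z → Fs (K ∸ suc L) ++ concatRange Fs z L) (sym eq))
  where
    eq : suc (K ∸ suc L) ≡ K ∸ L
    eq = sym (+-∸-assoc 1 le)

concatRange-cong : ∀ {A : Set} {f g : ℕ → List A} → (∀ p → f p ≡ g p) → ∀ a L → concatRange f a L ≡ concatRange g a L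
concatRange-cong e a zero = refl
concatRange-cong e a (suc L) = cong₂ _++_ (e a) (concatRange-cong e (suc a) L)

concatRange-snoc : ∀ {A : Set} (f : ℕ → List A) a L → concatRange f a (suc L) ≡ concatRange f a L ++ f (a + L)
concatRange-snoc f a zero = trans (++-identityʳ (f a)) (cong f (sym (+-identityʳ a)))
concatRange-snoc f a (suc L) = trans (cong (f a ++_) (concatRange-snoc f (suc a) L))
  (trans (sym (++-assoc (f a) (concatRange f (suc a) L) (f (suc a + L)))) (cong (λ z → concatRange f a (suc L) ++ f z) (sym (+-suc a L))))

length-concatRange-bits : ∀ (f : ℕ → Bool) a L → length (concatRange (λ p → f p ∷ []) a L) ≡ L
length-concatRange-bits f a zero = refl
length-concatRange-bits f a (suc L) = cong suc (length-concatRange-bits f (suc a) L)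

map-concatRange : ∀ {A B : Set} (h : A → B) (f : ℕ → List A) a k → map h (concatRange f a k) ≡ concatRange (λ p → map h (f p)) a k
map-concatRange h f a zero = refl
map-concatRange h f a (suc k) = trans (map-++ h (f a) (concatRange f (suc a) k)) (cong (map h (f a) ++_) (map-concatRange h f (suc a) k))

All-concatRange : ∀ {A : Set} {P : A → Set} (f : ℕ → List A) a k → (∀ j → j < k → All P (f (a + j))) → All P (concatRange f a k)
All-concatRange f a zero h = []
All-concatRange {P = P} f a (suc k) h = Allₚ.++⁺ (subst (λ z → All P (f z)) (+-identityʳ a) (h 0 (s≤s z≤n)))
  (All-concatRange f (suc a) k (λ j p → subst (λ z → All P (f z)) (+-suc a j) (h (suc j) (s≤s p))))

concatRange-cong< : ∀ {A : Set} {f g : ℕ → List A} a k → (∀ j → j < k → f (a + j) ≡ g (a + j)) → concatRange f a k ≡ concatRange g a k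
concatRange-cong< a zero h = refl
concatRange-cong< {f = f} {g} a (suc k) h = cong₂ _++_ (subst (λ z → f z ≡ g z) (+-identityʳ a) (h 0 (s≤s z≤n)))
  (concatRange-cong< (suc a) k (λ j p → subst (λ z → f z ≡ g z) (+-suc a j) (h (suc j) (s≤s p))))

length-concatRange : ∀ m (f : ℕ → W) → (∀ p → length (f p) ≡ m) → ∀ a k → length (concatRange f a k) ≡ k * m
length-concatRange m f hf a zero = refl
length-concatRange m f hf a (suc k) = trans (length-++ (f a)) (cong₂ _+_ (hf a) (length-concatRange m f hf (suc a) k))

lookupD-concatRange : ∀ m (f : ℕ → W) → (∀ p → length (f p) ≡ m) → ∀ a k t j → t < k → j < m →
          lookupD (concatRange f a k) (t * m + j) ≡ lookupD (f (a + t)) j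
lookupD-concatRange m f hf a (suc k) zero j p q =
  trans (lookupD-++ˡ (f a) (concatRange f (suc a) k) j (subst (j <_) (sym (hf a)) q)) (cong (λ z → lookupD (f z) j) (sym (+-identityʳ a)))
lookupD-concatRange m f hf a (suc k) (suc t) j (s≤s p) q =
  trans (cong (lookupD (f a ++ concatRange f (suc a) k)) (trans (+-assoc m (t * m) j) (cong (_+ (t * m + j)) (sym (hf a)))))
  (trans (lookupD-++ʳ (f a) (concatRange f (suc a) k) (t * m + j))
  (trans (lookupD-concatRange m f hf (suc a) k t j p q) (cong (λ z → lookupD (f z) j) (sym (+-suc a t)))))

lookupD-concatRange-bits : ∀ (h : ℕ → Bool) k t → t < k → lookupD (concatRange (λ p → h p ∷ []) 0 k) t ≡ h t
lookupD-concatRange-bits h k t p = trans (cong (lookupD (concatRange (λ p → h p ∷ []) 0 k)) (sym (trans (+-identityʳ (t * 1)) (*-identityʳ t))))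
  (lookupD-concatRange 1 (λ p → h p ∷ []) (λ _ → refl) 0 k t 0 p (s≤s z≤n))

concatRange-lookupD : ∀ (w : W) → concatRange (λ p → lookupD w p ∷ []) 0 (length w) ≡ w
concatRange-lookupD w = go w
  where
    shiftS : ∀ (h : ℕ → Bool) a k → concatRange (λ p → h (suc p) ∷ []) a k ≡ concatRange (λ p → h p ∷ []) (suc a) k
    shiftS h a zero = refl
    shiftS h a (suc k) = cong (h (suc a) ∷_) (shiftS h (suc a) k)
    go : ∀ w → concatRange (λ p → lookupD w p ∷ []) 0 (length w) ≡ w
    go [] = refl
    go (b ∷ w) = cong (b ∷_) (trans (sym (shiftS (lookupD (b ∷ w)) 0 (length w))) (go w))

countdown-const : ∀ i n → countdown (λ _ → unary n) i ≡ unary (i * n)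
countdown-const zero n = refl
countdown-const (suc i) n = trans (cong (unary n ++_) (countdown-const i n)) (unary-++ n (i * n))

range : {A : Set} → (ℕ → A) → ℕ → ℕ → List A
range f a zero = []
range f a (suc k) = f a ∷ range f (suc a) k

sumRange : (ℕ → ℕ) → ℕ → ℕ → ℕ
sumRange f a zero = 0
sumRange f a (suc k) = f a + sumRange f (suc a) k

length-concatRange-sumRange : ∀ {A : Set} (f : ℕ → List A) a k → length (concatRange f a k) ≡ sumRange (λ r → length (f r)) a k
length-concatRange-sumRange f a zero = refl
length-concatRange-sumRange f a (suc k) = trans (length-++ (f a)) (cong (length (f a) +_) (length-concatRange-sumRange f (suc a) k))

sumRange-+ : ∀ f g a k → sumRange (λ r → f r + g r) a k ≡ sumRange f a k + sumRange g a k
sumRange-+ f g a zero = refl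
sumRange-+ f g a (suc k) rewrite sumRange-+ f g (suc a) k =
  solve 4 (λ p q r s → p :+ q :+ (r :+ s) := p :+ r :+ (q :+ s)) refl (f a) (g a) (sumRange f (suc a) k) (sumRange g (suc a) k)

sumRange-cong : ∀ {f g : ℕ → ℕ} → (∀ r → f r ≡ g r) → ∀ a k → sumRange f a k ≡ sumRange g a k
sumRange-cong e a zero = refl
sumRange-cong e a (suc k) = cong₂ _+_ (e a) (sumRange-cong e (suc a) k)

sumRange-0 : ∀ a k → sumRange (λ _ → 0) a k ≡ 0
sumRange-0 a zero = refl
sumRange-0 a (suc k) = sumRange-0 (suc a) k

≡ᵇ-refl : ∀ c → (c ≡ᵇ c) ≡ true
≡ᵇ-refl zero = refl
≡ᵇ-refl (suc c) = ≡ᵇ-refl c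

≡ᵇ-sound : ∀ a c → (a ≡ᵇ c) ≡ true → a ≡ c
≡ᵇ-sound zero zero p = refl
≡ᵇ-sound (suc a) (suc c) p = cong suc (≡ᵇ-sound a c p)
≡ᵇ-sound zero (suc c) ()
≡ᵇ-sound (suc a) zero ()

<⇒≡ᵇ-false : ∀ m n → m < n → (m ≡ᵇ n) ≡ false
<⇒≡ᵇ-false zero (suc n) p = refl
<⇒≡ᵇ-false (suc m) (suc n) (s≤s p) = <⇒≡ᵇ-false m n p

>⇒≡ᵇ-false : ∀ m n → n < m → (m ≡ᵇ n) ≡ false
>⇒≡ᵇ-false (suc m) zero p = refl
>⇒≡ᵇ-false (suc m) (suc n) (s≤s p) = >⇒≡ᵇ-false m n p

sumRange-indicator-0 : ∀ c a k → c < a → sumRange (λ r → bit (c ≡ᵇ r)) a k ≡ 0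
sumRange-indicator-0 c a zero p = refl
sumRange-indicator-0 c a (suc k) p rewrite <⇒≡ᵇ-false c a p = sumRange-indicator-0 c (suc a) k (≤-trans p (n≤1+n a))

sumRange-indicator-1 : ∀ c a k → a ≤ c → c < a + k → sumRange (λ r → bit (c ≡ᵇ r)) a k ≡ 1
sumRange-indicator-1 c a zero p q = ⊥-elim (<⇒≱ q (≤-trans (≤-reflexive (+-identityʳ a)) p))
sumRange-indicator-1 c a (suc k) p q with m≤n⇒m<n∨m≡n p
... | inj₂ refl rewrite ≡ᵇ-refl c = cong suc (sumRange-indicator-0 c (suc c) k ≤-refl)
... | inj₁ a<c rewrite >⇒≡ᵇ-false c a a<c = sumRange-indicator-1 c (suc a) k a<c (subst (c <_) (+-suc a k) q)

lookup-range : ∀ {A : Set} (f : ℕ → A) a k (fi : Fin (length (range f a k))) → List.lookup (range f a k) fi ≡ f (a + toℕ fi)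
lookup-range f a (suc k) Fin.zero = cong f (sym (+-identityʳ a))
lookup-range f a (suc k) (Fin.suc fi) = trans (lookup-range f (suc a) k fi) (cong f (sym (+-suc a (toℕ fi))))

length-range : ∀ {A : Set} (f : ℕ → A) a k → length (range f a k) ≡ k
length-range f a zero = refl
length-range f a (suc k) = cong suc (length-range f (suc a) k)

-- Binary numerals

parity : ℕ → Bool
parity zero = false
parity (suc k) = not (parity k)

half-cases : ∀ A k → (⌊ A /2⌋ ≤ k × A ∸ suc (k + k) ≡ 0) ⊎ (k < ⌊ A /2⌋ × Σ ℕ (λ m → A ∸ suc (k + k) ≡ suc m))
half-cases zero k = inj₁ (z≤n , refl)
half-cases (suc zero) k = inj₁ (z≤n , 0∸n≡0 (k + k))
half-cases (suc (suc A)) zero = inj₂ (s≤s z≤n , (A , refl))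
half-cases (suc (suc A)) (suc k) with half-cases A k
... | inj₁ (p , q) = inj₁ (s≤s p , trans (cong (λ z → A ∸ z) (+-suc k k)) q)
... | inj₂ (p , (m , q)) = inj₂ (s≤s p , (m , trans (cong (λ z → A ∸ z) (+-suc k k)) q))

halvings : ℕ → ℕ → ℕ
halvings zero K = K
halvings (suc p) K = ⌊ halvings p K /2⌋

halvings≤ : ∀ p K → halvings p K ≤ K
halvings≤ zero K = ≤-refl
halvings≤ (suc p) K = ≤-trans (⌊n/2⌋≤n (halvings p K)) (halvings≤ p K)

toBinary : ℕ → W
toBinary K = concatRange (λ p → parity (halvings p K) ∷ []) 0 K

bin-∷ : ∀ b w → bin (b ∷ w) ≡ bit b + 2 * bin w
bin-∷ false w = refl
bin-∷ true w = refl

parity+2*⌊/2⌋ : ∀ m → m ≡ bit (parity m) + 2 * ⌊ m /2⌋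
parity+2*⌊/2⌋ zero = refl
parity+2*⌊/2⌋ (suc zero) = refl
parity+2*⌊/2⌋ (suc (suc m)) rewrite not-involutive (parity m) =
  trans (cong (λ (z : ℕ) → suc (suc z)) (parity+2*⌊/2⌋ m)) (solve 2 (λ a h → con 2 :+ (a :+ con 2 :* h) := a :+ con 2 :* (con 1 :+ h)) refl (bit (parity m)) (⌊ m /2⌋))

toBinary-invariant : ∀ K L a → bin (concatRange (λ p → parity (halvings p K) ∷ []) a L) + 2 ^ L * halvings (a + L) K ≡ halvings a K
toBinary-invariant K zero a rewrite +-identityʳ a = +-identityʳ (halvings a K)
toBinary-invariant K (suc L) a =
  begin
    bin (parity m ∷ S) + 2 ^ suc L * halvings (a + suc L) K
      ≡⟨ cong₂ (λ u v → u + 2 ^ suc L * halvings v K) (bin-∷ (parity m) S) (+-suc a L) ⟩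
    bit (parity m) + 2 * bin S + 2 * 2 ^ L * X
      ≡⟨ solve 4 (λ b s p x → b :+ con 2 :* s :+ con 2 :* p :* x := b :+ con 2 :* (s :+ p :* x)) refl (bit (parity m)) (bin S) (2 ^ L) X ⟩
    bit (parity m) + 2 * (bin S + 2 ^ L * X)
      ≡⟨ cong (λ z → bit (parity m) + 2 * z) (toBinary-invariant K L (suc a)) ⟩
    bit (parity m) + 2 * ⌊ m /2⌋
      ≡⟨ sym (parity+2*⌊/2⌋ m) ⟩
    m ∎
  where
    open ≡-Reasoning
    m = halvings a K
    S = concatRange (λ p → parity (halvings p K) ∷ []) (suc a) L
    X = halvings (suc a + L) K

n<2^n : ∀ n → n < 2 ^ n
n<2^n zero = s≤s z≤n
n<2^n (suc n) = +-mono-≤ (m^n>0 2 n) (≤-trans (n<2^n n) (m≤m+n (2 ^ n) 0))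

bin-toBinary : ∀ K → bin (toBinary K) ≡ K
bin-toBinary K with halvings K K | toBinary-invariant K K 0
... | zero | e = trans (sym (+-identityʳ _)) (trans (cong (bin (toBinary K) +_) (sym (*-zeroʳ (2 ^ K)))) e)
... | suc h | e = ⊥-elim (<⇒≱ (n<2^n K) (≤-trans (m≤m*n (2 ^ K) (suc h)) (≤-trans (m≤n+m _ (bin (toBinary K))) (≤-reflexive e))))

majority3 : Bool → Bool → Bool → Bool
majority3 a b c = if a then (if b then true else c) else (if b then c else false)

xor3 : Bool → Bool → Bool → Bool
xor3 a b c = if a then (if b then c else not c) else (if b then not c else c)

carry : W → W → ℕ → Bool
carry s o zero = false
carry s o (suc q) = majority3 (lookupD s q) (lookupD o q) (carry s o q)

add : W → W → W
add s o = concatRange (λ p → xor3 (lookupD s p) (lookupD o p) (carry s o p) ∷ []) 0 (length s + length o)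
           ++ (carry s o (length s + length o) ∷ [])

bin-++ : ∀ xs ys → bin (xs ++ ys) ≡ bin xs + 2 ^ length xs * bin ys
bin-++ [] ys = sym (+-identityʳ (bin ys))
bin-++ (b ∷ xs) ys =
  begin
    bin (b ∷ (xs ++ ys)) ≡⟨ bin-∷ b (xs ++ ys) ⟩
    bit b + 2 * bin (xs ++ ys) ≡⟨ cong (λ z → bit b + 2 * z) (bin-++ xs ys) ⟩
    bit b + 2 * (bin xs + 2 ^ length xs * bin ys)
      ≡⟨ solve 4 (λ v x p y → v :+ con 2 :* (x :+ p :* y) := v :+ con 2 :* x :+ con 2 :* p :* y) refl (bit b) (bin xs) (2 ^ length xs) (bin ys) ⟩
    bit b + 2 * bin xs + 2 ^ length (b ∷ xs) * bin ys ≡⟨ cong (_+ 2 ^ length (b ∷ xs) * bin ys) (sym (bin-∷ b xs)) ⟩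
    bin (b ∷ xs) + 2 ^ length (b ∷ xs) * bin ys ∎
  where open ≡-Reasoning

bin-take-suc : ∀ L s → bin (take (suc L) s) ≡ bin (take L s) + 2 ^ L * bit (lookupD s L)
bin-take-suc zero [] = refl
bin-take-suc (suc L) [] = sym (*-zeroʳ (2 ^ suc L))
bin-take-suc zero (false ∷ s) = refl
bin-take-suc zero (true ∷ s) = refl
bin-take-suc (suc L) (b ∷ s) =
  begin
    bin (b ∷ take (suc L) s) ≡⟨ bin-∷ b _ ⟩
    bit b + 2 * bin (take (suc L) s) ≡⟨ cong (λ z → bit b + 2 * z) (bin-take-suc L s) ⟩
    bit b + 2 * (bin (take L s) + 2 ^ L * bit (lookupD s L))
      ≡⟨ solve 4 (λ v x p y → v :+ con 2 :* (x :+ p :* y) := v :+ con 2 :* x :+ con 2 :* p :* y) refl (bit b) (bin (take L s)) (2 ^ L) (bit (lookupD s L)) ⟩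
    bit b + 2 * bin (take L s) + 2 ^ suc L * bit (lookupD s L) ≡⟨ cong (_+ 2 ^ suc L * bit (lookupD s L)) (sym (bin-∷ b _)) ⟩
    bin (b ∷ take L s) + 2 ^ suc L * bit (lookupD s L) ∎
  where open ≡-Reasoning

full-adder : ∀ a b c → bit (xor3 a b c) + 2 * bit (majority3 a b c) ≡ bit a + bit b + bit c
full-adder false false false = refl
full-adder false false true = refl
full-adder false true false = refl
full-adder false true true = refl
full-adder true false false = refl
full-adder true false true = refl
full-adder true true false = refl
full-adder true true true = refl

add-invariant : ∀ s o L → bin (concatRange (λ p → xor3 (lookupD s p) (lookupD o p) (carry s o p) ∷ []) 0 L) + 2 ^ L * bit (carry s o L)
                    ≡ bin (take L s) + bin (take L o)
add-invariant s o zero = refl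
add-invariant s o (suc L) =
  begin
    bin (concatRange f 0 (suc L)) + 2 ^ suc L * bit (carry s o (suc L))
      ≡⟨ cong (λ z → bin z + 2 ^ suc L * bit (carry s o (suc L))) (concatRange-snoc f 0 L) ⟩
    bin (S ++ f L) + 2 ^ suc L * M
      ≡⟨ cong (_+ 2 ^ suc L * M) (bin-++ S (f L)) ⟩
    bin S + 2 ^ length S * bin (f L) + 2 ^ suc L * M
      ≡⟨ cong₂ (λ z w → bin S + 2 ^ z * w + 2 ^ suc L * M) (length-concatRange-bits _ 0 L) (bin-∷ X []) ⟩
    bin S + 2 ^ L * (bit X + 0) + 2 * 2 ^ L * M
      ≡⟨ solve 4 (λ b p x m → b :+ p :* (x :+ con 0) :+ con 2 :* p :* m := b :+ p :* (x :+ con 2 :* m)) refl (bin S) (2 ^ L) (bit X) M ⟩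
    bin S + 2 ^ L * (bit X + 2 * M)
      ≡⟨ cong (λ z → bin S + 2 ^ L * z) (full-adder a b c) ⟩
    bin S + 2 ^ L * (bit a + bit b + bit c)
      ≡⟨ solve 5 (λ s p x y z → s :+ p :* (x :+ y :+ z) := (s :+ p :* z) :+ p :* x :+ p :* y) refl (bin S) (2 ^ L) (bit a) (bit b) (bit c) ⟩
    (bin S + 2 ^ L * bit c) + 2 ^ L * bit a + 2 ^ L * bit b
      ≡⟨ cong (λ z → z + 2 ^ L * bit a + 2 ^ L * bit b) (add-invariant s o L) ⟩
    bin (take L s) + bin (take L o) + 2 ^ L * bit a + 2 ^ L * bit b
      ≡⟨ solve 4 (λ x y u v → x :+ y :+ u :+ v := (x :+ u) :+ (y :+ v)) refl (bin (take L s)) (bin (take L o)) (2 ^ L * bit a) (2 ^ L * bit b) ⟩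
    (bin (take L s) + 2 ^ L * bit a) + (bin (take L o) + 2 ^ L * bit b)
      ≡⟨ sym (cong₂ _+_ (bin-take-suc L s) (bin-take-suc L o)) ⟩
    bin (take (suc L) s) + bin (take (suc L) o) ∎
  where
    open ≡-Reasoning
    f : ℕ → W
    f p = xor3 (lookupD s p) (lookupD o p) (carry s o p) ∷ []
    S = concatRange f 0 L
    a = lookupD s L
    b = lookupD o L
    c = carry s o L
    X = xor3 a b c
    M = bit (majority3 a b c)

bin-add : ∀ s o → bin (add s o) ≡ bin s + bin o
bin-add s o =
  begin
    bin (S ++ (carry s o L ∷ [])) ≡⟨ bin-++ S _ ⟩
    bin S + 2 ^ length S * bin (carry s o L ∷ [])
      ≡⟨ cong₂ (λ u v → bin S + 2 ^ u * v) (length-concatRange-bits _ 0 L) (trans (bin-∷ (carry s o L) []) (+-identityʳ _)) ⟩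
    bin S + 2 ^ L * bit (carry s o L) ≡⟨ add-invariant s o L ⟩
    bin (take L s) + bin (take L o)
      ≡⟨ cong₂ (λ u v → bin u + bin v) (take-all L s (m≤m+n (length s) (length o))) (take-all L o (m≤n+m (length o) (length s))) ⟩
    bin s + bin o ∎
  where
    open ≡-Reasoning
    L = length s + length o
    S = concatRange (λ p → xor3 (lookupD s p) (lookupD o p) (carry s o p) ∷ []) 0 L

bit≤1 : ∀ b → bit b ≤ 1
bit≤1 false = z≤n
bit≤1 true = s≤s z≤n

encThen : W → W → W
encThen [] rest = false ∷ false ∷ rest
encThen (b ∷ s) rest = b ∷ true ∷ encThen s rest

enc : W → W
enc s = encThen s []

encList : List W → W
encList [] = []
encList (s ∷ ss) = encThen s (encList ss)

EvenLength : W → Set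
EvenLength w = parity (length w) ≡ false

evenLength-encThen : ∀ s rest → EvenLength rest → EvenLength (encThen s rest)
evenLength-encThen [] rest e = trans (not-involutive _) e
evenLength-encThen (b ∷ s) rest e = trans (not-involutive _) (evenLength-encThen s rest e)

evenLength-encList : ∀ ss → EvenLength (encList ss)
evenLength-encList [] = refl
evenLength-encList (s ∷ ss) = evenLength-encThen s (encList ss) (evenLength-encList ss)

enc-++ : ∀ s rest → enc s ++ rest ≡ encThen s rest
enc-++ [] rest = refl
enc-++ (b ∷ s) rest = cong (λ z → b ∷ true ∷ z) (enc-++ s rest)

decL-encThen : ∀ s rest ss → decL rest ≡ just ss → decL (encThen s rest) ≡ just (s ∷ ss)
decL-encThen [] rest ss eq rewrite eq = refl
decL-encThen (b ∷ s) rest ss eq rewrite decL-encThen s rest ss eq = refl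

decL-encList : ∀ ss → decL (encList ss) ≡ just ss
decL-encList [] = refl
decL-encList (s ∷ ss) = decL-encThen s (encList ss) ss (decL-encList ss)

encList-++ : ∀ xs ys → encList (xs ++ ys) ≡ encList xs ++ encList ys
encList-++ [] ys = refl
encList-++ (x ∷ xs) ys = trans (cong (encThen x) (encList-++ xs ys)) (trans (sym (enc-++ x _)) (trans (sym (++-assoc (enc x) (encList xs) (encList ys))) (cong (_++ encList ys) (enc-++ x _))))

decL-injective : ∀ w ss → decL w ≡ just ss → w ≡ encList ss
decL-injective [] ss refl = refl
decL-injective (b ∷ true ∷ rest) ss e with decL rest | decL-injective rest
... | just (w' ∷ ws) | ih with e
...   | refl = cong (λ z → b ∷ true ∷ z) (ih (w' ∷ ws) refl)
decL-injective (b ∷ true ∷ rest) ss () | just [] | ih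
decL-injective (b ∷ true ∷ rest) ss () | nothing | ih
decL-injective (false ∷ false ∷ rest) ss e with decL rest | decL-injective rest
... | just ws | ih with e
...   | refl = cong (λ z → false ∷ false ∷ z) (ih ws refl)
decL-injective (false ∷ false ∷ rest) ss () | nothing | ih
decL-injective (true ∷ false ∷ rest) ss ()
decL-injective (false ∷ []) ss ()
decL-injective (true ∷ []) ss ()

concatRange-enc : ∀ f a k → concatRange (λ i → enc (f i)) a k ≡ encList (range f a k)
concatRange-enc f a zero = refl
concatRange-enc f a (suc k) = trans (cong (enc (f a) ++_) (concatRange-enc f (suc a) k)) (enc-++ (f a) _)

-- Circuits

mod3 : ℕ → W
mod3 zero = []
mod3 (suc zero) = true ∷ []
mod3 (suc (suc zero)) = false ∷ true ∷ []
mod3 (suc (suc (suc k))) = mod3 k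

mod3-suc : ∀ k → branch (mod3 k) (branch (behead (mod3 k)) (true ∷ []) []) (false ∷ true ∷ []) ≡ mod3 (suc k)
mod3-suc zero = refl
mod3-suc (suc zero) = refl
mod3-suc (suc (suc zero)) = refl
mod3-suc (suc (suc (suc k))) = mod3-suc k

mod3≡0 : ∀ k → mod3 k ≡ [] → (mod3 (suc k) ≡ true ∷ []) × (mod3 (suc (suc k)) ≡ false ∷ true ∷ [])
mod3≡0 zero e = refl , refl
mod3≡0 (suc zero) ()
mod3≡0 (suc (suc zero)) ()
mod3≡0 (suc (suc (suc k))) e = mod3≡0 k e

shiftFields : W → List W → List W
shiftFields o (t ∷ i ∷ j ∷ rest) = t ∷ add i o ∷ add j o ∷ shiftFields o rest
shiftFields o _ = []

shiftGate : ℕ → Gate → Gate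
shiftGate k (AND i j) = AND (i + k) (j + k)
shiftGate k (OR i j) = OR (i + k) (j + k)
shiftGate k (NOT i) = NOT (i + k)

parseGates-shiftFields : ∀ ss gs o → parseGates ss ≡ just gs →
  (parseGates (shiftFields o ss) ≡ just (map (shiftGate (bin o)) gs)) × (mod3 (length ss) ≡ [])
parseGates-shiftFields [] gs o refl = refl , refl
parseGates-shiftFields ([] ∷ i ∷ j ∷ rest) gs o eq with parseGates rest | parseGates-shiftFields rest
parseGates-shiftFields ([] ∷ i ∷ j ∷ rest) gs o () | nothing | _
... | just gs′ | ih with ih gs′ o refl | eq
...   | shifted , fields≡0 | refl rewrite shifted | bin-add i o = refl , fields≡0
parseGates-shiftFields ((false ∷ []) ∷ i ∷ j ∷ rest) gs o eq with parseGates rest | parseGates-shiftFields rest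
parseGates-shiftFields ((false ∷ []) ∷ i ∷ j ∷ rest) gs o () | nothing | _
... | just gs′ | ih with ih gs′ o refl | eq
...   | shifted , fields≡0 | refl rewrite shifted | bin-add i o | bin-add j o = refl , fields≡0
parseGates-shiftFields ((true ∷ []) ∷ i ∷ j ∷ rest) gs o eq with parseGates rest | parseGates-shiftFields rest
parseGates-shiftFields ((true ∷ []) ∷ i ∷ j ∷ rest) gs o () | nothing | _
... | just gs′ | ih with ih gs′ o refl | eq
...   | shifted , fields≡0 | refl rewrite shifted | bin-add i o | bin-add j o = refl , fields≡0
parseGates-shiftFields ((false ∷ _ ∷ _) ∷ i ∷ j ∷ rest) gs o eq with parseGates rest
parseGates-shiftFields ((false ∷ _ ∷ _) ∷ i ∷ j ∷ rest) gs o () | nothing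
parseGates-shiftFields ((false ∷ _ ∷ _) ∷ i ∷ j ∷ rest) gs o () | just _
parseGates-shiftFields ((true ∷ _ ∷ _) ∷ i ∷ j ∷ rest) gs o eq with parseGates rest
parseGates-shiftFields ((true ∷ _ ∷ _) ∷ i ∷ j ∷ rest) gs o () | nothing
parseGates-shiftFields ((true ∷ _ ∷ _) ∷ i ∷ j ∷ rest) gs o () | just _
parseGates-shiftFields (_ ∷ []) gs o ()
parseGates-shiftFields (_ ∷ _ ∷ []) gs o ()

wires-++ : ∀ ws gs hs → wires ws (gs ++ hs) ≡ wires (wires ws gs) hs
wires-++ ws [] hs = refl
wires-++ ws (g ∷ gs) hs = wires-++ (ws ++ (gateVal ws g ∷ [])) gs hs

ReadsBelow : ℕ → Gate → Set
ReadsBelow m (AND i j) = i < m × j < m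
ReadsBelow m (OR i j) = i < m × j < m
ReadsBelow m (NOT i) = i < m

readsBelow-mono : ∀ {m m'} g → m ≤ m' → ReadsBelow m g → ReadsBelow m' g
readsBelow-mono (AND i j) le (p , q) = ≤-trans p le , ≤-trans q le
readsBelow-mono (OR i j) le (p , q) = ≤-trans p le , ≤-trans q le
readsBelow-mono (NOT i) le p = ≤-trans p le

gateVal-++ : ∀ ws e g → ReadsBelow (length ws) g → gateVal (ws ++ e) g ≡ gateVal ws g
gateVal-++ ws e (AND i j) (p , q) = cong₂ _∧_ (lookupD-++ˡ ws e i p) (lookupD-++ˡ ws e j q)
gateVal-++ ws e (OR i j) (p , q) = cong₂ _∨_ (lookupD-++ˡ ws e i p) (lookupD-++ˡ ws e j q)
gateVal-++ ws e (NOT i) p = cong not (lookupD-++ˡ ws e i p)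

all-readsBelow-mono : ∀ {m m'} gs → m ≤ m' → All (ReadsBelow m) gs → All (ReadsBelow m') gs
all-readsBelow-mono [] le [] = []
all-readsBelow-mono (g ∷ gs) le (p ∷ ps) = readsBelow-mono g le p ∷ all-readsBelow-mono gs le ps

map-gateVal-++ : ∀ ws e gs → All (ReadsBelow (length ws)) gs → map (gateVal (ws ++ e)) gs ≡ map (gateVal ws) gs
map-gateVal-++ ws e [] [] = refl
map-gateVal-++ ws e (g ∷ gs) (p ∷ ps) = cong₂ _∷_ (gateVal-++ ws e g p) (map-gateVal-++ ws e gs ps)

wires-independent : ∀ ws gs → All (ReadsBelow (length ws)) gs → wires ws gs ≡ ws ++ map (gateVal ws) gs
wires-independent ws [] [] = sym (++-identityʳ ws)
wires-independent ws (g ∷ gs) (p ∷ ps) =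
  begin
    wires (ws ++ (v ∷ [])) gs
      ≡⟨ wires-independent (ws ++ (v ∷ [])) gs (all-readsBelow-mono gs le ps) ⟩
    (ws ++ (v ∷ [])) ++ map (gateVal (ws ++ (v ∷ []))) gs
      ≡⟨ cong ((ws ++ (v ∷ [])) ++_) (map-gateVal-++ ws (v ∷ []) gs ps) ⟩
    (ws ++ (v ∷ [])) ++ map (gateVal ws) gs
      ≡⟨ ++-assoc ws (v ∷ []) _ ⟩
    ws ++ map (gateVal ws) (g ∷ gs) ∎
  where
    open ≡-Reasoning
    v = gateVal ws g
    le : length ws ≤ length (ws ++ (v ∷ []))
    le = ≤-trans (m≤m+n (length ws) 1) (≤-reflexive (sym (length-++ ws)))

gateVal-shiftGate : ∀ pre ws g → gateVal (pre ++ ws) (shiftGate (length pre) g) ≡ gateVal ws g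
gateVal-shiftGate pre ws (AND i j) rewrite +-comm i (length pre) | +-comm j (length pre) | lookupD-++ʳ pre ws i | lookupD-++ʳ pre ws j = refl
gateVal-shiftGate pre ws (OR i j) rewrite +-comm i (length pre) | +-comm j (length pre) | lookupD-++ʳ pre ws i | lookupD-++ʳ pre ws j = refl
gateVal-shiftGate pre ws (NOT i) rewrite +-comm i (length pre) | lookupD-++ʳ pre ws i = refl

wires-shiftGate : ∀ pre ws gs → wires (pre ++ ws) (map (shiftGate (length pre)) gs) ≡ pre ++ wires ws gs
wires-shiftGate pre ws [] = refl
wires-shiftGate pre ws (g ∷ gs) rewrite gateVal-shiftGate pre ws g | ++-assoc pre ws (gateVal ws g ∷ []) =
  wires-shiftGate pre (ws ++ (gateVal ws g ∷ [])) gs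

lastD-++ : ∀ pre x L → lastD (pre ++ (x ∷ L)) ≡ lastD (x ∷ L)
lastD-++ [] x L = refl
lastD-++ (a ∷ []) x L = refl
lastD-++ (a ∷ b ∷ pre) x L = lastD-++ (b ∷ pre) x L

wires-nonempty : ∀ x ws gs → Σ Bool (λ y → Σ W (λ L → wires (x ∷ ws) gs ≡ y ∷ L))
wires-nonempty x ws [] = x , ws , refl
wires-nonempty x ws (g ∷ gs) = wires-nonempty x (ws ++ (gateVal (x ∷ ws) g ∷ [])) gs

evalC-shiftGate : ∀ pre x ws gs → evalC (map (shiftGate (length pre)) gs) (pre ++ (x ∷ ws)) ≡ evalC gs (x ∷ ws)
evalC-shiftGate pre x ws gs with wires-nonempty x ws gs
... | y , L , e rewrite wires-shiftGate pre (x ∷ ws) gs | e = lastD-++ pre y L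

ltB : W → W → Bool
ltB [] _ = false
ltB (a ∷ u) [] = false
ltB (a ∷ u) (b ∷ z) = (not a ∧ b) ∨ ((not a ∨ b) ∧ ltB u z)

-- Wire layout for inputs u, z of length n: u at 0 and z at n; ¬ uₜ at B1n + t; ¬ uₜ ∧ zₜ and
-- ¬ uₜ ∨ zₜ at B2n + 2t and B2n + 2t + 1; the constant 0 at B3n (gF reads its own wire, which is
-- not yet defined); the chain gCh computes ltB (drop t u) (drop t z) for t = n - 1, …, 0 at the
-- odd offsets from B4n, ending with ltB u z at ltI; its negation at B5n; the four products of gA
-- from B6n; and at B7n the smaller and then the larger of u and z, which the shifted C reads as
-- its input.
module Prelude (n : ℕ) where
  B1n B2n B3n B4n B5n B6n B7n ltI : ℕ
  B1n = n + n
  B2n = B1n + n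
  B3n = B2n + n * 2
  B4n = suc B3n
  B5n = B4n + n * 2
  B6n = suc B5n
  B7n = B6n + n * 4
  ltI = B3n + n * 2

  tk : ℕ → ℕ
  tk k = n ∸ suc k

  fN fX fCh fA fB fC : ℕ → Circuit
  fN t = NOT t ∷ []
  fX t = AND (B1n + t) (n + t) ∷ OR (B1n + t) (n + t) ∷ []
  fCh k = AND (B2n + (tk k * 2 + 1)) (B3n + k * 2) ∷ OR (B2n + (tk k * 2 + 0)) (B4n + (k * 2 + 0)) ∷ []
  fA t = AND t ltI ∷ AND (n + t) B5n ∷ AND (n + t) ltI ∷ AND t B5n ∷ []
  fB t = OR (B6n + (t * 4 + 0)) (B6n + (t * 4 + 1)) ∷ []
  fC t = OR (B6n + (t * 4 + 2)) (B6n + (t * 4 + 3)) ∷ []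

  gN gX gCh gA gB gC : Circuit
  gN = concatRange fN 0 n
  gX = concatRange fX 0 n
  gCh = concatRange fCh 0 n
  gA = concatRange fA 0 n
  gB = concatRange fB 0 n
  gC = concatRange fC 0 n

  gF gNL : Gate
  gF = AND B3n B3n
  gNL = NOT ltI

  prelude : Circuit
  prelude = gN ++ (gX ++ (gF ∷ (gCh ++ (gNL ∷ (gA ++ (gB ++ gC))))))

  withPrelude : Circuit → Circuit
  withPrelude C = prelude ++ map (shiftGate B7n) C

*2+1< : ∀ {t n} → t < n → t * 2 + 1 < n * 2
*2+1< {t} {suc n} (s≤s p) = s≤s (≤-trans (≤-reflexive (+-comm (t * 2) 1)) (s≤s (*-monoˡ-≤ 2 p)))

*2+0< : ∀ {t n} → t < n → t * 2 + 0 < n * 2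
*2+0< {t} p = ≤-trans (≤-reflexive (cong suc (+-identityʳ (t * 2)))) (≤-trans (≤-reflexive (+-comm 1 (t * 2))) (<⇒≤ (*2+1< p)))

*4+j< : ∀ {t n} j → j < 4 → t < n → t * 4 + j < n * 4
*4+j< {t} {suc n} j q (s≤s p) = ≤-trans (+-monoʳ-< (t * 4) q) (≤-trans (≤-reflexive (+-comm (t * 4) 4)) (+-monoʳ-≤ 4 (*-monoˡ-≤ 4 p)))

module PreludeSem (u z : W) (m : ℕ) (lu : length u ≡ suc m) (lz : length z ≡ suc m) where
  n = suc m
  open Prelude n

  ut zt : ℕ → Bool
  ut t = lookupD u t
  zt t = lookupD z t

  ltFrom : ℕ → Bool
  ltFrom t = ltB (drop t u) (drop t z)

  u<ᵇz : Bool
  u<ᵇz = ltB u z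

  ltFrom-step : ∀ t → t < n → ltFrom t ≡ (not (ut t) ∧ zt t) ∨ ((not (ut t) ∨ zt t) ∧ ltFrom (suc t))
  ltFrom-step t p rewrite drop-lookupD t u (subst (t <_) (sym lu) p) | drop-lookupD t z (subst (t <_) (sym lz) p) = refl

  ltFrom-end : ltFrom n ≡ false
  ltFrom-end rewrite sym lu | drop-length u = refl

  fnus fxv fav fmin fmax : ℕ → W
  fnus t = not (ut t) ∷ []
  fxv t = (not (ut t) ∧ zt t) ∷ (not (ut t) ∨ zt t) ∷ []
  fav t = (ut t ∧ u<ᵇz) ∷ (zt t ∧ not u<ᵇz) ∷ (zt t ∧ u<ᵇz) ∷ (ut t ∧ not u<ᵇz) ∷ []
  fmin t = ((ut t ∧ u<ᵇz) ∨ (zt t ∧ not u<ᵇz)) ∷ []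
  fmax t = ((zt t ∧ u<ᵇz) ∨ (ut t ∧ not u<ᵇz)) ∷ []

  chf : ℕ → W
  chf k = ((not (ut (tk k)) ∨ zt (tk k)) ∧ ltFrom (suc (tk k))) ∷ ltFrom (tk k) ∷ []

  nus xv chv av minv maxv : W
  nus = concatRange fnus 0 n
  xv = concatRange fxv 0 n
  chv = concatRange chf 0 n
  av = concatRange fav 0 n
  minv = concatRange fmin 0 n
  maxv = concatRange fmax 0 n

  ws0 ws1 ws2 ws3 ws4 ws5 ws6 ws7 ws8 : W
  ws0 = u ++ z
  ws1 = ws0 ++ nus
  ws2 = ws1 ++ xv
  ws3 = ws2 ++ (false ∷ [])
  ws4 = ws3 ++ chv
  ws5 = ws4 ++ (not u<ᵇz ∷ [])
  ws6 = ws5 ++ av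
  ws7 = ws6 ++ minv
  ws8 = ws7 ++ maxv

  l0 : length ws0 ≡ B1n
  l0 = trans (length-++ u) (cong₂ _+_ lu lz)
  l1 : length ws1 ≡ B2n
  l1 = trans (length-++ ws0) (cong₂ _+_ l0 (trans (length-concatRange 1 fnus (λ _ → refl) 0 n) (*-identityʳ n)))
  l2 : length ws2 ≡ B3n
  l2 = trans (length-++ ws1) (cong₂ _+_ l1 (length-concatRange 2 fxv (λ _ → refl) 0 n))
  l3 : length ws3 ≡ B4n
  l3 = trans (length-++ ws2) (trans (cong (_+ 1) l2) (+-comm B3n 1))
  l4 : length ws4 ≡ B5n
  l4 = trans (length-++ ws3) (cong₂ _+_ l3 (length-concatRange 2 chf (λ _ → refl) 0 n))
  l5 : length ws5 ≡ B6n
  l5 = trans (length-++ ws4) (trans (cong (_+ 1) l4) (+-comm B5n 1))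
  l6 : length ws6 ≡ B7n
  l6 = trans (length-++ ws5) (cong₂ _+_ l5 (length-concatRange 4 fav (λ _ → refl) 0 n))

  lkP : ∀ (A B : W) {k} → k < length A → lookupD (A ++ B) k ≡ lookupD A k
  lkP A B {k} p = lookupD-++ˡ A B k p

  lkR' : ∀ (A B : W) {L} k → length A ≡ L → lookupD (A ++ B) (L + k) ≡ lookupD B k
  lkR' A B k refl = lookupD-++ʳ A B k

  B1≤ : ∀ {k} → k < B1n → k < B3n
  B1≤ {k} p = m≤n⇒m≤n+o (n * 2) (m≤n⇒m≤n+o n p)

  lk-u : ∀ t → t < n → lookupD ws0 t ≡ ut t
  lk-u t p = lkP u z (subst (t <_) (sym lu) p)

  lk-z : ∀ t → lookupD ws0 (n + t) ≡ zt t
  lk-z t = lkR' u z t lu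

  lk2 : ∀ {k} → k < B1n → lookupD ws2 k ≡ lookupD ws0 k
  lk2 {k} p = trans (lkP ws1 xv (subst (k <_) (sym l1) (m≤n⇒m≤n+o n p))) (lkP ws0 nus (subst (k <_) (sym l0) p))

  lk5 : ∀ {k} → k < B3n → lookupD ws5 k ≡ lookupD ws2 k
  lk5 {k} p = trans (lkP ws4 _ (subst (k <_) (sym l4) (m≤n⇒m≤n+o (n * 2) (≤-trans p (n≤1+n B3n)))))
             (trans (lkP ws3 chv (subst (k <_) (sym l3) (≤-trans p (n≤1+n B3n))))
                    (lkP ws2 _ (subst (k <_) (sym l2) p)))

  t<B1 : ∀ {t} → t < n → t < B1n
  t<B1 p = m≤n⇒m≤n+o n p
  nt<B1 : ∀ {t} → t < n → n + t < B1n
  nt<B1 p = +-monoʳ-< n p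

  lkR0 : ∀ (A B : W) {L} → length A ≡ L → lookupD (A ++ B) L ≡ lookupD B 0
  lkR0 A B {L} e = trans (cong (lookupD (A ++ B)) (sym (+-identityʳ L))) (lkR' A B 0 e)

  stage1 : wires ws0 gN ≡ ws1
  stage1 = trans (wires-independent ws0 gN ok)
        (cong (ws0 ++_) (trans (map-concatRange (gateVal ws0) fN 0 n)
          (concatRange-cong< 0 n (λ j p → cong (λ b → not b ∷ []) (lk-u j p)))))
    where
      ok : All (ReadsBelow (length ws0)) gN
      ok = All-concatRange fN 0 n (λ j p → subst (j <_) (sym l0) (t<B1 p) ∷ [])

  stage2 : wires ws1 gX ≡ ws2
  stage2 = trans (wires-independent ws1 gX ok)
        (cong (ws1 ++_) (trans (map-concatRange (gateVal ws1) fX 0 n)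
          (concatRange-cong< 0 n (λ j p → cong₂ (λ a b → (a ∧ b) ∷ (a ∨ b) ∷ []) (e1 j p) (e2 j p)))))
    where
      ok : All (ReadsBelow (length ws1)) gX
      ok = All-concatRange fX 0 n (λ j p →
        (subst (B1n + j <_) (sym l1) (+-monoʳ-< B1n p) , subst (n + j <_) (sym l1) (m≤n⇒m≤n+o n (nt<B1 p))) ∷
        (subst (B1n + j <_) (sym l1) (+-monoʳ-< B1n p) , subst (n + j <_) (sym l1) (m≤n⇒m≤n+o n (nt<B1 p))) ∷ [])
      e1 : ∀ j → j < n → lookupD ws1 (B1n + j) ≡ not (ut j)
      e1 j p = trans (lkR' ws0 nus j l0) (lookupD-concatRange-bits (λ t → not (ut t)) n j p)
      e2 : ∀ j → j < n → lookupD ws1 (n + j) ≡ zt j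
      e2 j p = trans (lkP ws0 nus (subst (n + j <_) (sym l0) (nt<B1 p))) (lk-z j)

  stage3 : wires ws2 (gF ∷ []) ≡ ws3
  stage3 = cong (λ b → ws2 ++ ((b ∧ b) ∷ [])) (trans (cong (lookupD ws2) (sym l2)) (lookupD-length ws2))

  tk<n : ∀ k → tk k < n
  tk<n k = s≤s (m∸n≤m m k)

  lkX : ∀ k j → j < 2 → lookupD ws2 (B2n + (tk k * 2 + j)) ≡ lookupD (fxv (tk k)) j
  lkX k j q = trans (lkR' ws1 xv (tk k * 2 + j) l1) (lookupD-concatRange 2 fxv (λ _ → refl) 0 n (tk k) j (tk<n k) q)

  idx<B3 : ∀ k j → j < 2 → B2n + (tk k * 2 + j) < B3n
  idx<B3 k zero q = +-monoʳ-< B2n (*2+0< (tk<n k))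
  idx<B3 k (suc zero) q = +-monoʳ-< B2n (*2+1< (tk<n k))
  idx<B3 k (suc (suc j)) (s≤s (s≤s ()))

  lkW : ∀ (S : W) {i} → i < B3n → lookupD (ws3 ++ S) i ≡ lookupD ws2 i
  lkW S {i} p = trans (lkP ws3 S (subst (i <_) (sym l3) (≤-trans p (n≤1+n B3n)))) (lkP ws2 (false ∷ []) (subst (i <_) (sym l2) p))

  arith1 : ∀ k → B3n + suc k * 2 ≡ B4n + (k * 2 + 1)
  arith1 k = solve 2 (λ b k → b :+ (con 1 :+ k) :* con 2 := (con 1 :+ b) :+ (k :* con 2 :+ con 1)) refl B3n k

  prevL : ∀ k → k < n → lookupD (ws3 ++ concatRange chf 0 k) (B3n + k * 2) ≡ ltFrom (suc (tk k))
  prevL zero p = trans (lkP ws3 (concatRange chf 0 0) (subst (B3n + 0 <_) (sym l3) (s≤s (≤-reflexive (+-identityʳ B3n)))))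
                (trans (lkR' ws2 (false ∷ []) 0 l2) (sym ltFrom-end))
  prevL (suc k) p = trans (cong (lookupD (ws3 ++ concatRange chf 0 (suc k))) (arith1 k))
     (trans (lkR' ws3 (concatRange chf 0 (suc k)) (k * 2 + 1) l3)
     (trans (lookupD-concatRange 2 chf (λ _ → refl) 0 (suc k) k 1 ≤-refl (s≤s (s≤s z≤n)))
       (cong ltFrom (+-∸-assoc 1 {m} {suc k} (≤-pred p)))))

  chainInv : ∀ k → k ≤ n → wires ws3 (concatRange fCh 0 k) ≡ ws3 ++ concatRange chf 0 k
  chainInv zero p = sym (++-identityʳ ws3)
  chainInv (suc k) p =
    begin
      wires ws3 (concatRange fCh 0 (suc k))
        ≡⟨ cong (wires ws3) (concatRange-snoc fCh 0 k) ⟩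
      wires ws3 (concatRange fCh 0 k ++ fCh k)
        ≡⟨ wires-++ ws3 (concatRange fCh 0 k) (fCh k) ⟩
      wires (wires ws3 (concatRange fCh 0 k)) (fCh k)
        ≡⟨ cong (λ w → wires w (fCh k)) (chainInv k (≤-trans (n≤1+n k) p)) ⟩
      (WW ++ (v1 ∷ [])) ++ (v2 ∷ [])
        ≡⟨ cong₂ (λ a b → (WW ++ (a ∷ [])) ++ (b ∷ [])) ev1 ev2 ⟩
      (WW ++ (c1 ∷ [])) ++ (ltFrom t ∷ [])
        ≡⟨ ++-assoc WW (c1 ∷ []) (ltFrom t ∷ []) ⟩
      (ws3 ++ S) ++ chf k
        ≡⟨ ++-assoc ws3 S (chf k) ⟩
      ws3 ++ (S ++ chf k)
        ≡⟨ cong (ws3 ++_) (sym (concatRange-snoc chf 0 k)) ⟩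
      ws3 ++ concatRange chf 0 (suc k) ∎
    where
      open ≡-Reasoning
      t = tk k
      S = concatRange chf 0 k
      WW = ws3 ++ S
      v1 = gateVal WW (AND (B2n + (t * 2 + 1)) (B3n + k * 2))
      v2 = gateVal (WW ++ (v1 ∷ [])) (OR (B2n + (t * 2 + 0)) (B4n + (k * 2 + 0)))
      c1 = (not (ut t) ∨ zt t) ∧ ltFrom (suc t)
      lW : length WW ≡ B4n + k * 2
      lW = trans (length-++ ws3) (cong₂ _+_ l3 (length-concatRange 2 chf (λ _ → refl) 0 k))
      ev1 : v1 ≡ c1
      ev1 = cong₂ _∧_ (trans (lkW S (idx<B3 k 1 (s≤s (s≤s z≤n)))) (lkX k 1 (s≤s (s≤s z≤n)))) (prevL k p)
      ev2 : v2 ≡ ltFrom t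
      ev2 = trans (cong₂ _∨_
              (trans (lkP WW (v1 ∷ []) (subst (B2n + (t * 2 + 0) <_) (sym lW) (≤-trans (idx<B3 k 0 (s≤s z≤n)) (≤-trans (n≤1+n B3n) (m≤m+n B4n (k * 2))))))
                     (trans (lkW S (idx<B3 k 0 (s≤s z≤n))) (lkX k 0 (s≤s z≤n))))
              (trans (cong (lookupD (WW ++ (v1 ∷ []))) (sym (+-assoc B4n (k * 2) 0))) (trans (lkR' WW (v1 ∷ []) 0 lW) ev1)))
              (sym (ltFrom-step t (tk<n k)))

  stage4 : wires ws3 gCh ≡ ws4
  stage4 = chainInv n ≤-refl

  lkLt : lookupD ws4 ltI ≡ u<ᵇz
  lkLt = trans (cong (lookupD ws4) (arith1 m))
     (trans (lkR' ws3 chv (m * 2 + 1) l3)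
     (trans (lookupD-concatRange 2 chf (λ _ → refl) 0 n m 1 ≤-refl (s≤s (s≤s z≤n)))
       (cong ltFrom (n∸n≡0 m))))

  stage5 : wires ws4 (gNL ∷ []) ≡ ws5
  stage5 = cong (λ b → ws4 ++ (not b ∷ [])) lkLt

  B3≤B5 : B3n ≤ B5n
  B3≤B5 = ≤-trans (n≤1+n B3n) (m≤m+n B4n (n * 2))

  a5u : ∀ t → t < n → lookupD ws5 t ≡ ut t
  a5u t p = trans (lk5 (B1≤ (t<B1 p))) (trans (lk2 (t<B1 p)) (lk-u t p))
  a5z : ∀ t → t < n → lookupD ws5 (n + t) ≡ zt t
  a5z t p = trans (lk5 (B1≤ (nt<B1 p))) (trans (lk2 (nt<B1 p)) (lk-z t))
  a5l : lookupD ws5 ltI ≡ u<ᵇz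
  a5l = trans (lkP ws4 (not u<ᵇz ∷ []) (subst (ltI <_) (sym l4) ≤-refl)) lkLt
  a5n : lookupD ws5 B5n ≡ not u<ᵇz
  a5n = lkR0 ws4 (not u<ᵇz ∷ []) l4

  stage6 : wires ws5 gA ≡ ws6
  stage6 = trans (wires-independent ws5 gA ok)
        (cong (ws5 ++_) (trans (map-concatRange (gateVal ws5) fA 0 n)
          (concatRange-cong< 0 n (λ j p → e j p))))
    where
      b< : ∀ {x} → x ≤ B5n → x < length ws5
      b< {x} q = subst (x <_) (sym l5) (s≤s q)
      u< : ∀ {j} → j < n → j < length ws5
      u< p = b< (≤-trans (<⇒≤ (B1≤ (t<B1 p))) B3≤B5)
      z< : ∀ {j} → j < n → n + j < length ws5
      z< p = b< (≤-trans (<⇒≤ (B1≤ (nt<B1 p))) B3≤B5)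
      ok : All (ReadsBelow (length ws5)) gA
      ok = All-concatRange fA 0 n (λ j p →
        (u< p , b< (n≤1+n ltI)) ∷ (z< p , b< ≤-refl) ∷ (z< p , b< (n≤1+n ltI)) ∷ (u< p , b< ≤-refl) ∷ [])
      e : ∀ j → j < n → map (gateVal ws5) (fA j) ≡ fav j
      e j p rewrite a5u j p | a5z j p | a5l | a5n = refl

  a6 : ∀ t j → t < n → j < 4 → lookupD ws6 (B6n + (t * 4 + j)) ≡ lookupD (fav t) j
  a6 t j p q = trans (lkR' ws5 av (t * 4 + j) l5) (lookupD-concatRange 4 fav (λ _ → refl) 0 n t j p q)

  i6 : ∀ {t} j → j < 4 → t < n → B6n + (t * 4 + j) < length ws6
  i6 {t} j q p = subst (B6n + (t * 4 + j) <_) (sym l6) (+-monoʳ-< B6n (*4+j< j q p))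

  stage7 : wires ws6 gB ≡ ws7
  stage7 = trans (wires-independent ws6 gB ok)
        (cong (ws6 ++_) (trans (map-concatRange (gateVal ws6) fB 0 n)
          (concatRange-cong< 0 n (λ j p → cong₂ (λ a b → (a ∨ b) ∷ []) (a6 j 0 p (s≤s z≤n)) (a6 j 1 p (s≤s (s≤s z≤n)))))))
    where
      ok : All (ReadsBelow (length ws6)) gB
      ok = All-concatRange fB 0 n (λ j p → (i6 0 (s≤s z≤n) p , i6 1 (s≤s (s≤s z≤n)) p) ∷ [])

  stage8 : wires ws7 gC ≡ ws8
  stage8 = trans (wires-independent ws7 gC ok)
        (cong (ws7 ++_) (trans (map-concatRange (gateVal ws7) fC 0 n)
          (concatRange-cong< 0 n (λ j p → cong₂ (λ a b → (a ∨ b) ∷ [])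
             (trans (lkP ws6 minv (i6 2 q2 p)) (a6 j 2 p q2))
             (trans (lkP ws6 minv (i6 3 q3 p)) (a6 j 3 p q3))))))
    where
      q2 : 2 < 4
      q2 = s≤s (s≤s (s≤s z≤n))
      q3 : 3 < 4
      q3 = s≤s (s≤s (s≤s (s≤s z≤n)))
      l6' : length ws6 ≤ length ws7
      l6' = ≤-trans (m≤m+n (length ws6) (length minv)) (≤-reflexive (sym (length-++ ws6)))
      ok : All (ReadsBelow (length ws7)) gC
      ok = All-concatRange fC 0 n (λ j p → (≤-trans (i6 2 q2 p) l6' , ≤-trans (i6 3 q3 p) l6') ∷ [])

  prelude-sem : wires ws0 prelude ≡ ws8
  prelude-sem =
    begin
      wires ws0 (gN ++ R1)   ≡⟨ wires-++ ws0 gN R1 ⟩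
      wires (wires ws0 gN) R1  ≡⟨ cong (λ w → wires w R1) stage1 ⟩
      wires ws1 (gX ++ R2)   ≡⟨ wires-++ ws1 gX R2 ⟩
      wires (wires ws1 gX) R2  ≡⟨ cong (λ w → wires w R2) stage2 ⟩
      wires ws2 ((gF ∷ []) ++ R3)  ≡⟨ wires-++ ws2 (gF ∷ []) R3 ⟩
      wires (wires ws2 (gF ∷ [])) R3  ≡⟨ cong (λ w → wires w R3) stage3 ⟩
      wires ws3 (gCh ++ R4)   ≡⟨ wires-++ ws3 gCh R4 ⟩
      wires (wires ws3 gCh) R4  ≡⟨ cong (λ w → wires w R4) stage4 ⟩
      wires ws4 ((gNL ∷ []) ++ R5)  ≡⟨ wires-++ ws4 (gNL ∷ []) R5 ⟩
      wires (wires ws4 (gNL ∷ [])) R5  ≡⟨ cong (λ w → wires w R5) stage5 ⟩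
      wires ws5 (gA ++ R6)  ≡⟨ wires-++ ws5 gA R6 ⟩
      wires (wires ws5 gA) R6  ≡⟨ cong (λ w → wires w R6) stage6 ⟩
      wires ws6 (gB ++ gC)  ≡⟨ wires-++ ws6 gB gC ⟩
      wires (wires ws6 gB) gC  ≡⟨ cong (λ w → wires w gC) stage7 ⟩
      wires ws7 gC  ≡⟨ stage8 ⟩
      ws8 ∎
    where
      open ≡-Reasoning
      R6 = gB ++ gC
      R5 = gA ++ R6
      R4 = (gNL ∷ []) ++ R5
      R3 = gCh ++ R4
      R2 = (gF ∷ []) ++ R3
      R1 = gX ++ R2

  ∧∨-if : ∀ a b c → (a ∧ c) ∨ (b ∧ not c) ≡ (if c then a else b)
  ∧∨-if false false false = refl
  ∧∨-if false false true = refl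
  ∧∨-if false true false = refl
  ∧∨-if false true true = refl
  ∧∨-if true false false = refl
  ∧∨-if true false true = refl
  ∧∨-if true true false = refl
  ∧∨-if true true true = refl

  concatRange-if : ∀ c (x y : W) → length x ≡ n → length y ≡ n →
    concatRange (λ t → (if c then lookupD x t else lookupD y t) ∷ []) 0 n ≡ (if c then x else y)
  concatRange-if false x y lx ly = trans (cong (concatRange (λ t → lookupD y t ∷ []) 0) (sym ly)) (concatRange-lookupD y)
  concatRange-if true x y lx ly = trans (cong (concatRange (λ t → lookupD x t ∷ []) 0) (sym lx)) (concatRange-lookupD x)

  min++max : minv ++ maxv ≡ (if u<ᵇz then u ++ z else z ++ u)
  min++max = trans (cong₂ _++_ (trans (concatRange-cong (λ t → cong (_∷ []) (∧∨-if (ut t) (zt t) u<ᵇz)) 0 n) (concatRange-if u<ᵇz u z lu lz))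
                         (trans (concatRange-cong (λ t → cong (_∷ []) (∧∨-if (zt t) (ut t) u<ᵇz)) 0 n) (concatRange-if u<ᵇz z u lz lu))) (fin u<ᵇz)
    where
      fin : ∀ c → (if c then u else z) ++ (if c then z else u) ≡ (if c then u ++ z else z ++ u)
      fin false = refl
      fin true = refl

  withPrelude-sem : ∀ C → evalC (withPrelude C) (u ++ z) ≡ evalC C (if u<ᵇz then u ++ z else z ++ u)
  withPrelude-sem C =
    begin
      lastD (wires ws0 (prelude ++ map (shiftGate B7n) C))
        ≡⟨ cong lastD (wires-++ ws0 prelude _) ⟩
      lastD (wires (wires ws0 prelude) (map (shiftGate B7n) C))
        ≡⟨ cong (λ w → lastD (wires w (map (shiftGate B7n) C))) (trans prelude-sem (++-assoc ws6 minv maxv)) ⟩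
      lastD (wires (ws6 ++ (minv ++ maxv)) (map (shiftGate B7n) C))
        ≡⟨ cong (λ k → lastD (wires (ws6 ++ (minv ++ maxv)) (map (shiftGate k) C))) (sym l6) ⟩
      evalC (map (shiftGate (length ws6)) C) (ws6 ++ (minv ++ maxv))
        ≡⟨ evalC-shiftGate ws6 ((ut 0 ∧ u<ᵇz) ∨ (zt 0 ∧ not u<ᵇz)) (concatRange fmin 1 m ++ maxv) C ⟩
      evalC C (minv ++ maxv)
        ≡⟨ cong (evalC C) min++max ⟩
      evalC C (if u<ᵇz then u ++ z else z ++ u) ∎
    where open ≡-Reasoning

gateFields : Gate → List W
gateFields (AND i j) = (false ∷ []) ∷ toBinary i ∷ toBinary j ∷ []
gateFields (OR i j) = (true ∷ []) ∷ toBinary i ∷ toBinary j ∷ []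
gateFields (NOT i) = [] ∷ toBinary i ∷ toBinary i ∷ []

gatesFields : Circuit → List W
gatesFields [] = []
gatesFields (g ∷ gs) = gateFields g ++ gatesFields gs

encGates : Circuit → W
encGates gs = encList (gatesFields gs)

gatesFields-++ : ∀ gs hs → gatesFields (gs ++ hs) ≡ gatesFields gs ++ gatesFields hs
gatesFields-++ [] hs = refl
gatesFields-++ (g ∷ gs) hs = trans (cong (gateFields g ++_) (gatesFields-++ gs hs)) (sym (++-assoc (gateFields g) _ _))

encGates-++ : ∀ gs hs → encGates (gs ++ hs) ≡ encGates gs ++ encGates hs
encGates-++ gs hs = trans (cong encList (gatesFields-++ gs hs)) (encList-++ (gatesFields gs) (gatesFields hs))

encGates-concatRange : ∀ f a k → encGates (concatRange f a k) ≡ concatRange (λ p → encGates (f p)) a k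
encGates-concatRange f a zero = refl
encGates-concatRange f a (suc k) = trans (encGates-++ (f a) (concatRange f (suc a) k)) (cong (encGates (f a) ++_) (encGates-concatRange f (suc a) k))

parseGates-gatesFields : ∀ gs rest gs' → parseGates rest ≡ just gs' → parseGates (gatesFields gs ++ rest) ≡ just (gs ++ gs')
parseGates-gatesFields [] rest gs' e = e
parseGates-gatesFields (AND i j ∷ gs) rest gs' e rewrite parseGates-gatesFields gs rest gs' e | bin-toBinary i | bin-toBinary j = refl
parseGates-gatesFields (OR i j ∷ gs) rest gs' e rewrite parseGates-gatesFields gs rest gs' e | bin-toBinary i | bin-toBinary j = refl
parseGates-gatesFields (NOT i ∷ gs) rest gs' e rewrite parseGates-gatesFields gs rest gs' e | bin-toBinary i = refl

ltB-irrefl : ∀ x → ltB x x ≡ false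
ltB-irrefl [] = refl
ltB-irrefl (false ∷ x) rewrite ltB-irrefl x = refl
ltB-irrefl (true ∷ x) rewrite ltB-irrefl x = refl

ltB-trans : ∀ x y z → ltB x y ≡ true → ltB y z ≡ true → ltB x z ≡ true
ltB-trans [] y z () q
ltB-trans (a ∷ x) [] z () q
ltB-trans (a ∷ x) (b ∷ y) [] p ()
ltB-trans (false ∷ x) (false ∷ y) (false ∷ z) p q = ltB-trans x y z p q
ltB-trans (false ∷ x) (false ∷ y) (true ∷ z) p q = refl
ltB-trans (false ∷ x) (true ∷ y) (false ∷ z) p ()
ltB-trans (false ∷ x) (true ∷ y) (true ∷ z) p q = refl
ltB-trans (true ∷ x) (false ∷ y) z () q
ltB-trans (true ∷ x) (true ∷ y) (false ∷ z) p ()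
ltB-trans (true ∷ x) (true ∷ y) (true ∷ z) p q = ltB-trans x y z p q

ltB-asym : ∀ x y → ltB x y ≡ true → ltB y x ≡ false
ltB-asym x y p with ltB y x in e
... | false = refl
... | true with trans (sym (ltB-irrefl x)) (ltB-trans x y x p e)
...   | ()

ltB-total : ∀ x y → length x ≡ length y → ¬ (x ≡ y) → (ltB x y ≡ true) ⊎ (ltB y x ≡ true)
ltB-total [] [] e ne = ⊥-elim (ne refl)
ltB-total (false ∷ x) (false ∷ y) e ne = ltB-total x y (suc-injective e) (λ q → ne (cong (false ∷_) q))
ltB-total (false ∷ x) (true ∷ y) e ne = inj₁ refl
ltB-total (true ∷ x) (false ∷ y) e ne = inj₂ refl
ltB-total (true ∷ x) (true ∷ y) e ne = ltB-total x y (suc-injective e) (λ q → ne (cong (true ∷_) q))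

ltB⇒≢ : ∀ {x y} → ltB x y ≡ true → ¬ (x ≡ y)
ltB⇒≢ {x} p refl with trans (sym p) (ltB-irrefl x)
... | ()

ltB⇒<ₗ : ∀ x y → ltB x y ≡ true → x <ₗ y
ltB⇒<ₗ [] y ()
ltB⇒<ₗ (a ∷ x) [] ()
ltB⇒<ₗ (false ∷ x) (false ∷ y) p = there (ltB⇒<ₗ x y p)
ltB⇒<ₗ (false ∷ x) (true ∷ y) p = here
ltB⇒<ₗ (true ∷ x) (false ∷ y) ()
ltB⇒<ₗ (true ∷ x) (true ∷ y) p = there (ltB⇒<ₗ x y p)

edgeColour : Circuit → W → W → Bool
edgeColour C u v = evalC C (if ltB u v then u ++ v else v ++ u)

sameBit : Bool → Bool → Bool
sameBit x y = if x then y else not y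

-- The item with L items left (itself included) has index n ∸ L: the last item is always kept,
-- the one before it never, and the others iff their colour bit is b.
selected : ℕ → W → Bool → ℕ → Bool
selected n bs b (suc (suc (suc m))) = sameBit (lookupD bs (n ∸ suc (suc (suc m)))) b
selected n bs b (suc (suc zero)) = false
selected n bs b _ = true

countTrue countFalse : W → ℕ
countTrue [] = 0
countTrue (true ∷ w) = suc (countTrue w)
countTrue (false ∷ w) = countTrue w
countFalse [] = 0
countFalse (true ∷ w) = countFalse w
countFalse (false ∷ w) = suc (countFalse w)

isZero : ℕ → Bool
isZero zero = true
isZero (suc _) = false

majorityBit : W → Bool
majorityBit bs = isZero (countFalse bs ∸ countTrue bs)

bit-mono : ∀ u v → (u ≡ true → v ≡ true) → bit u ≤ bit v
bit-mono false v f = z≤n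
bit-mono true v f rewrite f refl = ≤-refl

rank : W → List W → ℕ
rank s0 [] = 0
rank s0 (x ∷ xs) = bit (ltB x s0) + rank s0 xs

rank-mono : ∀ a c xs → All (λ x → ltB x a ≡ true → ltB x c ≡ true) xs → rank a xs ≤ rank c xs
rank-mono a c [] [] = z≤n
rank-mono a c (x ∷ xs) (p ∷ ps) = +-mono-≤ (bit-mono (ltB x a) (ltB x c) p) (rank-mono a c xs ps)

rank-strict : ∀ a c xs → All (λ x → ltB x a ≡ true → ltB x c ≡ true) xs → a ∈ xs → ltB a c ≡ true → rank a xs < rank c xs
rank-strict a c (x ∷ xs) (p ∷ ps) (here refl) q rewrite ltB-irrefl a | q = s≤s (rank-mono a c xs ps)
rank-strict a c (x ∷ xs) (p ∷ ps) (there m) q = +-mono-≤-< (bit-mono (ltB x a) (ltB x c) p) (rank-strict a c xs ps m q)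

rank<length : ∀ a xs → a ∈ xs → rank a xs < length xs
rank<length a (x ∷ xs) (here refl) rewrite ltB-irrefl a = s≤s (cb xs)
  where
    cb : ∀ ys → rank a ys ≤ length ys
    cb [] = z≤n
    cb (y ∷ ys) = +-mono-≤ (bit≤1 (ltB y a)) (cb ys)
rank<length a (x ∷ xs) (there m) = +-mono-≤-< (bit≤1 (ltB x a)) (rank<length a xs m)

length-buckets : ∀ (ρ : W → ℕ) k xs → All (λ x → ρ x < k) xs →
  sumRange (λ r → length (keep (λ x → ρ x ≡ᵇ r) xs)) 0 k ≡ length xs
length-buckets ρ k [] [] = sumRange-0 0 k
length-buckets ρ k (x ∷ xs) (p ∷ ps) =
  trans (sumRange-cong (λ r → length-keep (λ y → ρ y ≡ᵇ r) x xs) 0 k)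
  (trans (sumRange-+ (λ r → bit (ρ x ≡ᵇ r)) (λ r → length (keep (λ y → ρ y ≡ᵇ r) xs)) 0 k)
         (cong₂ _+_ (sumRange-indicator-1 (ρ x) 0 k z≤n p) (length-buckets ρ k xs ps)))

module SortByRank (N : ℕ) (T : List W) (lenT : All (λ (x : W) → length x ≡ N) T) (dT : AllPairs (λ x y → ¬ (x ≡ y)) T) where
  rk : W → ℕ
  rk x = rank x T

  bucket : ℕ → List W
  bucket r = keep (λ x → rk x ≡ᵇ r) T

  sortedList : ℕ → List W
  sortedList k = concatRange bucket 0 k

  rank-< : ∀ {a c} → a ∈ T → ltB a c ≡ true → rk a < rk c
  rank-< {a} {c} m q = rank-strict a c T (All.tabulate (λ {x} _ p → ltB-trans x a c p q)) m q

  rank-injective : ∀ {x y} → x ∈ T → y ∈ T → ¬ (x ≡ y) → ¬ (rk x ≡ rk y)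
  rank-injective {x} {y} mx my ne e with ltB-total x y (trans (All.lookup lenT mx) (sym (All.lookup lenT my))) ne
  ... | inj₁ p = <-irrefl e (rank-< mx p)
  ... | inj₂ p = <-irrefl (sym e) (rank-< my p)

  ∈bucket : ∀ {r x} → x ∈ bucket r → (x ∈ T) × (rk x ≡ r)
  ∈bucket {r} {x} m with ∈-keep (λ x → rk x ≡ᵇ r) T m
  ... | (mT , e) = mT , ≡ᵇ-sound (rk x) r e

  ∈buckets : ∀ a k {y} → y ∈ concatRange bucket a k → (y ∈ T) × (a ≤ rk y)
  ∈buckets a (suc k) {y} m with ∈-++⁻ (bucket a) m
  ... | inj₁ m1 = proj₁ (∈bucket m1) , ≤-reflexive (sym (proj₂ (∈bucket m1)))
  ... | inj₂ m2 = proj₁ (∈buckets (suc a) k m2) , ≤-trans (n≤1+n a) (proj₂ (∈buckets (suc a) k m2))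

  ∈sorted : ∀ k {y} → y ∈ sortedList k → y ∈ T
  ∈sorted k m = proj₁ (∈buckets 0 k m)

  Less : W → W → Set
  Less x y = ltB x y ≡ true

  bucket-sorted : ∀ r → AllPairs Less (bucket r)
  bucket-sorted r = AllPairs-map-All (bucket r) (All.tabulate ∈bucket) (AllPairs-keep (λ x → rk x ≡ᵇ r) T dT)
    (λ {x} {y} ax ay ne → ⊥-elim (rank-injective (proj₁ ax) (proj₁ ay) ne (trans (proj₂ ax) (sym (proj₂ ay)))))

  sorted : ∀ a k → AllPairs Less (concatRange bucket a k)
  sorted a zero = []
  sorted a (suc k) = AllPairsₚ.++⁺ (bucket-sorted a) (sorted (suc a) k)
    (All.tabulate (λ mx → All.tabulate (λ my → cross (∈bucket mx) (∈buckets (suc a) k my))))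
    where
      cross : ∀ {x y} → (x ∈ T) × (rk x ≡ a) → (y ∈ T) × (suc a ≤ rk y) → Less x y
      cross {x} {y} (mx , ex) (my , ey) with ltB-total x y (trans (All.lookup lenT mx) (sym (All.lookup lenT my)))
                                                   (λ e → <-irrefl (trans (sym ex) (cong rk e)) ey)
      ... | inj₁ p = p
      ... | inj₂ p = ⊥-elim (<-asym (rank-< my p) (subst (_< rk y) (sym ex) ey))

  length-sortedList : ∀ k → length T ≤ k → length (sortedList k) ≡ length T
  length-sortedList k le = trans (length-concatRange-sumRange bucket 0 k)
    (length-buckets rk k T (All.tabulate (λ {x} m → ≤-trans (rank<length x T m) le)))

count : Bool → W → ℕ
count b [] = 0
count b (x ∷ xs) = bit (sameBit x b) + count b xs

count-true : ∀ w → count true w ≡ countTrue w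
count-true [] = refl
count-true (true ∷ w) = cong suc (count-true w)
count-true (false ∷ w) = count-true w

count-false : ∀ w → count false w ≡ countFalse w
count-false [] = refl
count-false (true ∷ w) = count-false w
count-false (false ∷ w) = cong suc (count-false w)

countTrue+countFalse : ∀ w → countTrue w + countFalse w ≡ length w
countTrue+countFalse [] = refl
countTrue+countFalse (true ∷ w) = cong suc (countTrue+countFalse w)
countTrue+countFalse (false ∷ w) = trans (+-suc (countTrue w) (countFalse w)) (cong suc (countTrue+countFalse w))

majority-count : ∀ w → length w ≤ 2 * count (majorityBit w) w
majority-count w with countFalse w ∸ countTrue w in e
... | zero rewrite count-true w = subst (_≤ 2 * countTrue w) (countTrue+countFalse w)
        (subst (countTrue w + countFalse w ≤_) (sym (cong (countTrue w +_) (+-identityʳ (countTrue w)))) (+-monoʳ-≤ (countTrue w) (m∸n≡0⇒m≤n e)))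
... | suc k rewrite count-false w = subst (_≤ 2 * countFalse w) (countTrue+countFalse w)
        (subst (countTrue w + countFalse w ≤_) (sym (cong (countFalse w +_) (+-identityʳ (countFalse w)))) (+-monoˡ-≤ (countFalse w) lt))
  where
    lt : countTrue w ≤ countFalse w
    lt with ≤-total (countTrue w) (countFalse w)
    ... | inj₁ p = p
    ... | inj₂ p = ⊥-elim (1+n≢0 (trans (sym e) (m≤n⇒m∸n≡0 p)))

-- Bellantoni–Cook programming

NIL : ∀ {n s} → BC n s
NIL = scomp zer [] []

APPLY : ∀ {n s} → BC 0 1 → BC n s → BC n s
APPLY h a = scomp h [] (a ∷ [])

S0 S1 PR : ∀ {n s} → BC n s → BC n s
S0 = APPLY suc0
S1 = APPLY suc1
PR = APPLY pred

Sb : ∀ {n s} → Bool → BC n s → BC n s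
Sb false = S0
Sb true = S1

CND : ∀ {n s} → BC n s → BC n s → BC n s → BC n s
CND a b c = scomp cond [] (a ∷ b ∷ c ∷ [])

ONE : ∀ {n s} → BC n s
ONE = S1 NIL

APP : ∀ {k n s} → BC k 0 → Vec (BC n 0) k → BC n s
APP h rs = scomp h rs []

APS : ∀ {k n s} → BC k 1 → Vec (BC n 0) k → BC n s → BC n s
APS h rs a = scomp h rs (a ∷ [])

projsVia : ∀ {n m} → (Fin n → Fin m) → Vec (BC m 0) n
projsVia f = tabulate (λ i → projN (f i))

projs : ∀ {n} → Vec (BC n 0) n
projs = projsVia (λ i → i)

evalsN-projsVia : ∀ {n m} (f : Fin n → Fin m) (xs : Vec W m) →
  evalsN (projsVia f) xs ≡ tabulate (λ i → lookup xs (f i))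
evalsN-projsVia {zero} f xs = refl
evalsN-projsVia {suc n} f xs = cong (lookup xs (f zero) ∷_) (evalsN-projsVia (λ i → f (suc i)) xs)

evalsN-projs : ∀ {n} (xs : Vec W n) → evalsN projs xs ≡ xs
evalsN-projs xs = trans (evalsN-projsVia (λ i → i) xs) (tabulate∘lookup xs)

evalsN-drop₁ : ∀ {n} (x : W) (xs : Vec W n) → evalsN (projsVia suc) (x ∷ xs) ≡ xs
evalsN-drop₁ x xs = trans (evalsN-projsVia suc (x ∷ xs)) (tabulate∘lookup xs)

evalsN-drop₂ : ∀ {n} (x y : W) (xs : Vec W n) → evalsN (projsVia (λ i → suc (suc i))) (x ∷ y ∷ xs) ≡ xs
evalsN-drop₂ x y xs = trans (evalsN-projsVia (λ i → suc (suc i)) (x ∷ y ∷ xs)) (tabulate∘lookup xs)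

cond-sem : ∀ a b c → ⟦ cond ⟧ [] (a ∷ b ∷ c ∷ []) ≡ branch a b c
cond-sem [] b c = refl
cond-sem (false ∷ a) b c = refl
cond-sem (true ∷ a) b c = refl

pred-sem : ∀ a → ⟦ pred ⟧ [] (a ∷ []) ≡ behead a
pred-sem [] = refl
pred-sem (x ∷ a) = refl

module _ {n s} (xs : Vec W n) (as : Vec W s) where
  CND-sem : ∀ {a b c : BC n s} {va vb vc} → ⟦ a ⟧ xs as ≡ va → ⟦ b ⟧ xs as ≡ vb →
          ⟦ c ⟧ xs as ≡ vc → ⟦ CND a b c ⟧ xs as ≡ branch va vb vc
  CND-sem {a} {b} {c} refl refl refl = cond-sem (⟦ a ⟧ xs as) (⟦ b ⟧ xs as) (⟦ c ⟧ xs as)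

  PR-sem : ∀ {a : BC n s} {va} → ⟦ a ⟧ xs as ≡ va → ⟦ PR a ⟧ xs as ≡ behead va
  PR-sem {a} refl = pred-sem (⟦ a ⟧ xs as)

  Sb-sem : ∀ b {a : BC n s} {va} → ⟦ a ⟧ xs as ≡ va → ⟦ Sb b a ⟧ xs as ≡ b ∷ va
  Sb-sem false refl = refl
  Sb-sem true refl = refl

  APP-sem : ∀ {k} {h : BC k 0} {rs : Vec (BC n 0) k} {vs} → evalsN rs xs ≡ vs →
          ⟦ APP h rs ⟧ xs as ≡ ⟦ h ⟧ vs []
  APP-sem refl = refl

  APS-sem : ∀ {k} {h : BC k 1} {rs : Vec (BC n 0) k} {a : BC n s} {vs va} → evalsN rs xs ≡ vs →
          ⟦ a ⟧ xs as ≡ va → ⟦ APS h rs a ⟧ xs as ≡ ⟦ h ⟧ vs (va ∷ [])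
  APS-sem refl refl = refl

ONES : BC 1 0
ONES = srec NIL (S1 (projS zero)) (S1 (projS zero))

ONES-sem : ∀ x → ⟦ ONES ⟧ (x ∷ []) [] ≡ unary (length x)
ONES-sem [] = refl
ONES-sem (false ∷ x) = cong (true ∷_) (ONES-sem x)
ONES-sem (true ∷ x) = cong (true ∷_) (ONES-sem x)

CAT : BC 1 1
CAT = srec (projS zero) (S0 (projS zero)) (S1 (projS zero))

CAT-sem : ∀ x a → ⟦ CAT ⟧ (x ∷ []) (a ∷ []) ≡ x ++ a
CAT-sem [] a = refl
CAT-sem (false ∷ x) a = cong (false ∷_) (CAT-sem x a)
CAT-sem (true ∷ x) a = cong (true ∷_) (CAT-sem x a)

DROP : BC 1 1
DROP = srec (projS zero) (PR (projS zero)) (PR (projS zero))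

DROP-sem : ∀ c a → ⟦ DROP ⟧ (c ∷ []) (a ∷ []) ≡ drop (length c) a
DROP-sem [] a = refl
DROP-sem (false ∷ c) a = trans (PR-sem (c ∷ []) (_ ∷ a ∷ []) {a = projS zero} (DROP-sem c a)) (behead-drop (length c) a)
DROP-sem (true ∷ c) a = trans (PR-sem (c ∷ []) (_ ∷ a ∷ []) {a = projS zero} (DROP-sem c a)) (behead-drop (length c) a)

PARITY : BC 1 0
PARITY = srec NIL (CND (projS zero) ONE NIL) (CND (projS zero) ONE NIL)

branch-flag-not : ∀ b → branch (flag b) (true ∷ []) [] ≡ flag (not b)
branch-flag-not false = refl
branch-flag-not true = refl

PARITY-sem : ∀ y → ⟦ PARITY ⟧ (y ∷ []) [] ≡ flag (parity (length y))
PARITY-sem [] = refl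
PARITY-sem (false ∷ y) = trans (CND-sem (y ∷ []) (_ ∷ []) {a = projS zero} {b = ONE} {c = NIL} (PARITY-sem y) refl refl) (branch-flag-not (parity (length y)))
PARITY-sem (true ∷ y) = trans (CND-sem (y ∷ []) (_ ∷ []) {a = projS zero} {b = ONE} {c = NIL} (PARITY-sem y) refl refl) (branch-flag-not (parity (length y)))

PARITY₀ : ∀ {n s} → BC (suc n) s
PARITY₀ = APP PARITY (projN zero ∷ [])

PARITY₀-sem : ∀ {n s} (y : W) (xs : Vec W n) (as : Vec W s) → ⟦ PARITY₀ {n} {s} ⟧ (y ∷ xs) as ≡ flag (parity (length y))
PARITY₀-sem y xs as = PARITY-sem y

-- An encoded list is a sequence of bit pairs (v , t): t = 1 makes v a data bit, t = 0 ends a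
-- string. SCAN-STEP acts at the first bit of each pair, recognised by an odd number of remaining
-- bits, and passes the result through at the second.
SCAN-STEP : ∀ {n} → BC (suc n) 1 → BC (suc n) 1 → BC (suc n) 1
SCAN-STEP T D = CND PARITY₀ (projS zero) (CND (projN zero) T D)

module _ {n} (T D : BC (suc n) 1) (y : W) (xs : Vec W n) (r : W) where
  SCAN-STEP-flag : parity (length y) ≡ false → ⟦ SCAN-STEP T D ⟧ (y ∷ xs) (r ∷ []) ≡ r
  SCAN-STEP-flag p = CND-sem (y ∷ xs) (r ∷ []) {a = PARITY₀} {b = projS zero} {c = CND (projN zero) T D}
                (trans (PARITY₀-sem y xs (r ∷ [])) (cong flag p)) refl refl

  SCAN-STEP-bit : parity (length y) ≡ true → ⟦ SCAN-STEP T D ⟧ (y ∷ xs) (r ∷ []) ≡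
           branch y (⟦ T ⟧ (y ∷ xs) (r ∷ [])) (⟦ D ⟧ (y ∷ xs) (r ∷ []))
  SCAN-STEP-bit p = trans (CND-sem (y ∷ xs) (r ∷ []) {a = PARITY₀} {b = projS zero} {c = CND (projN zero) T D}
                (trans (PARITY₀-sem y xs (r ∷ [])) (cong flag p)) refl refl)
                (CND-sem (y ∷ xs) (r ∷ []) {a = projN zero} {b = T} {c = D} refl refl refl)

not-false : ∀ {b} → b ≡ false → not b ≡ true
not-false refl = refl

module Scan {n} (g : BC n 0) (T D : Bool → BC (suc n) 1) where
  SCAN : BC (suc n) 0
  SCAN = srec g (SCAN-STEP (T false) (D false)) (SCAN-STEP (T true) (D true))

  R : W → Vec W n → W
  R w xs = ⟦ SCAN ⟧ (w ∷ xs) []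

  scan-flag : ∀ c y xs → EvenLength y → R (c ∷ y) xs ≡ R y xs
  scan-flag false y xs e = SCAN-STEP-flag (T false) (D false) y xs (R y xs) e
  scan-flag true y xs e = SCAN-STEP-flag (T true) (D true) y xs (R y xs) e

  scan-end : ∀ rest xs → EvenLength rest → R (false ∷ false ∷ rest) xs ≡
           ⟦ T false ⟧ ((false ∷ rest) ∷ xs) (R rest xs ∷ [])
  scan-end rest xs e = trans (SCAN-STEP-bit (T false) (D false) (false ∷ rest) xs (R (false ∷ rest) xs) (not-false e))
                           (cong (λ z → ⟦ T false ⟧ ((false ∷ rest) ∷ xs) (z ∷ [])) (scan-flag false rest xs e))

  scan-bit : ∀ b X xs → EvenLength X → R (b ∷ true ∷ X) xs ≡ ⟦ D b ⟧ ((true ∷ X) ∷ xs) (R X xs ∷ [])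
  scan-bit false X xs e = trans (SCAN-STEP-bit (T false) (D false) (true ∷ X) xs (R (true ∷ X) xs) (not-false e))
                           (cong (λ z → ⟦ D false ⟧ ((true ∷ X) ∷ xs) (z ∷ [])) (scan-flag true X xs e))
  scan-bit true X xs e = trans (SCAN-STEP-bit (T true) (D true) (true ∷ X) xs (R (true ∷ X) xs) (not-false e))
                           (cong (λ z → ⟦ D true ⟧ ((true ∷ X) ∷ xs) (z ∷ [])) (scan-flag true X xs e))

module HeadScan = Scan {0} NIL (λ _ → NIL) (λ b → Sb b (projS zero))

HEAD : BC 1 0
HEAD = HeadScan.SCAN

HEAD-sem : ∀ s rest → EvenLength rest → ⟦ HEAD ⟧ (encThen s rest ∷ []) [] ≡ s
HEAD-sem [] rest e = HeadScan.scan-end rest [] e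
HEAD-sem (b ∷ s) rest e = trans (HeadScan.scan-bit b (encThen s rest) [] (evenLength-encThen s rest e))
  (Sb-sem ((true ∷ encThen s rest) ∷ []) (HeadScan.R (encThen s rest) [] ∷ []) b {a = projS zero} (HEAD-sem s rest e))

module TailScan = Scan {0} NIL (λ _ → PR (projN zero)) (λ _ → projS zero)

TAIL : BC 1 0
TAIL = TailScan.SCAN

TAIL-sem : ∀ s rest → EvenLength rest → ⟦ TAIL ⟧ (encThen s rest ∷ []) [] ≡ rest
TAIL-sem [] rest e = trans (TailScan.scan-end rest [] e) (pred-sem (false ∷ rest))
TAIL-sem (b ∷ s) rest e = trans (TailScan.scan-bit b (encThen s rest) [] (evenLength-encThen s rest e)) (TAIL-sem s rest e)

module CountScan = Scan {0} NIL (λ _ → S1 (projS zero)) (λ _ → projS zero)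

COUNT : BC 1 0
COUNT = CountScan.SCAN

COUNT-encThen : ∀ s rest → EvenLength rest → ⟦ COUNT ⟧ (encThen s rest ∷ []) [] ≡ true ∷ ⟦ COUNT ⟧ (rest ∷ []) []
COUNT-encThen [] rest e = CountScan.scan-end rest [] e
COUNT-encThen (b ∷ s) rest e = trans (CountScan.scan-bit b (encThen s rest) [] (evenLength-encThen s rest e)) (COUNT-encThen s rest e)

COUNT-sem : ∀ ss → ⟦ COUNT ⟧ (encList ss ∷ []) [] ≡ unary (length ss)
COUNT-sem [] = refl
COUNT-sem (s ∷ ss) = trans (COUNT-encThen s (encList ss) (evenLength-encList ss)) (cong (true ∷_) (COUNT-sem ss))

-- F is run on every suffix encList (s ∷ ss) of the encoded input; the suffixes after the end
-- markers are the recursion arguments with their first bit removed.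
module MapSuffixes {n} (F : BC (suc n) 0) where
  EMIT : BC (suc n) 0
  EMIT = CND (APP ONES (PR (projN zero) ∷ [])) NIL (APP F (PR (projN zero) ∷ projsVia suc))

  EMIT-CAT : BC (suc n) 1
  EMIT-CAT = APS CAT (EMIT ∷ []) (projS zero)

  module SuffixScan = Scan {n} NIL (λ _ → EMIT-CAT) (λ _ → projS zero)

  EMIT₀ : BC (suc n) 0
  EMIT₀ = CND (APP ONES (projN zero ∷ [])) NIL (APP F projs)

  MAP-SUFFIXES : BC (suc n) 0
  MAP-SUFFIXES = scomp CAT (EMIT₀ ∷ []) (SuffixScan.SCAN ∷ [])

  module _ (xs : Vec W n) where
    Fs : W → W
    Fs v = ⟦ F ⟧ (v ∷ xs) []

    emitted : W → W
    emitted v = branch (unary (length v)) [] (Fs v)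

    EMIT-sem : ∀ y → ⟦ EMIT ⟧ (y ∷ xs) [] ≡ emitted (behead y)
    EMIT-sem y = CND-sem (y ∷ xs) [] {a = APP ONES (PR (projN zero) ∷ [])} {b = NIL}
      {c = APP F (PR (projN zero) ∷ projsVia suc)}
      (trans (APP-sem (y ∷ xs) [] {h = ONES} {rs = PR (projN zero) ∷ []} (cong₂ _∷_ (pred-sem y) refl)) (ONES-sem (behead y))) refl
      (APP-sem (y ∷ xs) [] {h = F} {rs = PR (projN zero) ∷ projsVia suc} (cong₂ _∷_ (pred-sem y) (evalsN-drop₁ y xs)))

    EMIT₀-sem : ∀ w → ⟦ EMIT₀ ⟧ (w ∷ xs) [] ≡ emitted w
    EMIT₀-sem w = CND-sem (w ∷ xs) [] {a = APP ONES (projN zero ∷ [])} {b = NIL} {c = APP F projs}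
      (ONES-sem w) refl (APP-sem (w ∷ xs) [] {h = F} {rs = projs} (evalsN-projs (w ∷ xs)))

    SCAN-encThen : ∀ s rest → EvenLength rest → SuffixScan.R (encThen s rest) xs ≡ emitted rest ++ SuffixScan.R rest xs
    SCAN-encThen [] rest e = trans (SuffixScan.scan-end rest xs e)
      (trans (APS-sem ((false ∷ rest) ∷ xs) (SuffixScan.R rest xs ∷ []) {h = CAT} {rs = EMIT ∷ []} {a = projS zero}
                (cong₂ _∷_ (EMIT-sem (false ∷ rest)) refl) refl)
             (CAT-sem (emitted rest) (SuffixScan.R rest xs)))
    SCAN-encThen (b ∷ s) rest e = trans (SuffixScan.scan-bit b (encThen s rest) xs (evenLength-encThen s rest e)) (SCAN-encThen s rest e)

    mapSuffixes : List W → W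
    mapSuffixes [] = []
    mapSuffixes (s ∷ ss) = Fs (encList (s ∷ ss)) ++ mapSuffixes ss

    emitted-encThen : ∀ s rest → emitted (encThen s rest) ≡ Fs (encThen s rest)
    emitted-encThen [] rest = refl
    emitted-encThen (b ∷ s) rest = refl

    emitted-scan : ∀ ss → emitted (encList ss) ++ SuffixScan.R (encList ss) xs ≡ mapSuffixes ss
    emitted-scan [] = refl
    emitted-scan (s ∷ ss) = begin
        emitted (encThen s (encList ss)) ++ SuffixScan.R (encThen s (encList ss)) xs
          ≡⟨ cong₂ _++_ (emitted-encThen s (encList ss)) (SCAN-encThen s (encList ss) (evenLength-encList ss)) ⟩
        Fs (encList (s ∷ ss)) ++ (emitted (encList ss) ++ SuffixScan.R (encList ss) xs)
          ≡⟨ cong (Fs (encList (s ∷ ss)) ++_) (emitted-scan ss) ⟩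
        mapSuffixes (s ∷ ss) ∎
      where open ≡-Reasoning

    MAP-SUFFIXES-sem : ∀ ss → ⟦ MAP-SUFFIXES ⟧ (encList ss ∷ xs) [] ≡ mapSuffixes ss
    MAP-SUFFIXES-sem ss = trans (cong (λ z → ⟦ CAT ⟧ (z ∷ []) (SuffixScan.R (encList ss) xs ∷ [])) (EMIT₀-sem (encList ss)))
      (trans (CAT-sem (emitted (encList ss)) (SuffixScan.R (encList ss) xs)) (emitted-scan ss))

module Countdown {n} (F : BC (suc n) 0) where
  LOOP : BC (suc n) 0
  LOOP = srec NIL (APS CAT (APP F projs ∷ []) (projS zero)) (APS CAT (APP F projs ∷ []) (projS zero))

  LOOP-sem : ∀ k (xs : Vec W n) → ⟦ LOOP ⟧ (unary k ∷ xs) [] ≡ countdown (λ y → ⟦ F ⟧ (y ∷ xs) []) k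
  LOOP-sem zero xs = refl
  LOOP-sem (suc k) xs =
    trans (APS-sem (unary k ∷ xs) (⟦ LOOP ⟧ (unary k ∷ xs) [] ∷ []) {h = CAT} {rs = APP F projs ∷ []} {a = projS zero}
             (cong₂ _∷_ (APP-sem (unary k ∷ xs) [] {h = F} {rs = projs} (evalsN-projs (unary k ∷ xs))) refl) refl)
     (trans (CAT-sem (⟦ F ⟧ (unary k ∷ xs) []) (⟦ LOOP ⟧ (unary k ∷ xs) [])) (cong (⟦ F ⟧ (unary k ∷ xs) [] ++_) (LOOP-sem k xs)))

-- The BC recursion visits the prefixes of the counter from the longest one down, so to list
-- F 0, …, F (K - 1) in increasing order the step for prefix 1ʲ evaluates F (K ∸ (j + 1)).
module Countup {n} (F : BC (suc n) 0) where
  F-reversed : BC (suc (suc n)) 0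
  F-reversed = APP F (APS DROP (S1 (projN zero) ∷ []) (projN (suc zero)) ∷ projsVia (λ i → suc (suc i)))

  module Reversed = Countdown F-reversed

  FOR : BC (suc n) 0
  FOR = APP Reversed.LOOP (projN zero ∷ projs)

  FOR-sem : ∀ K (xs : Vec W n) → ⟦ FOR ⟧ (unary K ∷ xs) [] ≡ concatRange (λ p → ⟦ F ⟧ (unary p ∷ xs) []) 0 K
  FOR-sem K xs =
    trans (cong (λ z → ⟦ Reversed.LOOP ⟧ (unary K ∷ z) []) (evalsN-projs (unary K ∷ xs)))
    (trans (Reversed.LOOP-sem K (unary K ∷ xs))
    (trans (countdown-concatRange (λ y → ⟦ F-reversed ⟧ (y ∷ unary K ∷ xs) []) (λ p → ⟦ F ⟧ (unary p ∷ xs) []) K hyp K ≤-refl)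
           (cong (λ z → concatRange (λ p → ⟦ F ⟧ (unary p ∷ xs) []) z K) (n∸n≡0 K))))
    where
      hyp : ∀ j → suc j ≤ K → ⟦ F-reversed ⟧ (unary j ∷ unary K ∷ xs) [] ≡ ⟦ F ⟧ (unary (K ∸ suc j) ∷ xs) []
      hyp j _ = trans (cong (λ z → ⟦ F ⟧ (⟦ DROP ⟧ ((true ∷ unary j) ∷ []) (unary K ∷ []) ∷ z) []) (evalsN-drop₂ (unary j) (unary K) xs))
        (cong (λ z → ⟦ F ⟧ (z ∷ xs) [])
        (trans (DROP-sem (true ∷ unary j) (unary K))
        (trans (cong (λ z → drop (suc z) (unary K)) (length-replicate j)) (drop-unary (suc j) K))))

CAT₀ : ∀ {n} → BC n 0 → BC n 0 → BC n 0
CAT₀ a b = APS CAT (a ∷ []) b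

CAT₀-sem : ∀ {n} (a b : BC n 0) xs → ⟦ CAT₀ a b ⟧ xs [] ≡ ⟦ a ⟧ xs [] ++ ⟦ b ⟧ xs []
CAT₀-sem a b xs = CAT-sem (⟦ a ⟧ xs []) (⟦ b ⟧ xs [])

DOUBLE+1 : BC 1 0
DOUBLE+1 = S1 (APS CAT (projN zero ∷ []) (projN zero))

HALVE-STEP : BC 1 2
HALVE-STEP = CND (APS DROP (DOUBLE+1 ∷ []) (projS (suc zero))) (projS zero) (S1 (projS zero))

HALVE : BC 1 1
HALVE = srec NIL HALVE-STEP HALVE-STEP

HALVE-STEP-sem : ∀ y A R → ⟦ HALVE-STEP ⟧ (y ∷ []) (R ∷ unary A ∷ []) ≡ branch (unary (A ∸ suc (length y + length y))) R (true ∷ R)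
HALVE-STEP-sem y A R = trans (CND-sem (y ∷ []) (R ∷ unary A ∷ []) {a = APS DROP (DOUBLE+1 ∷ []) (projS (suc zero))} {b = projS zero} {c = S1 (projS zero)} refl refl refl)
  (cong (λ z → branch z R (true ∷ R))
  (trans (cong (λ z → ⟦ DROP ⟧ ((true ∷ z) ∷ []) (unary A ∷ [])) (CAT-sem y y))
  (trans (DROP-sem (true ∷ (y ++ y)) (unary A))
  (trans (cong (λ z → drop (suc z) (unary A)) (length-++ y))
  (drop-unary (suc (length y + length y)) A)))))

HALVE-sem : ∀ c A → ⟦ HALVE ⟧ (c ∷ []) (unary A ∷ []) ≡ unary (length c ⊓ ⌊ A /2⌋)
HALVE-sem [] A = refl
HALVE-sem (b ∷ c) A = trans (step b) (go (half-cases A (length c)))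
  where
    R = ⟦ HALVE ⟧ (c ∷ []) (unary A ∷ [])
    step : ∀ b → ⟦ HALVE ⟧ ((b ∷ c) ∷ []) (unary A ∷ []) ≡ branch (unary (A ∸ suc (length c + length c))) R (true ∷ R)
    step false = HALVE-STEP-sem c A R
    step true = HALVE-STEP-sem c A R
    go : _ → branch (unary (A ∸ suc (length c + length c))) R (true ∷ R) ≡ unary (suc (length c) ⊓ ⌊ A /2⌋)
    go (inj₁ (p , q)) rewrite q | HALVE-sem c A =
      cong unary (trans (m≥n⇒m⊓n≡n p) (sym (m≥n⇒m⊓n≡n (m≤n⇒m≤1+n p))))
    go (inj₂ (p , (m , q))) rewrite q | HALVE-sem c A =
      cong unary (trans (cong suc (m≤n⇒m⊓n≡m (<⇒≤ p))) (sym (m≤n⇒m⊓n≡m p)))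

HALVE-AGAIN : BC 2 1
HALVE-AGAIN = APS HALVE (projN (suc zero) ∷ []) (projS zero)

HALVINGS : BC 2 0
HALVINGS = srec (projN zero) HALVE-AGAIN HALVE-AGAIN

HALVINGS-sem : ∀ P K → ⟦ HALVINGS ⟧ (P ∷ unary K ∷ []) [] ≡ unary (halvings (length P) K)
HALVINGS-sem [] K = refl
HALVINGS-sem (b ∷ P) K = trans (step b) (trans (cong (λ z → ⟦ HALVE ⟧ (unary K ∷ []) (z ∷ [])) (HALVINGS-sem P K))
   (trans (HALVE-sem (unary K) (halvings (length P) K))
     (cong unary (trans (cong (_⊓ ⌊ halvings (length P) K /2⌋) (length-replicate K))
        (m≥n⇒m⊓n≡n (≤-trans (⌊n/2⌋≤n _) (halvings≤ (length P) K)))))))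
  where
    step : ∀ b → ⟦ HALVINGS ⟧ ((b ∷ P) ∷ unary K ∷ []) [] ≡ ⟦ HALVE ⟧ (unary K ∷ []) (⟦ HALVINGS ⟧ (P ∷ unary K ∷ []) [] ∷ [])
    step false = refl
    step true = refl

DIGIT : BC 2 0
DIGIT = CND (APP PARITY (APP HALVINGS (projN zero ∷ projN (suc zero) ∷ []) ∷ [])) (S0 NIL) (S1 NIL)

branch-flag-digit : ∀ b → branch (flag b) (false ∷ []) (true ∷ []) ≡ b ∷ []
branch-flag-digit false = refl
branch-flag-digit true = refl

DIGIT-sem : ∀ P K → ⟦ DIGIT ⟧ (P ∷ unary K ∷ []) [] ≡ parity (halvings (length P) K) ∷ []
DIGIT-sem P K = trans (CND-sem (P ∷ unary K ∷ []) [] {a = APP PARITY (APP HALVINGS (projN zero ∷ projN (suc zero) ∷ []) ∷ [])} {b = S0 NIL} {c = S1 NIL} refl refl refl)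
              (trans (cong (λ z → branch z (false ∷ []) (true ∷ []))
                 (trans (cong (λ z → ⟦ PARITY ⟧ (z ∷ []) []) (HALVINGS-sem P K))
                 (trans (PARITY-sem (unary (halvings (length P) K))) (cong (flag ∘ parity) (length-replicate (halvings (length P) K))))))
               (branch-flag-digit _))

module DigitLoop = Countup {1} DIGIT

TO-BINARY : BC 1 0
TO-BINARY = APP DigitLoop.FOR (projN zero ∷ projN zero ∷ [])

TO-BINARY-sem : ∀ K → ⟦ TO-BINARY ⟧ (unary K ∷ []) [] ≡ toBinary K
TO-BINARY-sem K = trans (DigitLoop.FOR-sem K (unary K ∷ []))
  (concatRange-cong (λ p → trans (DIGIT-sem (unary p) K) (cong (λ z → parity (halvings z K) ∷ []) (length-replicate p))) 0 K)

MAJ : ∀ {n s} → BC n s → BC n s → BC n s → BC n s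
MAJ a b c = CND a (CND b NIL c) (CND b c ONE)

branch-majority : ∀ u v c → branch u (branch v [] (flag c)) (branch v (flag c) (true ∷ [])) ≡ flag (majority3 (headBit u) (headBit v) c)
branch-majority [] [] c = refl
branch-majority [] (false ∷ v) c = refl
branch-majority [] (true ∷ v) c = refl
branch-majority (false ∷ u) [] c = refl
branch-majority (false ∷ u) (false ∷ v) c = refl
branch-majority (false ∷ u) (true ∷ v) c = refl
branch-majority (true ∷ u) [] c = refl
branch-majority (true ∷ u) (false ∷ v) c = refl
branch-majority (true ∷ u) (true ∷ v) c = refl

DIGIT-OF NOT-DIGIT-OF : ∀ {n s} → BC n s → BC n s
DIGIT-OF c = CND c (S0 NIL) (S1 NIL)
NOT-DIGIT-OF c = CND c (S1 NIL) (S0 NIL)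

XOR : ∀ {n s} → BC n s → BC n s → BC n s → BC n s
XOR a b c = CND a (CND b (DIGIT-OF c) (NOT-DIGIT-OF c)) (CND b (NOT-DIGIT-OF c) (DIGIT-OF c))

branch-digit : ∀ w → branch w (false ∷ []) (true ∷ []) ≡ headBit w ∷ []
branch-digit [] = refl
branch-digit (false ∷ w) = refl
branch-digit (true ∷ w) = refl

branch-not-digit : ∀ w → branch w (true ∷ []) (false ∷ []) ≡ not (headBit w) ∷ []
branch-not-digit [] = refl
branch-not-digit (false ∷ w) = refl
branch-not-digit (true ∷ w) = refl

branch-xor : ∀ u v (w : W) → branch u (branch v (headBit w ∷ []) (not (headBit w) ∷ [])) (branch v (not (headBit w) ∷ []) (headBit w ∷ [])) ≡ xor3 (headBit u) (headBit v) (headBit w) ∷ []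
branch-xor [] [] w = refl
branch-xor [] (false ∷ v) w = refl
branch-xor [] (true ∷ v) w = refl
branch-xor (false ∷ u) [] w = refl
branch-xor (false ∷ u) (false ∷ v) w = refl
branch-xor (false ∷ u) (true ∷ v) w = refl
branch-xor (true ∷ u) [] w = refl
branch-xor (true ∷ u) (false ∷ v) w = refl
branch-xor (true ∷ u) (true ∷ v) w = refl

DROP₁ DROP₂ : ∀ {s} → BC 3 s
DROP₁ = APS DROP (projN zero ∷ []) (projN (suc zero))
DROP₂ = APS DROP (projN zero ∷ []) (projN (suc (suc zero)))

CARRY-STEP : BC 3 1
CARRY-STEP = MAJ DROP₁ DROP₂ (projS zero)

CARRY : BC 3 0
CARRY = srec NIL CARRY-STEP CARRY-STEP

module _ {n s} (xs : Vec W n) (as : Vec W s) where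
  MAJ-sem : ∀ {a b c : BC n s} {va vb vc} → ⟦ a ⟧ xs as ≡ va → ⟦ b ⟧ xs as ≡ vb → ⟦ c ⟧ xs as ≡ vc →
          ⟦ MAJ a b c ⟧ xs as ≡ branch va (branch vb [] vc) (branch vb vc (true ∷ []))
  MAJ-sem {a} {b} {c} pa pb pc = CND-sem xs as {a = a} {b = CND b NIL c} {c = CND b c ONE} pa
    (CND-sem xs as {a = b} {b = NIL} {c = c} pb refl pc) (CND-sem xs as {a = b} {b = c} {c = ONE} pb pc refl)

CARRY-sem : ∀ P s o → ⟦ CARRY ⟧ (P ∷ s ∷ o ∷ []) [] ≡ flag (carry s o (length P))
CARRY-sem [] s o = refl
CARRY-sem (b ∷ P) s o = trans (step b) (trans (branch-majority (drop (length P) s) (drop (length P) o) (carry s o (length P)))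
   (cong₂ (λ u v → flag (majority3 u v (carry s o (length P)))) (headBit-drop (length P) s) (headBit-drop (length P) o)))
  where
    R = ⟦ CARRY ⟧ (P ∷ s ∷ o ∷ []) []
    hstep : ⟦ CARRY-STEP ⟧ (P ∷ s ∷ o ∷ []) (R ∷ []) ≡ branch (drop (length P) s) (branch (drop (length P) o) [] (flag (carry s o (length P))))
                (branch (drop (length P) o) (flag (carry s o (length P))) (true ∷ []))
    hstep = MAJ-sem (P ∷ s ∷ o ∷ []) (R ∷ []) {a = DROP₁} {b = DROP₂} {c = projS zero} (DROP-sem P s) (DROP-sem P o) (CARRY-sem P s o)
    step : ∀ b → ⟦ CARRY ⟧ ((b ∷ P) ∷ s ∷ o ∷ []) [] ≡ _
    step false = hstep
    step true = hstep

SUM-DIGIT : BC 3 0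
SUM-DIGIT = XOR DROP₁ DROP₂ (APP CARRY projs)

SUM-DIGIT-sem : ∀ P s o → ⟦ SUM-DIGIT ⟧ (P ∷ s ∷ o ∷ []) [] ≡ xor3 (lookupD s (length P)) (lookupD o (length P)) (carry s o (length P)) ∷ []
SUM-DIGIT-sem P s o =
  trans (CND-sem xs [] {a = DROP₁} {b = CND DROP₂ (DIGIT-OF cc) (NOT-DIGIT-OF cc)} {c = CND DROP₂ (NOT-DIGIT-OF cc) (DIGIT-OF cc)} (DROP-sem P s)
          (CND-sem xs [] {a = DROP₂} {b = DIGIT-OF cc} {c = NOT-DIGIT-OF cc} (DROP-sem P o) (bbE) (nbE))
          (CND-sem xs [] {a = DROP₂} {b = NOT-DIGIT-OF cc} {c = DIGIT-OF cc} (DROP-sem P o) (nbE) (bbE)))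
  (trans (branch-xor (drop (length P) s) (drop (length P) o) (flag (carry s o (length P))))
    (cong₃ (headBit-drop (length P) s) (headBit-drop (length P) o) (headBit-flag (carry s o (length P)))))
  where
    xs = P ∷ s ∷ o ∷ []
    cc : BC 3 0
    cc = APP CARRY projs
    cv : ⟦ cc ⟧ xs [] ≡ flag (carry s o (length P))
    cv = trans (APP-sem xs [] {h = CARRY} {rs = projs} (evalsN-projs xs)) (CARRY-sem P s o)
    bbE : ⟦ DIGIT-OF cc ⟧ xs [] ≡ headBit (flag (carry s o (length P))) ∷ []
    bbE = trans (CND-sem xs [] {a = cc} {b = S0 NIL} {c = S1 NIL} cv refl refl) (branch-digit _)
    nbE : ⟦ NOT-DIGIT-OF cc ⟧ xs [] ≡ not (headBit (flag (carry s o (length P)))) ∷ []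
    nbE = trans (CND-sem xs [] {a = cc} {b = S1 NIL} {c = S0 NIL} cv refl refl) (branch-not-digit _)
    cong₃ : ∀ {a a' b b' c c'} → a ≡ a' → b ≡ b' → c ≡ c' → xor3 a b c ∷ [] ≡ xor3 a' b' c' ∷ []
    cong₃ refl refl refl = refl

module SumLoop = Countup {2} SUM-DIGIT

ADD-LENGTH : BC 2 0
ADD-LENGTH = APP ONES (APS CAT (projN zero ∷ []) (projN (suc zero)) ∷ [])

ADD : BC 2 0
ADD = APS CAT (APP SumLoop.FOR (ADD-LENGTH ∷ projN zero ∷ projN (suc zero) ∷ []) ∷ [])
              (DIGIT-OF (APP CARRY (ADD-LENGTH ∷ projN zero ∷ projN (suc zero) ∷ [])))

ADD-sem : ∀ s o → ⟦ ADD ⟧ (s ∷ o ∷ []) [] ≡ add s o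
ADD-sem s o = trans (CAT-sem (⟦ SumLoop.FOR ⟧ (lenv ∷ s ∷ o ∷ []) []) (⟦ DIGIT-OF (APP CARRY (ADD-LENGTH ∷ projN zero ∷ projN (suc zero) ∷ [])) ⟧ (s ∷ o ∷ []) []))
  (cong₂ _++_ loopE carryE)
  where
    L = length s + length o
    lenv = ⟦ ADD-LENGTH ⟧ (s ∷ o ∷ []) []
    lenE : lenv ≡ unary L
    lenE = trans (cong (λ z → ⟦ ONES ⟧ (z ∷ []) []) (CAT-sem s o)) (trans (ONES-sem (s ++ o)) (cong unary (length-++ s)))
    loopE : ⟦ SumLoop.FOR ⟧ (lenv ∷ s ∷ o ∷ []) [] ≡ concatRange (λ p → xor3 (lookupD s p) (lookupD o p) (carry s o p) ∷ []) 0 L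
    loopE = trans (cong (λ z → ⟦ SumLoop.FOR ⟧ (z ∷ s ∷ o ∷ []) []) lenE)
      (trans (SumLoop.FOR-sem L (s ∷ o ∷ []))
        (concatRange-cong (λ p → trans (SUM-DIGIT-sem (unary p) s o) (cong (λ q → xor3 (lookupD s q) (lookupD o q) (carry s o q) ∷ []) (length-replicate p))) 0 L))
    carryE : ⟦ DIGIT-OF (APP CARRY (ADD-LENGTH ∷ projN zero ∷ projN (suc zero) ∷ [])) ⟧ (s ∷ o ∷ []) [] ≡ carry s o L ∷ []
    carryE = trans (CND-sem (s ∷ o ∷ []) [] {a = APP CARRY (ADD-LENGTH ∷ projN zero ∷ projN (suc zero) ∷ [])} {b = S0 NIL} {c = S1 NIL}
       (trans (cong (λ z → ⟦ CARRY ⟧ (z ∷ s ∷ o ∷ []) []) lenE) (trans (CARRY-sem (unary L) s o) (cong (flag ∘ carry s o) (length-replicate L)))) refl refl)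
       (trans (branch-digit _) (cong (_∷ []) (headBit-flag _)))

ENC : BC 1 0
ENC = srec (S0 (S0 NIL)) (S0 (S1 (projS zero))) (S1 (S1 (projS zero)))

ENC-sem : ∀ s → ⟦ ENC ⟧ (s ∷ []) [] ≡ enc s
ENC-sem [] = refl
ENC-sem (false ∷ s) = cong (λ z → false ∷ true ∷ z) (ENC-sem s)
ENC-sem (true ∷ s) = cong (λ z → true ∷ true ∷ z) (ENC-sem s)

MOD3-STEP : BC 1 1
MOD3-STEP = CND (projS zero) (CND (PR (projS zero)) ONE NIL) (S0 ONE)

MOD3 : BC 1 0
MOD3 = srec NIL MOD3-STEP MOD3-STEP

MOD3-sem : ∀ y → ⟦ MOD3 ⟧ (y ∷ []) [] ≡ mod3 (length y)
MOD3-sem [] = refl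
MOD3-sem (b ∷ y) = trans (step b) (mod3-suc (length y))
  where
    R = ⟦ MOD3 ⟧ (y ∷ []) []
    hs : ⟦ MOD3-STEP ⟧ (y ∷ []) (R ∷ []) ≡ branch (mod3 (length y)) (branch (behead (mod3 (length y))) (true ∷ []) []) (false ∷ true ∷ [])
    hs = CND-sem (y ∷ []) (R ∷ []) {a = projS zero} {b = CND (PR (projS zero)) ONE NIL} {c = S0 ONE} (MOD3-sem y)
           (CND-sem (y ∷ []) (R ∷ []) {a = PR (projS zero)} {b = ONE} {c = NIL} (PR-sem (y ∷ []) (R ∷ []) {a = projS zero} (MOD3-sem y)) refl refl) refl
    step : ∀ b → ⟦ MOD3 ⟧ ((b ∷ y) ∷ []) [] ≡ _
    step false = hs
    step true = hs

-- A field of an encoded gate list is a gate tag iff the number of fields from it to the end is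
-- a multiple of 3; all other fields are wire indices and get shifted.
FIELD FIELD-MOD3 SHIFTED-FIELD : BC 2 0
FIELD = APP HEAD (projN zero ∷ [])
FIELD-MOD3 = APP MOD3 (APP COUNT (projN zero ∷ []) ∷ [])
SHIFTED-FIELD = APP ENC (APP ADD (FIELD ∷ projN (suc zero) ∷ []) ∷ [])

SHIFT-FIELD : BC 2 0
SHIFT-FIELD = CND FIELD-MOD3 (CND (PR FIELD-MOD3) (APP ENC (FIELD ∷ [])) SHIFTED-FIELD) SHIFTED-FIELD

module ShiftFields = MapSuffixes {1} SHIFT-FIELD

SHIFT : BC 2 0
SHIFT = ShiftFields.MAP-SUFFIXES

SHIFT-FIELD-sem : ∀ s ss o → ⟦ SHIFT-FIELD ⟧ (encList (s ∷ ss) ∷ o ∷ []) [] ≡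
  branch (mod3 (suc (length ss))) (branch (behead (mod3 (suc (length ss)))) (enc s) (enc (add s o))) (enc (add s o))
SHIFT-FIELD-sem s ss o =
  CND-sem xs [] {a = FIELD-MOD3} {b = CND (PR FIELD-MOD3) (APP ENC (FIELD ∷ [])) SHIFTED-FIELD} {c = SHIFTED-FIELD} mE
    (CND-sem xs [] {a = PR FIELD-MOD3} {b = APP ENC (FIELD ∷ [])} {c = SHIFTED-FIELD} (PR-sem xs [] {a = FIELD-MOD3} mE)
       (trans (cong (λ z → ⟦ ENC ⟧ (z ∷ []) []) sE) (ENC-sem s)) aE) aE
  where
    xs = encList (s ∷ ss) ∷ o ∷ []
    sE : ⟦ FIELD ⟧ xs [] ≡ s
    sE = HEAD-sem s (encList ss) (evenLength-encList ss)
    mE : ⟦ FIELD-MOD3 ⟧ xs [] ≡ mod3 (suc (length ss))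
    mE = trans (cong (λ z → ⟦ MOD3 ⟧ (z ∷ []) []) (COUNT-sem (s ∷ ss))) (trans (MOD3-sem (unary (suc (length ss)))) (cong mod3 (length-replicate (suc (length ss)))))
    aE : ⟦ SHIFTED-FIELD ⟧ xs [] ≡ enc (add s o)
    aE = trans (cong (λ z → ⟦ ENC ⟧ (⟦ ADD ⟧ (z ∷ o ∷ []) [] ∷ []) []) sE) (trans (cong (λ z → ⟦ ENC ⟧ (z ∷ []) []) (ADD-sem s o)) (ENC-sem _))

SHIFT-sem : ∀ ss o → mod3 (length ss) ≡ [] → ⟦ SHIFT ⟧ (encList ss ∷ o ∷ []) [] ≡ encList (shiftFields o ss)
SHIFT-sem ss o e = trans (ShiftFields.MAP-SUFFIXES-sem (o ∷ []) ss) (go ss e)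
  where
    go : ∀ ss → mod3 (length ss) ≡ [] → ShiftFields.mapSuffixes (o ∷ []) ss ≡ encList (shiftFields o ss)
    go [] e = refl
    go (t ∷ i ∷ j ∷ rest) e with mod3≡0 (length rest) e
    ... | e1 , e2 =
      begin
        ShiftFields.Fs (o ∷ []) (encList (t ∷ i ∷ j ∷ rest)) ++ (ShiftFields.Fs (o ∷ []) (encList (i ∷ j ∷ rest)) ++ (ShiftFields.Fs (o ∷ []) (encList (j ∷ rest)) ++ ShiftFields.mapSuffixes (o ∷ []) rest))
          ≡⟨ cong₂ _++_ (trans (SHIFT-FIELD-sem t (i ∷ j ∷ rest) o) (cong (λ z → branch z (branch (behead z) (enc t) (enc (add t o))) (enc (add t o))) e))
              (cong₂ _++_ (trans (SHIFT-FIELD-sem i (j ∷ rest) o) (cong (λ z → branch z (branch (behead z) (enc i) (enc (add i o))) (enc (add i o))) e2))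
                (cong₂ _++_ (trans (SHIFT-FIELD-sem j rest o) (cong (λ z → branch z (branch (behead z) (enc j) (enc (add j o))) (enc (add j o))) e1))
                   (go rest e))) ⟩
        enc t ++ (enc (add i o) ++ (enc (add j o) ++ encList (shiftFields o rest)))
          ≡⟨ cong (λ z → enc t ++ (enc (add i o) ++ z)) (enc-++ (add j o) (encList (shiftFields o rest))) ⟩
        enc t ++ (enc (add i o) ++ encThen (add j o) (encList (shiftFields o rest)))
          ≡⟨ cong (enc t ++_) (enc-++ (add i o) _) ⟩
        enc t ++ encThen (add i o) (encThen (add j o) (encList (shiftFields o rest)))
          ≡⟨ enc-++ t _ ⟩
        encList (shiftFields o (t ∷ i ∷ j ∷ rest)) ∎
      where open ≡-Reasoning
    go (x ∷ []) ()
    go (x ∷ y ∷ []) ()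

-- The reduction map

data UExp : Set where
  uN uT uTK : UExp
  uC : ℕ → UExp
  _⊕_ : UExp → UExp → UExp
  _⊗_ : UExp → ℕ → UExp

infixl 6 _⊕_

infixl 7 _⊗_

⟪_⟫ : UExp → ℕ → ℕ → ℕ
⟪ uN ⟫ t n = n
⟪ uT ⟫ t n = t
⟪ uTK ⟫ t n = n ∸ suc t
⟪ uC c ⟫ t n = c
⟪ a ⊕ b ⟫ t n = ⟪ a ⟫ t n + ⟪ b ⟫ t n
⟪ a ⊗ c ⟫ t n = ⟪ a ⟫ t n * c

UNARY-CONST : ℕ → BC 2 0
UNARY-CONST zero = NIL
UNARY-CONST (suc c) = S1 (UNARY-CONST c)

UNARY : UExp → BC 2 0

UNARY-TIMES : UExp → ℕ → BC 2 0
UNARY uN = projN (suc zero)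
UNARY uT = projN zero
UNARY uTK = APS DROP (S1 (projN zero) ∷ []) (projN (suc zero))
UNARY (uC c) = UNARY-CONST c
UNARY (a ⊕ b) = CAT₀ (UNARY a) (UNARY b)
UNARY (a ⊗ c) = UNARY-TIMES a c
UNARY-TIMES a zero = NIL
UNARY-TIMES a (suc c) = CAT₀ (UNARY a) (UNARY-TIMES a c)

UNARY-CONST-sem : ∀ c xs → ⟦ UNARY-CONST c ⟧ xs [] ≡ unary c
UNARY-CONST-sem zero xs = refl
UNARY-CONST-sem (suc c) xs = cong (true ∷_) (UNARY-CONST-sem c xs)

UNARY-sem : ∀ e t n → ⟦ UNARY e ⟧ (unary t ∷ unary n ∷ []) [] ≡ unary (⟪ e ⟫ t n)

UNARY-TIMES-sem : ∀ e c t n → ⟦ UNARY-TIMES e c ⟧ (unary t ∷ unary n ∷ []) [] ≡ unary (⟪ e ⟫ t n * c)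
UNARY-sem uN t n = refl
UNARY-sem uT t n = refl
UNARY-sem uTK t n = trans (DROP-sem (true ∷ unary t) (unary n)) (trans (cong (λ z → drop (suc z) (unary n)) (length-replicate t)) (drop-unary (suc t) n))
UNARY-sem (uC c) t n = UNARY-CONST-sem c _
UNARY-sem (a ⊕ b) t n = trans (CAT₀-sem (UNARY a) (UNARY b) _) (trans (cong₂ _++_ (UNARY-sem a t n) (UNARY-sem b t n)) (unary-++ (⟪ a ⟫ t n) (⟪ b ⟫ t n)))
UNARY-sem (a ⊗ c) t n = UNARY-TIMES-sem a c t n
UNARY-TIMES-sem a zero t n = cong unary (sym (*-zeroʳ (⟪ a ⟫ t n)))
UNARY-TIMES-sem a (suc c) t n = trans (CAT₀-sem (UNARY a) (UNARY-TIMES a c) _)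
  (trans (cong₂ _++_ (UNARY-sem a t n) (UNARY-TIMES-sem a c t n)) (trans (unary-++ (⟪ a ⟫ t n) (⟪ a ⟫ t n * c)) (cong unary (sym (*-suc (⟪ a ⟫ t n) c)))))

ENC-LIST : ∀ {n} → List (BC n 0) → BC n 0
ENC-LIST [] = NIL
ENC-LIST (e ∷ es) = CAT₀ (APP ENC (e ∷ [])) (ENC-LIST es)

ENC-LIST-sem : ∀ {n} (es : List (BC n 0)) xs → ⟦ ENC-LIST es ⟧ xs [] ≡ encList (map (λ e → ⟦ e ⟧ xs []) es)
ENC-LIST-sem [] xs = refl
ENC-LIST-sem (e ∷ es) xs = trans (CAT₀-sem (APP ENC (e ∷ [])) (ENC-LIST es) xs)
  (trans (cong₂ _++_ (ENC-sem (⟦ e ⟧ xs [])) (ENC-LIST-sem es xs)) (enc-++ _ _))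

data GateTemplate : Set where
  dAND dOR : UExp → UExp → GateTemplate
  dNOT : UExp → GateTemplate

BINARY : UExp → BC 2 0
BINARY e = APP TO-BINARY (UNARY e ∷ [])

BINARY-sem : ∀ e t n → ⟦ BINARY e ⟧ (unary t ∷ unary n ∷ []) [] ≡ toBinary (⟪ e ⟫ t n)
BINARY-sem e t n = trans (cong (λ z → ⟦ TO-BINARY ⟧ (z ∷ []) []) (UNARY-sem e t n)) (TO-BINARY-sem (⟪ e ⟫ t n))

FIELDS : GateTemplate → List (BC 2 0)
FIELDS (dAND a b) = S0 NIL ∷ BINARY a ∷ BINARY b ∷ []
FIELDS (dOR a b) = S1 NIL ∷ BINARY a ∷ BINARY b ∷ []
FIELDS (dNOT a) = NIL ∷ BINARY a ∷ BINARY a ∷ []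

instantiate : GateTemplate → ℕ → ℕ → Gate
instantiate (dAND a b) t n = AND (⟪ a ⟫ t n) (⟪ b ⟫ t n)
instantiate (dOR a b) t n = OR (⟪ a ⟫ t n) (⟪ b ⟫ t n)
instantiate (dNOT a) t n = NOT (⟪ a ⟫ t n)

ALL-FIELDS : List GateTemplate → List (BC 2 0)
ALL-FIELDS [] = []
ALL-FIELDS (d ∷ ds) = FIELDS d ++ ALL-FIELDS ds

FIELDS-sem : ∀ d t n → map (λ e → ⟦ e ⟧ (unary t ∷ unary n ∷ []) []) (FIELDS d) ≡ gateFields (instantiate d t n)
FIELDS-sem (dAND a b) t n = cong₂ (λ x y → (false ∷ []) ∷ x ∷ y ∷ []) (BINARY-sem a t n) (BINARY-sem b t n)
FIELDS-sem (dOR a b) t n = cong₂ (λ x y → (true ∷ []) ∷ x ∷ y ∷ []) (BINARY-sem a t n) (BINARY-sem b t n)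
FIELDS-sem (dNOT a) t n = cong (λ x → [] ∷ x ∷ x ∷ []) (BINARY-sem a t n)

ALL-FIELDS-sem : ∀ ds t n → map (λ e → ⟦ e ⟧ (unary t ∷ unary n ∷ []) []) (ALL-FIELDS ds) ≡ gatesFields (map (λ d → instantiate d t n) ds)
ALL-FIELDS-sem [] t n = refl
ALL-FIELDS-sem (d ∷ ds) t n = trans (map-++ _ (FIELDS d) (ALL-FIELDS ds)) (cong₂ _++_ (FIELDS-sem d t n) (ALL-FIELDS-sem ds t n))

GATES : List GateTemplate → BC 2 0
GATES ds = ENC-LIST (ALL-FIELDS ds)

GATES-sem : ∀ ds t n → ⟦ GATES ds ⟧ (unary t ∷ unary n ∷ []) [] ≡ encGates (map (λ d → instantiate d t n) ds)
GATES-sem ds t n = trans (ENC-LIST-sem (ALL-FIELDS ds) _) (cong encList (ALL-FIELDS-sem ds t n))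

uB1 uB2 uB3 uB4 uB5 uB6 uB7 uLt : UExp
uB1 = uN ⊕ uN
uB2 = uB1 ⊕ uN
uB3 = uB2 ⊕ uN ⊗ 2
uB4 = uC 1 ⊕ uB3
uB5 = uB4 ⊕ uN ⊗ 2
uB6 = uC 1 ⊕ uB5
uB7 = uB6 ⊕ uN ⊗ 4
uLt = uB3 ⊕ uN ⊗ 2

-- Templates for the gates of Prelude; PRELUDE-sem checks by refl that they instantiate to them.
dsN dsX dsCh dsA dsB dsC dsF dsNL : List GateTemplate
dsN = dNOT uT ∷ []
dsX = dAND (uB1 ⊕ uT) (uN ⊕ uT) ∷ dOR (uB1 ⊕ uT) (uN ⊕ uT) ∷ []
dsCh = dAND (uB2 ⊕ (uTK ⊗ 2 ⊕ uC 1)) (uB3 ⊕ uT ⊗ 2) ∷ dOR (uB2 ⊕ (uTK ⊗ 2 ⊕ uC 0)) (uB4 ⊕ (uT ⊗ 2 ⊕ uC 0)) ∷ []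
dsA = dAND uT uLt ∷ dAND (uN ⊕ uT) uB5 ∷ dAND (uN ⊕ uT) uLt ∷ dAND uT uB5 ∷ []
dsB = dOR (uB6 ⊕ (uT ⊗ 4 ⊕ uC 0)) (uB6 ⊕ (uT ⊗ 4 ⊕ uC 1)) ∷ []
dsC = dOR (uB6 ⊕ (uT ⊗ 4 ⊕ uC 2)) (uB6 ⊕ (uT ⊗ 4 ⊕ uC 3)) ∷ []
dsF = dAND uB3 uB3 ∷ []
dsNL = dNOT uLt ∷ []

module GatesLoop (ds : List GateTemplate) = Countup {1} (GATES ds)

PASS : List GateTemplate → BC 1 0
PASS ds = APP (GatesLoop.FOR ds) (projN zero ∷ projN zero ∷ [])

SINGLE : List GateTemplate → BC 1 0
SINGLE ds = APP (GATES ds) (projN zero ∷ projN zero ∷ [])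

PASS-sem : ∀ ds n → ⟦ PASS ds ⟧ (unary n ∷ []) [] ≡ concatRange (λ p → encGates (map (λ d → instantiate d p n) ds)) 0 n
PASS-sem ds n = trans (GatesLoop.FOR-sem ds n (unary n ∷ [])) (concatRange-cong (λ p → GATES-sem ds p n) 0 n)

SINGLE-sem : ∀ ds n → ⟦ SINGLE ds ⟧ (unary n ∷ []) [] ≡ encGates (map (λ d → instantiate d n n) ds)
SINGLE-sem ds n = GATES-sem ds n n

T7 T6 T5 T4 T3 T2 T1 PRELUDE : BC 1 0
T7 = PASS dsC
T6 = CAT₀ (PASS dsB) T7
T5 = CAT₀ (PASS dsA) T6
T4 = CAT₀ (SINGLE dsNL) T5
T3 = CAT₀ (PASS dsCh) T4
T2 = CAT₀ (SINGLE dsF) T3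
T1 = CAT₀ (PASS dsX) T2
PRELUDE = CAT₀ (PASS dsN) T1

PRELUDE-sem : ∀ n → ⟦ PRELUDE ⟧ (unary n ∷ []) [] ≡ encGates (Prelude.prelude n)
PRELUDE-sem n = trans lhs (sym rhs)
  where
    open Prelude n
    xs = unary n ∷ []
    P : ∀ ds f → (λ p → encGates (map (λ d → instantiate d p n) ds)) ≡ (λ p → encGates (f p)) → ⟦ PASS ds ⟧ xs [] ≡ encGates (concatRange f 0 n)
    P ds f e = trans (PASS-sem ds n) (trans (cong (λ g → concatRange g 0 n) e) (sym (encGates-concatRange f 0 n)))
    c2 : (a b : BC 1 0) {va vb : W} → ⟦ a ⟧ xs [] ≡ va → ⟦ b ⟧ xs [] ≡ vb → ⟦ CAT₀ a b ⟧ xs [] ≡ va ++ vb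
    c2 a b ea eb = trans (CAT₀-sem a b xs) (cong₂ _++_ ea eb)
    lhs : ⟦ PRELUDE ⟧ xs [] ≡ encGates gN ++ (encGates gX ++ (encGates (gF ∷ []) ++ (encGates gCh ++ (encGates (gNL ∷ []) ++ (encGates gA ++ (encGates gB ++ encGates gC))))))
    lhs = c2 (PASS dsN) T1 (P dsN fN refl) (c2 (PASS dsX) T2 (P dsX fX refl) (c2 (SINGLE dsF) T3 (SINGLE-sem dsF n)
        (c2 (PASS dsCh) T4 (P dsCh fCh refl) (c2 (SINGLE dsNL) T5 (SINGLE-sem dsNL n) (c2 (PASS dsA) T6 (P dsA fA refl)
        (c2 (PASS dsB) T7 (P dsB fB refl) (P dsC fC refl)))))))
    e6 = encGates-++ gB gC
    e5 = trans (encGates-++ gA (gB ++ gC)) (cong (encGates gA ++_) e6)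
    e4 = trans (encGates-++ (gNL ∷ []) (gA ++ (gB ++ gC))) (cong (encGates (gNL ∷ []) ++_) e5)
    e3 = trans (encGates-++ gCh (gNL ∷ (gA ++ (gB ++ gC)))) (cong (encGates gCh ++_) e4)
    e2 = trans (encGates-++ (gF ∷ []) (gCh ++ (gNL ∷ (gA ++ (gB ++ gC))))) (cong (encGates (gF ∷ []) ++_) e3)
    e1 = trans (encGates-++ gX (gF ∷ (gCh ++ (gNL ∷ (gA ++ (gB ++ gC)))))) (cong (encGates gX ++_) e2)
    rhs : encGates prelude ≡ encGates gN ++ (encGates gX ++ (encGates (gF ∷ []) ++ (encGates gCh ++ (encGates (gNL ∷ []) ++ (encGates gA ++ (encGates gB ++ encGates gC))))))
    rhs = trans (encGates-++ gN (gX ++ (gF ∷ (gCh ++ (gNL ∷ (gA ++ (gB ++ gC))))))) (cong (encGates gN ++_) e1)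

SIZE SIZE₁ : ∀ {k} → BC (suc k) 0
SIZE = APP HEAD (projN zero ∷ [])
SIZE₁ = APP ONES (SIZE ∷ [])

CIRCUIT PRELUDE-SIZE ORDERED-CIRCUIT : BC 1 0
CIRCUIT = APP HEAD (APP TAIL (projN zero ∷ []) ∷ [])
PRELUDE-SIZE = APP (UNARY uB7) (SIZE₁ ∷ SIZE₁ ∷ [])
ORDERED-CIRCUIT = CAT₀ (APP PRELUDE (SIZE₁ ∷ [])) (APP SHIFT (CIRCUIT ∷ APP TO-BINARY (PRELUDE-SIZE ∷ []) ∷ []))

module MulLoop = Countdown {1} (projN (suc zero))

MUL : BC 3 0
MUL = APP MulLoop.LOOP (projN zero ∷ projN (suc (suc zero)) ∷ [])

SHIFTED-COPY : BC 3 0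
SHIFTED-COPY = APP ENC (APP SHIFT (projN (suc zero) ∷ APP TO-BINARY (MUL ∷ []) ∷ []) ∷ [])

module CopyLoop = Countup {2} SHIFTED-COPY

REDUCTION : BC 1 0
REDUCTION = CAT₀ (APP ENC (PR SIZE ∷ [])) (APP CopyLoop.FOR (PR (PR SIZE₁) ∷ ORDERED-CIRCUIT ∷ SIZE₁ ∷ []))

reduce : W → W
reduce x = ⟦ REDUCTION ⟧ (x ∷ []) []

MUL-sem : ∀ i t n → ⟦ MUL ⟧ (unary i ∷ t ∷ unary n ∷ []) [] ≡ unary (i * n)
MUL-sem i t n = trans (MulLoop.LOOP-sem i (unary n ∷ [])) (countdown-const i n)

decodeWLC-encList : ∀ a cs Ps → parseCircuits cs ≡ just Ps → decodeWLC (encList (a ∷ cs)) ≡ just (length a , Ps)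
decodeWLC-encList a cs Ps e rewrite decL-encList (a ∷ cs) | e = refl

module ReduceSpec (nstr : W) (cs : List W) (C : Circuit) (pc : parseGates cs ≡ just C) where
  n = length nstr
  open Prelude n using (prelude; B7n; withPrelude)
  orderedFields : List W
  orderedFields = gatesFields prelude ++ shiftFields (toBinary B7n) cs

  fields≡0 : mod3 (length cs) ≡ []
  fields≡0 = proj₂ (parseGates-shiftFields cs C (toBinary B7n) pc)

  parse-orderedFields : parseGates orderedFields ≡ just (withPrelude C)
  parse-orderedFields = trans (parseGates-gatesFields prelude (shiftFields (toBinary B7n) cs) _ (proj₁ (parseGates-shiftFields cs C (toBinary B7n) pc)))
                 (cong (λ k → just (prelude ++ map (shiftGate k) C)) (bin-toBinary B7n))

  orderedFields≡0 : mod3 (length orderedFields) ≡ []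
  orderedFields≡0 = proj₂ (parseGates-shiftFields orderedFields (withPrelude C) (toBinary 0) parse-orderedFields)

  encP : ℕ → W
  encP i = encList (shiftFields (toBinary (i * n)) orderedFields)

  P : ℕ → Circuit
  P i = map (shiftGate (i * n)) (withPrelude C)

  parse-P : ∀ i → parseGates (shiftFields (toBinary (i * n)) orderedFields) ≡ just (P i)
  parse-P i = trans (proj₁ (parseGates-shiftFields orderedFields (withPrelude C) (toBinary (i * n)) parse-orderedFields)) (cong (λ k → just (map (shiftGate k) (withPrelude C))) (bin-toBinary (i * n)))

  x = encList (nstr ∷ encList cs ∷ [])

  reduce-sem : reduce x ≡ encList (behead nstr ∷ range encP 0 (n ∸ 2))
  reduce-sem = trans (CAT₀-sem (APP ENC (PR SIZE ∷ [])) (APP CopyLoop.FOR (PR (PR SIZE₁) ∷ ORDERED-CIRCUIT ∷ SIZE₁ ∷ [])) (x ∷ []))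
    (trans (cong₂ _++_ e1 e2) (enc-++ (behead nstr) _))
    where
      xs = x ∷ []
      eN : ⟦ SIZE ⟧ xs [] ≡ nstr
      eN = HEAD-sem nstr (encList (encList cs ∷ [])) (evenLength-encList (encList cs ∷ []))
      eNU : ⟦ SIZE₁ ⟧ xs [] ≡ unary n
      eNU = trans (cong (λ z → ⟦ ONES ⟧ (z ∷ []) []) eN) (ONES-sem nstr)
      eC : ⟦ CIRCUIT ⟧ xs [] ≡ encList cs
      eC = trans (cong (λ z → ⟦ HEAD ⟧ (z ∷ []) []) (TAIL-sem nstr (encList (encList cs ∷ [])) (evenLength-encList (encList cs ∷ []))))
                 (HEAD-sem (encList cs) [] refl)
      e1 : ⟦ APP ENC (PR SIZE ∷ []) ⟧ xs [] ≡ enc (behead nstr)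
      e1 = trans (cong (λ z → ⟦ ENC ⟧ (z ∷ []) []) (PR-sem xs [] {a = SIZE} eN)) (ENC-sem (behead nstr))
      eO : ⟦ PRELUDE-SIZE ⟧ xs [] ≡ unary B7n
      eO = trans (cong (λ z → ⟦ UNARY uB7 ⟧ (z ∷ z ∷ []) []) eNU) (UNARY-sem uB7 n n)
      ePRE : ⟦ APP PRELUDE (SIZE₁ ∷ []) ⟧ xs [] ≡ encGates prelude
      ePRE = trans (cong (λ z → ⟦ PRELUDE ⟧ (z ∷ []) []) eNU) (PRELUDE-sem n)
      eTB : ⟦ APP TO-BINARY (PRELUDE-SIZE ∷ []) ⟧ xs [] ≡ toBinary B7n
      eTB = trans (APP-sem xs [] {h = TO-BINARY} {rs = PRELUDE-SIZE ∷ []} (cong₂ _∷_ eO refl)) (TO-BINARY-sem B7n)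
      eSH : ⟦ APP SHIFT (CIRCUIT ∷ APP TO-BINARY (PRELUDE-SIZE ∷ []) ∷ []) ⟧ xs [] ≡ encList (shiftFields (toBinary B7n) cs)
      eSH = trans (APP-sem xs [] {h = SHIFT} {rs = CIRCUIT ∷ APP TO-BINARY (PRELUDE-SIZE ∷ []) ∷ []} (cong₂ _∷_ eC (cong₂ _∷_ eTB refl))) (SHIFT-sem cs (toBinary B7n) fields≡0)
      eT : ⟦ ORDERED-CIRCUIT ⟧ xs [] ≡ encList orderedFields
      eT = trans (CAT₀-sem (APP PRELUDE (SIZE₁ ∷ [])) (APP SHIFT (CIRCUIT ∷ APP TO-BINARY (PRELUDE-SIZE ∷ []) ∷ [])) xs)
        (trans (cong₂ _++_ ePRE eSH) (sym (encList-++ (gatesFields prelude) (shiftFields (toBinary B7n) cs))))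
      eCnt : ⟦ PR (PR SIZE₁) ⟧ xs [] ≡ unary (n ∸ 2)
      eCnt = trans (PR-sem xs [] {a = PR SIZE₁} (PR-sem xs [] {a = SIZE₁} eNU))
        (trans (cong behead (behead-drop 0 (unary n))) (trans (behead-drop 1 (unary n)) (drop-unary 2 n)))
      eFP : ∀ i → ⟦ SHIFTED-COPY ⟧ (unary i ∷ encList orderedFields ∷ unary n ∷ []) [] ≡ enc (encP i)
      eFP i = trans (cong (λ z → ⟦ ENC ⟧ (⟦ SHIFT ⟧ (encList orderedFields ∷ ⟦ TO-BINARY ⟧ (z ∷ []) [] ∷ []) [] ∷ []) []) (MUL-sem i (encList orderedFields) n))
        (trans (cong (λ z → ⟦ ENC ⟧ (⟦ SHIFT ⟧ (encList orderedFields ∷ z ∷ []) [] ∷ []) []) (TO-BINARY-sem (i * n)))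
        (trans (cong (λ z → ⟦ ENC ⟧ (z ∷ []) []) (SHIFT-sem orderedFields (toBinary (i * n)) orderedFields≡0)) (ENC-sem _)))
      e2 : ⟦ APP CopyLoop.FOR (PR (PR SIZE₁) ∷ ORDERED-CIRCUIT ∷ SIZE₁ ∷ []) ⟧ xs [] ≡ encList (range encP 0 (n ∸ 2))
      e2 = trans (cong (λ z → ⟦ CopyLoop.FOR ⟧ z []) (cong₂ (λ a b → a ∷ b) eCnt (cong₂ (λ a b → a ∷ b ∷ []) eT eNU)))
        (trans (CopyLoop.FOR-sem (n ∸ 2) (encList orderedFields ∷ unary n ∷ []))
        (trans (concatRange-cong eFP 0 (n ∸ 2)) (concatRange-enc encP 0 (n ∸ 2))))

  parseCircuit-encP : ∀ i → parseCircuit (encP i) ≡ just (P i)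
  parseCircuit-encP i rewrite decL-encList (shiftFields (toBinary (i * n)) orderedFields) = parse-P i

  parseCircuits-range : ∀ a k → parseCircuits (range encP a k) ≡ just (range P a k)
  parseCircuits-range a zero = refl
  parseCircuits-range a (suc k) rewrite parseCircuit-encP a | parseCircuits-range (suc a) k = refl

  decodeWLC-reduce : decodeWLC (reduce x) ≡ just (length (behead nstr) , range P 0 (n ∸ 2))
  decodeWLC-reduce = trans (cong decodeWLC reduce-sem) (decodeWLC-encList (behead nstr) (range encP 0 (n ∸ 2)) _ (parseCircuits-range 0 (n ∸ 2)))

-- Recovering a Ramsey solution

OTHER-BIT : BC 3 1
OTHER-BIT = APS DROP (APS DROP (S1 (projN zero) ∷ []) (projN (suc zero)) ∷ []) (projN (suc (suc zero)))

LT-STEP0 LT-STEP1 : BC 3 1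
LT-STEP0 = CND OTHER-BIT (projS zero) ONE
LT-STEP1 = CND OTHER-BIT NIL (projS zero)

LT-SCAN : BC 3 0
LT-SCAN = srec NIL LT-STEP0 LT-STEP1

LT : BC 2 0
LT = APP LT-SCAN (projN zero ∷ projN zero ∷ projN (suc zero) ∷ [])

LT-SCAN-sem : ∀ pre suf v → length (pre ++ suf) ≡ length v →
         recEval NIL LT-STEP0 LT-STEP1 suf ((pre ++ suf) ∷ v ∷ []) [] ≡ flag (ltB suf (drop (length pre) v))
LT-SCAN-sem pre [] v e = refl
LT-SCAN-sem pre (c ∷ y) v e = trans (step c) (trans (fin c) (cong (λ w → flag (ltB (c ∷ y) w)) (sym dl)))
  where
    u' = pre ++ (c ∷ y)
    xs = y ∷ u' ∷ v ∷ []
    R = recEval NIL LT-STEP0 LT-STEP1 y (u' ∷ v ∷ []) []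
    vp = lookupD v (length pre)
    rest = drop (suc (length pre)) v
    L = ltB y rest
    assoc : (pre ++ (c ∷ [])) ++ y ≡ u'
    assoc = ++-assoc pre (c ∷ []) y
    lpre : length (pre ++ (c ∷ [])) ≡ suc (length pre)
    lpre = trans (length-++ pre) (+-comm (length pre) 1)
    ih : R ≡ flag L
    ih = trans (cong (λ w → recEval NIL LT-STEP0 LT-STEP1 y (w ∷ v ∷ []) []) (sym assoc))
         (trans (LT-SCAN-sem (pre ++ (c ∷ [])) y v (trans (cong length assoc) e))
                (cong (λ k → flag (ltB y (drop k v))) lpre))
    lu : length u' ≡ length pre + suc (length y)
    lu = length-++ pre
    plt : length pre < length v
    plt = subst (length pre <_) (trans (sym lu) e) (m<m+n (length pre) (s≤s z≤n))
    dl : drop (length pre) v ≡ vp ∷ rest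
    dl = drop-lookupD (length pre) v plt
    vbv : ⟦ OTHER-BIT ⟧ xs (R ∷ []) ≡ vp ∷ rest
    vbv = trans (cong (λ w → ⟦ DROP ⟧ (w ∷ []) (v ∷ [])) (DROP-sem (true ∷ y) u'))
          (trans (DROP-sem (drop (suc (length y)) u') v)
          (trans (cong (λ k → drop k v) (trans (length-drop (suc (length y)) u') (trans (cong (_∸ suc (length y)) lu) (m+n∸n≡m (length pre) (suc (length y))))))
          dl))
    step : ∀ c → recEval NIL LT-STEP0 LT-STEP1 (c ∷ y) (u' ∷ v ∷ []) [] ≡ ⟦ (if c then LT-STEP1 else LT-STEP0) ⟧ xs (R ∷ [])
    step false = refl
    step true = refl
    g0 : ∀ b → branch (b ∷ rest) (flag L) (true ∷ []) ≡ flag (ltB (false ∷ y) (b ∷ rest))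
    g0 false = refl
    g0 true = refl
    g1 : ∀ b → branch (b ∷ rest) [] (flag L) ≡ flag (ltB (true ∷ y) (b ∷ rest))
    g1 false = refl
    g1 true = refl
    fin : ∀ c → ⟦ (if c then LT-STEP1 else LT-STEP0) ⟧ xs (R ∷ []) ≡ flag (ltB (c ∷ y) (vp ∷ rest))
    fin false = trans (CND-sem xs (R ∷ []) {a = OTHER-BIT} {b = projS zero} {c = ONE} vbv ih refl) (g0 vp)
    fin true = trans (CND-sem xs (R ∷ []) {a = OTHER-BIT} {b = NIL} {c = projS zero} vbv refl ih) (g1 vp)

LT-sem : ∀ u v → length u ≡ length v → ⟦ LT ⟧ (u ∷ v ∷ []) [] ≡ flag (ltB u v)
LT-sem u v e = LT-SCAN-sem [] u v e

COUNT₀ : BC 4 0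
COUNT₀ = APP COUNT (projN zero ∷ [])

REMAINING COLOUR-BIT SAME-COLOUR IS-LAST SELECTED : BC 4 0
REMAINING = APS DROP (COUNT₀ ∷ []) (projN (suc zero))
COLOUR-BIT = APS DROP (REMAINING ∷ []) (projN (suc (suc zero)))
SAME-COLOUR = CND COLOUR-BIT (CND (projN (suc (suc (suc zero)))) ONE NIL) (CND (projN (suc (suc (suc zero)))) NIL ONE)
IS-LAST = CND (PR COUNT₀) ONE NIL
SELECTED = CND (PR (PR COUNT₀)) IS-LAST SAME-COLOUR

branch-sameBit : ∀ w b → branch w (branch (flag b) (true ∷ []) []) (branch (flag b) [] (true ∷ [])) ≡ flag (sameBit (headBit w) b)
branch-sameBit [] false = refl
branch-sameBit [] true = refl
branch-sameBit (false ∷ w) false = refl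
branch-sameBit (false ∷ w) true = refl
branch-sameBit (true ∷ w) false = refl
branch-sameBit (true ∷ w) true = refl

branch-selected : ∀ n bs b L → (e : W) → e ≡ flag (sameBit (lookupD bs (n ∸ L)) b) →
        branch (behead (behead (unary L))) (branch (behead (unary L)) (true ∷ []) []) e ≡ flag (selected n bs b L)
branch-selected n bs b zero e p = refl
branch-selected n bs b (suc zero) e p = refl
branch-selected n bs b (suc (suc zero)) e p = refl
branch-selected n bs b (suc (suc (suc L))) e p = p

SELECTED-sem : ∀ w n bs b L → ⟦ COUNT ⟧ (w ∷ []) [] ≡ unary L → ⟦ SELECTED ⟧ (w ∷ unary n ∷ bs ∷ flag b ∷ []) [] ≡ flag (selected n bs b L)
SELECTED-sem w n bs b L eL =
  trans (CND-sem xs [] {a = PR (PR COUNT₀)} {b = IS-LAST} {c = SAME-COLOUR} (PR-sem xs [] {a = PR COUNT₀} (PR-sem xs [] {a = COUNT₀} eTC))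
           (CND-sem xs [] {a = PR COUNT₀} {b = ONE} {c = NIL} (PR-sem xs [] {a = COUNT₀} eTC) refl refl) refl)
        (branch-selected n bs b L (⟦ SAME-COLOUR ⟧ xs []) eEQ)
  where
    xs = w ∷ unary n ∷ bs ∷ flag b ∷ []
    eTC : ⟦ COUNT₀ ⟧ xs [] ≡ unary L
    eTC = eL
    eKU : ⟦ REMAINING ⟧ xs [] ≡ unary (n ∸ L)
    eKU = trans (APS-sem xs [] {h = DROP} {rs = COUNT₀ ∷ []} {a = projN (suc zero)} (cong₂ _∷_ eTC refl) refl)
          (trans (DROP-sem (unary L) (unary n)) (trans (cong (λ k → drop k (unary n)) (length-replicate L)) (drop-unary L n)))
    eBIT : ⟦ COLOUR-BIT ⟧ xs [] ≡ drop (n ∸ L) bs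
    eBIT = trans (APS-sem xs [] {h = DROP} {rs = REMAINING ∷ []} {a = projN (suc (suc zero))} (cong₂ _∷_ eKU refl) refl)
          (trans (DROP-sem (unary (n ∸ L)) bs) (cong (λ k → drop k bs) (length-replicate (n ∸ L))))
    eEQ : ⟦ SAME-COLOUR ⟧ xs [] ≡ flag (sameBit (lookupD bs (n ∸ L)) b)
    eEQ = trans (CND-sem xs [] {a = COLOUR-BIT} {b = CND (projN (suc (suc (suc zero)))) ONE NIL} {c = CND (projN (suc (suc (suc zero)))) NIL ONE}
                  eBIT (CND-sem xs [] {a = projN (suc (suc (suc zero)))} {b = ONE} {c = NIL} refl refl refl)
                       (CND-sem xs [] {a = projN (suc (suc (suc zero)))} {b = NIL} {c = ONE} refl refl refl))
          (trans (branch-sameBit (drop (n ∸ L) bs) b) (cong (λ x → flag (sameBit x b)) (headBit-drop (n ∸ L) bs)))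

SELECTED₁ LT₁ BELOW : BC 5 0
SELECTED₁ = APP SELECTED (projN zero ∷ projN (suc (suc zero)) ∷ projN (suc (suc (suc zero))) ∷ projN (suc (suc (suc (suc zero)))) ∷ [])
LT₁ = APP LT (APP HEAD (projN zero ∷ []) ∷ projN (suc zero) ∷ [])
BELOW = CND SELECTED₁ NIL (CND LT₁ NIL ONE)

branch-∧ : ∀ x y → branch (flag x) [] (branch (flag y) [] (true ∷ [])) ≡ flag (x ∧ y)
branch-∧ false y = refl
branch-∧ true false = refl
branch-∧ true true = refl

module RankMap = MapSuffixes {4} BELOW

RANK : BC 5 0
RANK = APP RankMap.MAP-SUFFIXES (projN (suc zero) ∷ projN zero ∷ projN (suc (suc zero)) ∷ projN (suc (suc (suc zero))) ∷ projN (suc (suc (suc (suc zero)))) ∷ [])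

flag-unary : ∀ x k → flag x ++ unary k ≡ unary (bit x + k)
flag-unary false k = refl
flag-unary true k = refl

module Rank (n : ℕ) (bs : W) (b : Bool) where
  selectedRank : W → List W → ℕ
  selectedRank s0 [] = 0
  selectedRank s0 (s ∷ rest) = bit (selected n bs b (suc (length rest)) ∧ ltB s s0) + selectedRank s0 rest

  BELOW-sem : ∀ s rest s0 → length s ≡ length s0 →
    ⟦ BELOW ⟧ (encList (s ∷ rest) ∷ s0 ∷ unary n ∷ bs ∷ flag b ∷ []) [] ≡ flag (selected n bs b (suc (length rest)) ∧ ltB s s0)
  BELOW-sem s rest s0 e =
    trans (CND-sem xs [] {a = SELECTED₁} {b = NIL} {c = CND LT₁ NIL ONE}
             (trans (APP-sem xs [] {h = SELECTED} {rs = projN zero ∷ projN (suc (suc zero)) ∷ projN (suc (suc (suc zero))) ∷ projN (suc (suc (suc (suc zero)))) ∷ []} refl)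
                    (SELECTED-sem (encList (s ∷ rest)) n bs b (suc (length rest)) (COUNT-sem (s ∷ rest)))) refl
             (CND-sem xs [] {a = LT₁} {b = NIL} {c = ONE}
                (trans (APP-sem xs [] {h = LT} {rs = APP HEAD (projN zero ∷ []) ∷ projN (suc zero) ∷ []} (cong₂ _∷_ (HEAD-sem s (encList rest) (evenLength-encList rest)) refl))
                       (LT-sem s s0 e)) refl refl))
          (branch-∧ (selected n bs b (suc (length rest))) (ltB s s0))
    where xs = encList (s ∷ rest) ∷ s0 ∷ unary n ∷ bs ∷ flag b ∷ []

  RANK-sem : ∀ s0 as → All (λ a → length a ≡ length s0) as →
    ⟦ RANK ⟧ (s0 ∷ encList as ∷ unary n ∷ bs ∷ flag b ∷ []) [] ≡ unary (selectedRank s0 as)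
  RANK-sem s0 as al = trans (RankMap.MAP-SUFFIXES-sem (s0 ∷ unary n ∷ bs ∷ flag b ∷ []) as) (go as al)
    where
      go : ∀ as → All (λ a → length a ≡ length s0) as → RankMap.mapSuffixes (s0 ∷ unary n ∷ bs ∷ flag b ∷ []) as ≡ unary (selectedRank s0 as)
      go [] [] = refl
      go (s ∷ rest) (p ∷ ps) = trans (cong₂ _++_ (BELOW-sem s rest s0 p) (go rest ps)) (flag-unary (selected n bs b (suc (length rest)) ∧ ltB s s0) (selectedRank s0 rest))

ITEM ITEM-RANK RANK-IS ITEM-SELECTED EMIT-IF : BC 6 0
ITEM = APP HEAD (projN zero ∷ [])
ITEM-RANK = APP RANK (ITEM ∷ projN (suc (suc zero)) ∷ projN (suc (suc (suc zero))) ∷ projN (suc (suc (suc (suc zero)))) ∷ projN (suc (suc (suc (suc (suc zero))))) ∷ [])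
RANK-IS = CND (APS DROP (ITEM-RANK ∷ []) (projN (suc zero))) (CND (APS DROP (projN (suc zero) ∷ []) ITEM-RANK) ONE NIL) NIL
ITEM-SELECTED = APP SELECTED (projN zero ∷ projN (suc (suc (suc zero))) ∷ projN (suc (suc (suc (suc zero)))) ∷ projN (suc (suc (suc (suc (suc zero))))) ∷ [])
EMIT-IF = CND ITEM-SELECTED NIL (CND RANK-IS NIL (APP ENC (ITEM ∷ [])))

branch-≡ᵇ : ∀ k r → branch (unary (r ∸ k)) (branch (unary (k ∸ r)) (true ∷ []) []) [] ≡ flag (k ≡ᵇ r)
branch-≡ᵇ zero zero = refl
branch-≡ᵇ zero (suc r) = refl
branch-≡ᵇ (suc k) zero = refl
branch-≡ᵇ (suc k) (suc r) = branch-≡ᵇ k r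

branch-∧-emit : ∀ x y (E : W) → branch (flag x) [] (branch (flag y) [] E) ≡ (if x ∧ y then E else [])
branch-∧-emit false y E = refl
branch-∧-emit true false E = refl
branch-∧-emit true true E = refl

module EmitMap = MapSuffixes {5} EMIT-IF

EMIT-RANK : BC 5 0
EMIT-RANK = APP EmitMap.MAP-SUFFIXES (projN (suc zero) ∷ projN zero ∷ projN (suc zero) ∷ projN (suc (suc zero)) ∷ projN (suc (suc (suc zero))) ∷ projN (suc (suc (suc (suc zero)))) ∷ [])

module EmitRank (n : ℕ) (bs : W) (b : Bool) (N : ℕ) (all : List W) (al : All (λ (a : W) → length a ≡ N) all) where
  open Rank n bs b public

  all-same-length : ∀ (s : W) → length s ≡ N → All (λ (a : W) → length a ≡ length s) all
  all-same-length s e = go all al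
    where
      go : ∀ xs → All (λ (a : W) → length a ≡ N) xs → All (λ (a : W) → length a ≡ length s) xs
      go [] [] = []
      go (x ∷ xs) (p ∷ ps) = trans p (sym e) ∷ go xs ps

  emitRank : ℕ → List W → W
  emitRank r [] = []
  emitRank r (s ∷ rest) = (if selected n bs b (suc (length rest)) ∧ (selectedRank s all ≡ᵇ r) then enc s else []) ++ emitRank r rest

  EMIT-IF-sem : ∀ s rest r → length s ≡ N →
    ⟦ EMIT-IF ⟧ (encList (s ∷ rest) ∷ unary r ∷ encList all ∷ unary n ∷ bs ∷ flag b ∷ []) [] ≡
      (if selected n bs b (suc (length rest)) ∧ (selectedRank s all ≡ᵇ r) then enc s else [])
  EMIT-IF-sem s rest r e =
    trans (CND-sem xs [] {a = ITEM-SELECTED} {b = NIL} {c = CND RANK-IS NIL (APP ENC (ITEM ∷ []))}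
             (trans (APP-sem xs [] {h = SELECTED} {rs = projN zero ∷ projN (suc (suc (suc zero))) ∷ projN (suc (suc (suc (suc zero)))) ∷ projN (suc (suc (suc (suc (suc zero))))) ∷ []} refl)
                    (SELECTED-sem (encList (s ∷ rest)) n bs b (suc (length rest)) (COUNT-sem (s ∷ rest)))) refl
             (CND-sem xs [] {a = RANK-IS} {b = NIL} {c = APP ENC (ITEM ∷ [])} eEQ refl
                (trans (APP-sem xs [] {h = ENC} {rs = ITEM ∷ []} (cong₂ _∷_ eS refl)) (ENC-sem s))))
          (branch-∧-emit (selected n bs b (suc (length rest))) (selectedRank s all ≡ᵇ r) (enc s))
    where
      xs = encList (s ∷ rest) ∷ unary r ∷ encList all ∷ unary n ∷ bs ∷ flag b ∷ []
      k = selectedRank s all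
      eS : ⟦ ITEM ⟧ xs [] ≡ s
      eS = HEAD-sem s (encList rest) (evenLength-encList rest)
      eRK : ⟦ ITEM-RANK ⟧ xs [] ≡ unary k
      eRK = trans (APP-sem xs [] {h = RANK} {rs = ITEM ∷ projN (suc (suc zero)) ∷ projN (suc (suc (suc zero))) ∷ projN (suc (suc (suc (suc zero)))) ∷ projN (suc (suc (suc (suc (suc zero))))) ∷ []}
                 (cong₂ _∷_ eS refl)) (RANK-sem s all (all-same-length s e))
      eEQ : ⟦ RANK-IS ⟧ xs [] ≡ flag (k ≡ᵇ r)
      eEQ = trans (CND-sem xs [] {a = APS DROP (ITEM-RANK ∷ []) (projN (suc zero))} {b = CND (APS DROP (projN (suc zero) ∷ []) ITEM-RANK) ONE NIL} {c = NIL}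
               (trans (APS-sem xs [] {h = DROP} {rs = ITEM-RANK ∷ []} {a = projN (suc zero)} (cong₂ _∷_ eRK refl) refl)
                      (trans (DROP-sem (unary k) (unary r)) (trans (cong (λ z → drop z (unary r)) (length-replicate k)) (drop-unary k r))))
               (CND-sem xs [] {a = APS DROP (projN (suc zero) ∷ []) ITEM-RANK} {b = ONE} {c = NIL}
                  (trans (APS-sem xs [] {h = DROP} {rs = projN (suc zero) ∷ []} {a = ITEM-RANK} refl eRK)
                      (trans (DROP-sem (unary r) (unary k)) (trans (cong (λ z → drop z (unary k)) (length-replicate r)) (drop-unary r k)))) refl refl) refl)
            (branch-≡ᵇ k r)

  EMIT-RANK-sem : ∀ r → ⟦ EMIT-RANK ⟧ (unary r ∷ encList all ∷ unary n ∷ bs ∷ flag b ∷ []) [] ≡ emitRank r all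
  EMIT-RANK-sem r = trans (EmitMap.MAP-SUFFIXES-sem (unary r ∷ encList all ∷ unary n ∷ bs ∷ flag b ∷ []) all) (go all al)
    where
      go : ∀ xs → All (λ (a : W) → length a ≡ N) xs → EmitMap.mapSuffixes (unary r ∷ encList all ∷ unary n ∷ bs ∷ flag b ∷ []) xs ≡ emitRank r xs
      go [] [] = refl
      go (s ∷ rest) (p ∷ ps) = cong₂ _++_ (EMIT-IF-sem s rest r p) (go rest ps)

COUNT-TRUE COUNT-FALSE : BC 1 0
COUNT-TRUE = srec NIL (projS zero) (S1 (projS zero))
COUNT-FALSE = srec NIL (S1 (projS zero)) (projS zero)

COUNT-TRUE-sem : ∀ w → ⟦ COUNT-TRUE ⟧ (w ∷ []) [] ≡ unary (countTrue w)
COUNT-TRUE-sem [] = refl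
COUNT-TRUE-sem (true ∷ w) = cong (true ∷_) (COUNT-TRUE-sem w)
COUNT-TRUE-sem (false ∷ w) = COUNT-TRUE-sem w

COUNT-FALSE-sem : ∀ w → ⟦ COUNT-FALSE ⟧ (w ∷ []) [] ≡ unary (countFalse w)
COUNT-FALSE-sem [] = refl
COUNT-FALSE-sem (true ∷ w) = COUNT-FALSE-sem w
COUNT-FALSE-sem (false ∷ w) = cong (true ∷_) (COUNT-FALSE-sem w)

COLOURS ITEMS MAJORITY EMIT-SORTED RECOVER : BC 2 0
COLOURS = APP HEAD (projN (suc zero) ∷ [])
ITEMS = APP TAIL (projN (suc zero) ∷ [])
MAJORITY = CND (APS DROP (APP COUNT-TRUE (COLOURS ∷ []) ∷ []) (APP COUNT-FALSE (COLOURS ∷ []))) ONE NIL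

module SortLoop = Countup {4} EMIT-RANK

EMIT-SORTED = APP SortLoop.FOR (SIZE₁ ∷ ITEMS ∷ SIZE₁ ∷ COLOURS ∷ MAJORITY ∷ [])
RECOVER = CND (PR SIZE₁) (APP ENC (SIZE ∷ [])) EMIT-SORTED

recover : W → W → W
recover u y = ⟦ RECOVER ⟧ (u ∷ y ∷ []) []

branch-isZero : ∀ k → branch (unary k) (true ∷ []) [] ≡ flag (isZero k)
branch-isZero zero = refl
branch-isZero (suc k) = refl

module RecoverSpec (nstr cstr : W) (y : W) where
  u = encList (nstr ∷ cstr ∷ [])
  n = length nstr
  xs : Vec W 2
  xs = u ∷ y ∷ []

  eN : ⟦ SIZE ⟧ xs [] ≡ nstr
  eN = HEAD-sem nstr (encList (cstr ∷ [])) (evenLength-encList (cstr ∷ []))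
  eNU : ⟦ SIZE₁ ⟧ xs [] ≡ unary n
  eNU = trans (APP-sem xs [] {h = ONES} {rs = SIZE ∷ []} (cong₂ _∷_ eN refl)) (ONES-sem nstr)

  recover-small : n ≤ 1 → recover u y ≡ enc nstr
  recover-small le = trans (CND-sem xs [] {a = PR SIZE₁} {b = APP ENC (SIZE ∷ [])} {c = EMIT-SORTED} (PR-sem xs [] {a = SIZE₁} eNU)
                        (trans (APP-sem xs [] {h = ENC} {rs = SIZE ∷ []} (cong₂ _∷_ eN refl)) (ENC-sem nstr)) refl)
                  (sm n le)
    where
      sm : ∀ k → k ≤ 1 → branch (behead (unary k)) (enc nstr) (⟦ EMIT-SORTED ⟧ xs []) ≡ enc nstr
      sm zero _ = refl
      sm (suc zero) _ = refl
      sm (suc (suc k)) (s≤s ())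

  module _ (bs : W) (as : List W) (ey : y ≡ encList (bs ∷ as)) (al : All (λ (a : W) → length a ≡ n) as) where
    open EmitRank n bs (majorityBit bs) n as al

    eBS : ⟦ COLOURS ⟧ xs [] ≡ bs
    eBS = trans (APP-sem xs [] {h = HEAD} {rs = projN (suc zero) ∷ []} (cong₂ _∷_ ey refl)) (HEAD-sem bs (encList as) (evenLength-encList as))
    eAS : ⟦ ITEMS ⟧ xs [] ≡ encList as
    eAS = trans (APP-sem xs [] {h = TAIL} {rs = projN (suc zero) ∷ []} (cong₂ _∷_ ey refl)) (TAIL-sem bs (encList as) (evenLength-encList as))
    eB : ⟦ MAJORITY ⟧ xs [] ≡ flag (majorityBit bs)
    eB = trans (CND-sem xs [] {a = APS DROP (APP COUNT-TRUE (COLOURS ∷ []) ∷ []) (APP COUNT-FALSE (COLOURS ∷ []))} {b = ONE} {c = NIL}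
                (trans (APS-sem xs [] {h = DROP} {rs = APP COUNT-TRUE (COLOURS ∷ []) ∷ []} {a = APP COUNT-FALSE (COLOURS ∷ [])}
                         (cong₂ _∷_ (trans (APP-sem xs [] {h = COUNT-TRUE} {rs = COLOURS ∷ []} (cong₂ _∷_ eBS refl)) (COUNT-TRUE-sem bs)) refl)
                         (trans (APP-sem xs [] {h = COUNT-FALSE} {rs = COLOURS ∷ []} (cong₂ _∷_ eBS refl)) (COUNT-FALSE-sem bs)))
                  (trans (DROP-sem (unary (countTrue bs)) (unary (countFalse bs))) (trans (cong (λ k → drop k (unary (countFalse bs))) (length-replicate (countTrue bs))) (drop-unary (countTrue bs) (countFalse bs)))))
                refl refl)
          (branch-isZero (countFalse bs ∸ countTrue bs))

    eMAIN : ⟦ EMIT-SORTED ⟧ xs [] ≡ concatRange (λ r → emitRank r as) 0 n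
    eMAIN = trans (APP-sem xs [] {h = SortLoop.FOR} {rs = SIZE₁ ∷ ITEMS ∷ SIZE₁ ∷ COLOURS ∷ MAJORITY ∷ []}
                    (cong₂ _∷_ eNU (cong₂ _∷_ eAS (cong₂ _∷_ eNU (cong₂ _∷_ eBS (cong₂ _∷_ eB refl))))))
            (trans (SortLoop.FOR-sem n (encList as ∷ unary n ∷ bs ∷ flag (majorityBit bs) ∷ []))
                   (concatRange-cong (λ r → EMIT-RANK-sem r) 0 n))

    recover-sem : 2 ≤ n → recover u y ≡ concatRange (λ r → emitRank r as) 0 n
    recover-sem le = trans (CND-sem xs [] {a = PR SIZE₁} {b = APP ENC (SIZE ∷ [])} {c = EMIT-SORTED} (PR-sem xs [] {a = SIZE₁} eNU) refl eMAIN)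
                  (bg n le)
      where
        bg : ∀ k → 2 ≤ k → branch (behead (unary k)) (⟦ APP ENC (SIZE ∷ []) ⟧ xs []) (concatRange (λ r → emitRank r as) 0 n) ≡ concatRange (λ r → emitRank r as) 0 n
        bg (suc (suc k)) _ = refl
        bg (suc zero) (s≤s ())

module Selection (n : ℕ) (bs : W) (b : Bool) (as : List W) (al : All (λ (a : W) → length a ≡ n) as) where
  open EmitRank n bs b n as al public

  isSelected : ℕ → Bool
  isSelected = selected n bs b

  select : List W → List W
  select [] = []
  select (s ∷ rest) = if isSelected (suc (length rest)) then s ∷ select rest else select rest

  All-select : ∀ {P : W → Set} xs → All P xs → All P (select xs)
  All-select [] [] = []
  All-select (s ∷ rest) (p ∷ ps) with isSelected (suc (length rest))
  ... | true = p ∷ All-select rest ps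
  ... | false = All-select rest ps

  AllPairs-select : ∀ {R : W → W → Set} xs → AllPairs R xs → AllPairs R (select xs)
  AllPairs-select [] [] = []
  AllPairs-select (s ∷ rest) (p ∷ ps) with isSelected (suc (length rest))
  ... | true = All-select rest p ∷ AllPairs-select rest ps
  ... | false = AllPairs-select rest ps

  S : List W
  S = select as

  selectedRank-rank : ∀ s0 xs → selectedRank s0 xs ≡ rank s0 (select xs)
  selectedRank-rank s0 [] = refl
  selectedRank-rank s0 (s ∷ rest) with isSelected (suc (length rest))
  ... | true = cong (bit (ltB s s0) +_) (selectedRank-rank s0 rest)
  ... | false = selectedRank-rank s0 rest

  countSelected : ℕ → ℕ
  countSelected zero = 0
  countSelected (suc L) = bit (isSelected (suc L)) + countSelected L

  length-select≤ : ∀ xs → length (select xs) ≤ length xs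
  length-select≤ [] = z≤n
  length-select≤ (s ∷ rest) with isSelected (suc (length rest))
  ... | true = s≤s (length-select≤ rest)
  ... | false = ≤-trans (length-select≤ rest) (n≤1+n _)

  length-select : ∀ xs → length (select xs) ≡ countSelected (length xs)
  length-select [] = refl
  length-select (s ∷ rest) with isSelected (suc (length rest))
  ... | true = cong suc (length-select rest)
  ... | false = length-select rest

  module Distinct (dAs : AllPairs (λ x y → ¬ (x ≡ y)) as) where
    open SortByRank n S (All-select as al) (AllPairs-select as dAs) public

    emitRank-bucket : ∀ r xs → emitRank r xs ≡ encList (keep (λ x → rk x ≡ᵇ r) (select xs))
    emitRank-bucket r [] = refl
    emitRank-bucket r (s ∷ rest) with isSelected (suc (length rest))
    ... | false = emitRank-bucket r rest
    ... | true rewrite selectedRank-rank s as with rank s S ≡ᵇ r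
    ...   | true = trans (cong (enc s ++_) (emitRank-bucket r rest)) (enc-++ s _)
    ...   | false = emitRank-bucket r rest

    emitRanks-sortedList : ∀ k → concatRange (λ r → emitRank r as) 0 k ≡ encList (sortedList k)
    emitRanks-sortedList k = go 0 k
      where
        go : ∀ a k → concatRange (λ r → emitRank r as) a k ≡ encList (concatRange bucket a k)
        go a zero = refl
        go a (suc k) = trans (cong₂ _++_ (emitRank-bucket a as) (go (suc a) k)) (sym (encList-++ (bucket a) (concatRange bucket (suc a) k)))

  hasColour : ℕ → ℕ
  hasColour k = bit (sameBit (lookupD bs k) b)

  sumRange-shift : ∀ (f : ℕ → ℕ) a L → sumRange f (suc a) L ≡ sumRange (λ k → f (suc k)) a L
  sumRange-shift f a zero = refl
  sumRange-shift f a (suc L) = cong (f (suc a) +_) (sumRange-shift f (suc a) L)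

  sumRange-count : ∀ w → sumRange (λ k → bit (sameBit (lookupD w k) b)) 0 (length w) ≡ count b w
  sumRange-count [] = refl
  sumRange-count (x ∷ w) = cong (bit (sameBit x b) +_) (trans (sumRange-shift (λ k → bit (sameBit (lookupD (x ∷ w) k) b)) 0 (length w)) (sumRange-count w))

  module Size (m : ℕ) (en : n ≡ suc (suc m)) (la : length as ≡ n) where
    countSelected-sumRange : ∀ L → L ≤ m → countSelected (suc (suc L)) ≡ suc (sumRange hasColour (m ∸ L) L)
    countSelected-sumRange zero p = refl
    countSelected-sumRange (suc L) p =
      trans (cong₂ (λ u v → bit (sameBit (lookupD bs u) b) + v) (cong (_∸ suc (suc (suc L))) en) (countSelected-sumRange L (≤-trans (n≤1+n L) p)))
      (trans (+-suc (hasColour (m ∸ suc L)) (sumRange hasColour (m ∸ L) L))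
        (cong (λ z → suc (hasColour (m ∸ suc L) + sumRange hasColour z L)) (+-∸-assoc 1 {m} {suc L} p)))

    length-selection : length bs ≡ m → length S ≡ suc (count b bs)
    length-selection lb = trans (length-select as) (trans (cong countSelected (trans la en)) (trans (countSelected-sumRange m ≤-refl)
      (cong suc (trans (cong (λ z → sumRange hasColour z m) (n∸n≡0 m)) (trans (cong (sumRange hasColour 0) (sym lb)) (sumRange-count bs))))))

  sameBit-true : ∀ x y → sameBit x y ≡ true → x ≡ y
  sameBit-true false false p = refl
  sameBit-true true true p = refl
  sameBit-true false true ()
  sameBit-true true false ()

  module Homogeneous (C : Circuit) (m : ℕ) (en : n ≡ suc (suc m)) (la : length as ≡ n)
             (colour-of-edges : ∀ i j → i < j → j < n → i < m → edgeColour C (nth as i) (nth as j) ≡ lookupD bs i) where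
    R : W → W → Set
    R x y = edgeColour C x y ≡ b

    select-homogeneous : ∀ k xs → drop k as ≡ xs → AllPairs R (select xs)
    select-homogeneous k [] e = []
    select-homogeneous k (s ∷ rest) e with drop-∷ as k e
    ... | (ns , dr) with isSelected (suc (length rest)) in es
    ...   | false = select-homogeneous (suc k) rest dr
    ...   | true = All-select rest (allR rest dr es) ∷ select-homogeneous (suc k) rest dr
      where
        lenx : suc (length rest) ≡ n ∸ k
        lenx = trans (sym (cong length e)) (trans (length-drop k as) (cong (_∸ k) la))
        allR : ∀ r → drop (suc k) as ≡ r → isSelected (suc (length r)) ≡ true → All (R s) r
        allR [] _ _ = []
        allR (t ∷ []) _ ()
        allR (t ∷ t' ∷ r'') dr' es' = subst (All (R s)) dr' (All-drop as (suc k) (λ j p q → trans (cong (λ z → edgeColour C z (nth as j)) (sym ns))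
             (trans (colour-of-edges k j p (subst (j <_) la q) k<m) bk)))
          where
            L = suc (length (t ∷ t' ∷ r''))
            eL : L ≡ n ∸ k
            eL = trans (cong (λ z → suc (length z)) (sym dr')) (trans (cong (λ z → suc (length z)) dr) lenx)
            k<n : k < n
            k<n = m∸n≢0⇒n<m (λ z → 1+n≢0 (trans eL z))
            nL : n ∸ L ≡ k
            nL = trans (cong (n ∸_) eL) (m∸[m∸n]≡n (<⇒≤ k<n))
            bk : lookupD bs k ≡ b
            bk = subst (λ z → lookupD bs z ≡ b) nL (sameBit-true _ _ es')
            k<m : k < m
            k<m = ≤-pred (≤-pred (subst (suc (suc (suc k)) ≤_) (trans kL en) ineq))
              where
                kL : k + L ≡ n
                kL = trans (cong (k +_) eL) (m+[n∸m]≡n (<⇒≤ k<n))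
                r = length r''
                ineq : suc (suc (suc k)) ≤ k + L
                ineq = subst (suc (suc (suc k)) ≤_) (sym (trans (+-suc k _) (cong suc (trans (+-suc k _) (cong suc (+-suc k r))))))
                         (s≤s (s≤s (s≤s (m≤m+n k r))))

decodeRamsey-just : ∀ x n C → decodeRamsey x ≡ just (n , C) →
  Σ[ nstr ∈ W ] Σ[ cstr ∈ W ] (decL x ≡ just (nstr ∷ cstr ∷ []) × parseCircuit cstr ≡ just C × n ≡ length nstr)
decodeRamsey-just x n C e with decL x
... | just (nstr ∷ cstr ∷ []) with parseCircuit cstr in ep
...   | just C' with e
...     | refl = nstr , cstr , refl , ep , refl
decodeRamsey-just x n C () | just (nstr ∷ cstr ∷ []) | nothing
decodeRamsey-just x n C () | nothing
decodeRamsey-just x n C () | just []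
decodeRamsey-just x n C () | just (_ ∷ [])
decodeRamsey-just x n C () | just (_ ∷ _ ∷ _ ∷ _)

parseCircuit-just : ∀ w C → parseCircuit w ≡ just C → Σ[ cs ∈ List W ] (decL w ≡ just cs × parseGates cs ≡ just C)
parseCircuit-just w C e with decL w
... | just cs = cs , refl , e
parseCircuit-just w C () | nothing

wlcSolution : ∀ x y {n Ps} → decodeWLC x ≡ just (n , Ps) → WeakLongChoice x y → suc (length Ps) ≡ n → WLCSolFor n Ps y
wlcSolution x y e h with decodeWLC x | e
... | just _ | refl = h

module Correctness (nstr : W) (cs : List W) (C : Circuit) (pc : parseGates cs ≡ just C) where
  open ReduceSpec nstr cs C pc

  small-solution : n ≤ 1 → ∀ y → RamseySolFor n C (recover x y)
  small-solution le y = (nstr ∷ []) , trans (cong decL (RecoverSpec.recover-small nstr (encList cs) y le)) (decL-encList (nstr ∷ [])) ,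
               (refl ∷ []) , ([] ∷ []) , ≤-trans le (s≤s z≤n) , true , ([] ∷ [])

  edge-query : ∀ m → n ≡ suc (suc m) → ∀ (as : List W) → All (λ (a : W) → length a ≡ n) as → length as ≡ n →
        ∀ i j → i < n → j < n →
        evalC (P i) (concat (take (suc i) as) ++ nth as j) ≡ edgeColour C (nth as i) (nth as j)
  edge-query m en as al la i j i<n j<n with nonempty (nth as i) (suc m) (trans (All-nth as i al (subst (i <_) (sym la) i<n)) en)
  ... | a0 , ai' , eai =
    begin
      evalC (P i) (concat (take (suc i) as) ++ aj)
        ≡⟨ cong (λ z → evalC (P i) (z ++ aj)) (concat-take-suc as i (subst (i <_) (sym la) i<n)) ⟩
      evalC (P i) ((pre ++ ai) ++ aj)
        ≡⟨ cong (evalC (P i)) (++-assoc pre ai aj) ⟩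
      evalC (map (shiftGate (i * n)) T) (pre ++ (ai ++ aj))
        ≡⟨ cong (λ k → evalC (map (shiftGate k) T) (pre ++ (ai ++ aj))) (sym lpre) ⟩
      evalC (map (shiftGate (length pre)) T) (pre ++ (ai ++ aj))
        ≡⟨ cong (λ z → evalC (map (shiftGate (length pre)) T) (pre ++ (z ++ aj))) eai ⟩
      evalC (map (shiftGate (length pre)) T) (pre ++ (a0 ∷ (ai' ++ aj)))
        ≡⟨ evalC-shiftGate pre a0 (ai' ++ aj) T ⟩
      evalC T ((a0 ∷ ai') ++ aj)
        ≡⟨ cong (λ z → evalC T (z ++ aj)) (sym eai) ⟩
      evalC (Prelude.withPrelude n C) (ai ++ aj)
        ≡⟨ cong (λ k → evalC (Prelude.withPrelude k C) (ai ++ aj)) en ⟩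
      evalC (Prelude.withPrelude (suc (suc m)) C) (ai ++ aj)
        ≡⟨ PreludeSem.withPrelude-sem ai aj (suc m) (trans (All-nth as i al (subst (i <_) (sym la) i<n)) en) (trans (All-nth as j al (subst (j <_) (sym la) j<n)) en) C ⟩
      evalC C (if ltB ai aj then ai ++ aj else aj ++ ai) ∎
    where
      open ≡-Reasoning
      ai = nth as i
      aj = nth as j
      pre = concat (take i as)
      T = Prelude.withPrelude n C
      lpre : length pre ≡ i * n
      lpre = length-concat-take n as i al (<⇒≤ (subst (i <_) (sym la) i<n))

  Ps : List Circuit
  Ps = range P 0 (n ∸ 2)

  length-Ps : ∀ m → n ≡ suc (suc m) → suc (length Ps) ≡ length (behead nstr)
  length-Ps m en = trans (cong suc (trans (length-range P 0 (n ∸ 2)) (cong (_∸ 2) en))) (sym (trans (length-behead nstr) (cong (_∸ 1) en)))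

  module LargeInstance (m : ℕ) (en : n ≡ suc (suc m)) (y : W) (bs : W) (as : List W) (ey : decL y ≡ just (bs ∷ as))
             (lbs0 : length bs ≡ length (behead nstr) ∸ 1) (las0 : length as ≡ suc (length (behead nstr)))
             (al0 : All (λ (a : W) → length a ≡ suc (length (behead nstr))) as)
             (dAs : AllPairs (λ u v → ¬ (u ≡ v)) as)
             (hyp : ∀ (i : Fin (length Ps)) (j : Fin (length as)) → toℕ i < toℕ j →
                      evalC (List.lookup Ps i) (concat (take (suc (toℕ i)) as) ++ List.lookup as j) ≡ lookupD bs (toℕ i)) where
    nt-eq : length (behead nstr) ≡ suc m
    nt-eq = trans (length-behead nstr) (cong (_∸ 1) en)

    lbs : length bs ≡ m
    lbs = trans lbs0 (cong (_∸ 1) nt-eq)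
    la : length as ≡ n
    la = trans las0 (trans (cong suc nt-eq) (sym en))

    al : All (λ (a : W) → length a ≡ n) as
    al = All.map (λ e → trans e (trans (cong suc nt-eq) (sym en))) al0

    b : Bool
    b = majorityBit bs

    open Selection n bs b as al
    open Distinct dAs

    colour-of-edges : ∀ i j → i < j → j < n → i < m → edgeColour C (nth as i) (nth as j) ≡ lookupD bs i
    colour-of-edges i j i<j j<n i<m =
      trans (sym (edge-query m en as al la i j (<-trans i<j j<n) j<n))
      (trans (cong₂ (λ P z → evalC P (concat (take (suc i) as) ++ z)) (sym eP') (sym eA))
      (trans (cong (λ k → evalC (List.lookup Ps fi) (concat (take (suc k) as) ++ List.lookup as fj)) (sym ti))
      (trans (hyp fi fj (subst₂ _<_ (sym ti) (sym tj) i<j)) (cong (lookupD bs) ti))))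
      where
        i<P : i < length Ps
        i<P = subst (i <_) (sym (trans (length-range P 0 (n ∸ 2)) (cong (_∸ 2) en))) i<m
        j<A : j < length as
        j<A = subst (j <_) (sym la) j<n
        fi = fromℕ< i<P
        fj = fromℕ< j<A
        ti : toℕ fi ≡ i
        ti = toℕ-fromℕ< i<P
        tj : toℕ fj ≡ j
        tj = toℕ-fromℕ< j<A
        eP' : List.lookup Ps fi ≡ P i
        eP' = trans (lookup-range P 0 (n ∸ 2) fi) (cong P ti)
        eA : List.lookup as fj ≡ nth as j
        eA = trans (lookup-nth as fj) (cong (nth as) tj)

    y≡enc : y ≡ encList (bs ∷ as)
    y≡enc = decL-injective y (bs ∷ as) ey

    recover≡sorted : recover x y ≡ encList (sortedList n)
    recover≡sorted = trans (cong (recover x) y≡enc)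
         (trans (RecoverSpec.recover-sem nstr (encList cs) (encList (bs ∷ as)) bs as refl al (subst (2 ≤_) (sym en) (s≤s (s≤s z≤n))))
                (emitRanks-sortedList n))

    length-sorted : length (sortedList n) ≡ suc (count b bs)
    length-sorted = trans (length-sortedList n (subst (length S ≤_) la (length-select≤ as))) (Size.length-selection m en la lbs)

    size-bound : n ≤ 2 * length (sortedList n)
    size-bound = subst (n ≤_) (sym (cong (2 *_) length-sorted))
      (subst (_≤ 2 * suc (count b bs)) (sym en)
        (subst (suc (suc m) ≤_) (sym (*-suc 2 (count b bs))) (s≤s (s≤s (subst (_≤ 2 * count b bs) lbs (majority-count bs))))))

    selection-homogeneous : AllPairs (λ u v → edgeColour C u v ≡ b) S
    selection-homogeneous = Homogeneous.select-homogeneous C m en la colour-of-edges 0 as refl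

    edge-homogeneous : ∀ {u v} → u ∈ S → v ∈ S → ltB u v ≡ true → evalC C (u ++ v) ≡ b
    edge-homogeneous {u} {v} mu mv p = [ forward , backward ]′ (AllPairs-either S selection-homogeneous mu mv (ltB⇒≢ p))
      where
        forward : edgeColour C u v ≡ b → evalC C (u ++ v) ≡ b
        forward r = trans (cong (λ c → evalC C (if c then u ++ v else v ++ u)) (sym p)) r
        backward : edgeColour C v u ≡ b → evalC C (u ++ v) ≡ b
        backward r = trans (cong (λ c → evalC C (if c then v ++ u else u ++ v)) (sym (ltB-asym u v p))) r

    sorted⊆selection : All (_∈ S) (sortedList n)
    sorted⊆selection = All.tabulate (∈sorted n)

    ramsey-solution : RamseySolFor n C (recover x y)
    ramsey-solution = sortedList n , trans (cong decL recover≡sorted) (decL-encList (sortedList n)) ,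
             All.tabulate (λ m → All.lookup (All-select as al) (∈sorted n m)) ,
             AP.map (λ {u} {v} p → ltB⇒<ₗ u v p) (sorted 0 n) ,
             size-bound , b ,
             AllPairs-map-All (sortedList n) sorted⊆selection (sorted 0 n) edge-homogeneous

  large-solution : ∀ m → n ≡ suc (suc m) → ∀ y → WeakLongChoice (reduce x) y → RamseySolFor n C (recover x y)
  large-solution m en y h = go (wlcSolution (reduce x) y decodeWLC-reduce h (length-Ps m en))
    where
      go : WLCSolFor (length (behead nstr)) Ps y → RamseySolFor n C (recover x y)
      go (bs , as , ey , lbs0 , las0 , al0 , dAs , hyp) = LargeInstance.ramsey-solution m en y bs as ey lbs0 las0 al0 dAs hyp

  solution-by-size : ∀ k → n ≡ k → ∀ y → WeakLongChoice (reduce x) y → RamseySolFor n C (recover x y)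
  solution-by-size zero e y h = small-solution (subst (_≤ 1) (sym e) z≤n) y
  solution-by-size (suc zero) e y h = small-solution (subst (_≤ 1) (sym e) (s≤s z≤n)) y
  solution-by-size (suc (suc m)) e y h = large-solution m e y h

  solution : ∀ y → WeakLongChoice (reduce x) y → RamseySolFor n C (recover x y)
  solution = solution-by-size n refl

ramsey-malformed : ∀ x y → decodeRamsey x ≡ nothing → Ramsey x y
ramsey-malformed x y e with decodeRamsey x | e
... | nothing | refl = tt

ramsey-wellformed : ∀ x y {n C} → decodeRamsey x ≡ just (n , C) → RamseySolFor n C y → Ramsey x y
ramsey-wellformed x y e s with decodeRamsey x | e
... | just _ | refl = s

wellformed-solution : ∀ u y n C → decodeRamsey u ≡ just (n , C) → WeakLongChoice (reduce u) y → RamseySolFor n C (recover u y)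
wellformed-solution u y n C e h = go (decodeRamsey-just u n C e)
  where
    go2 : ∀ nstr cstr → decL u ≡ just (nstr ∷ cstr ∷ []) → n ≡ length nstr →
          Σ[ cs ∈ List W ] (decL cstr ≡ just cs × parseGates cs ≡ just C) → RamseySolFor n C (recover u y)
    go2 nstr cstr e1 e3 (cs , e4 , pc) =
      subst (λ w → RamseySolFor n C (recover w y)) (sym eu)
        (subst (λ k → RamseySolFor k C (recover (encList (nstr ∷ encList cs ∷ [])) y)) (sym e3)
          (Correctness.solution nstr cs C pc y (subst (λ w → WeakLongChoice (reduce w) y) eu h)))
      where
        eu : u ≡ encList (nstr ∷ encList cs ∷ [])
        eu = trans (decL-injective u (nstr ∷ cstr ∷ []) e1) (cong (λ c → encList (nstr ∷ c ∷ [])) (decL-injective cstr cs e4))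
    go : Σ[ nstr ∈ W ] Σ[ cstr ∈ W ] (decL u ≡ just (nstr ∷ cstr ∷ []) × parseCircuit cstr ≡ just C × n ≡ length nstr) →
         RamseySolFor n C (recover u y)
    go (nstr , cstr , e1 , e2 , e3) = go2 nstr cstr e1 e3 (parseCircuit-just cstr C e2)

recover-correct : ∀ u y → WeakLongChoice (reduce u) y → ∀ d → decodeRamsey u ≡ d → Ramsey u (recover u y)
recover-correct u y h nothing e = ramsey-malformed u (recover u y) e
recover-correct u y h (just (n , C)) e = ramsey-wellformed u (recover u y) e (wellformed-solution u y n C e h)

lemma7p12 : Ramsey ≤ₘ WeakLongChoice
lemma7p12 = reduce , recover , (REDUCTION , λ x → refl) , (RECOVER , λ x y → refl) , (λ u y h → recover-correct u y h (decodeRamsey u) refl)
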